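{- Let $n \ge 2$ and let $m$ be an integer with $3 \le m \le n-1$. Let $T$ be a subgraph of $K_n$ isomorphic to the tadpole graph $T_{m,1}$, and let $G$ be the graph on the same $n$ vertices obtained from $K_n$ by deleting the edges of $T$. Then $G$ has a path decomposition consisting of at most $\left\lfloor \frac{n+1}{2} \right\rfloor$ paths.
   Context: The tadpole graph $T_{m,1}$ ($m \ge 3$) is the graph obtained from a cycle $C_m$ by joining one vertex of the cycle by a single edge to a new vertex (so it has $m+1$ vertices and $m+1$ edges). A path decomposition of a graph $G$ is a collection of paths (subgraphs of $G$) such that every edge of $G$ belongs to exactly one path in the collection. -}

module Defs where

open import Data.Nat using (ℕ; zero; suc; _+_; _≤_; _<_; _∸_)
open import Data.Nat.DivMod using (_/_)
open import Data.Fin using (Fin; toℕ; fromℕ<; inject₁; fromℕ)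
open import Data.List using (List; []; _∷_)
open import Data.List.Relation.Unary.Unique.Propositional using (Unique)
open import Data.List.Relation.Unary.Linked using (Linked)
open import Data.Product using (Σ; _×_; _,_)
open import Data.Sum using (_⊎_)
open import Relation.Binary.PropositionalEquality using (_≡_)
open import Relation.Nullary using (¬_)
open import Function.Definitions using (Injective)

Graph : ℕ → Set₁
Graph n = Fin n → Fin n → Set

-- Cycle vertices: f 0, …, f (m-1) (cycle edges
-- {f i, f (i+1 mod m)}); pendant vertex f m, joined to f 0.
data TEdge {n m : ℕ} (f : Fin (suc m) → Fin n) : Fin n → Fin n → Set where
  cyc   : (i : ℕ) (i+1<m : suc i < m) (p : i < suc m) (q : suc i < suc m) →
          TEdge f (f (fromℕ< p)) (f (fromℕ< q))
  close : (p : m ∸ 1 < suc m) (z : 0 < suc m) →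
          TEdge f (f (fromℕ< p)) (f (fromℕ< z))
  pend  : (z : 0 < suc m) → TEdge f (f (fromℕ< z)) (f (fromℕ m))

TAdj : {n m : ℕ} → (Fin (suc m) → Fin n) → Graph n
TAdj f u v = TEdge f u v ⊎ TEdge f v u

KminusT : {n m : ℕ} → (Fin (suc m) → Fin n) → Graph n
KminusT f u v = ¬ (u ≡ v) × ¬ (TAdj f u v)

IsPath : {n : ℕ} → Graph n → List (Fin n) → Set
IsPath G vs = Unique vs × Linked G vs

data EdgeIn {n : ℕ} (u v : Fin n) : List (Fin n) → Set where
  here  : ∀ {x y xs} → (x ≡ u × y ≡ v) ⊎ (x ≡ v × y ≡ u) → EdgeIn u v (x ∷ y ∷ xs)
  there : ∀ {x xs} → EdgeIn u v xs → EdgeIn u v (x ∷ xs)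

IsPathDecomposition : {n : ℕ} → Graph n → (k : ℕ) → (Fin k → List (Fin n)) → Set
IsPathDecomposition {n} G k P =
  ((i : Fin k) → IsPath G (P i)) ×
  ((u v : Fin n) → G u v →
     Σ (Fin k) λ i → EdgeIn u v (P i) × ((j : Fin k) → EdgeIn u v (P j) → j ≡ i))

-- After relabelling, the tadpole may be placed anywhere, and the proof is an explicit
-- construction built on Walecki's decomposition of K_{2k+1} into k Hamiltonian cycles.
-- For n = 2k + 1 the tadpole is placed so that it meets every cycle it touches in a single
-- stretch, so those cycles lose one segment each and stay paths; each untouched cycle is
-- opened by deleting one edge {x, x+1}, and these deleted edges line up into one more path:
-- k + 1 = ⌊(n+1)/2⌋ paths.  For n = 2k + 2 the new vertex is the pendant vertex, and is
-- threaded through the opened cycles to absorb its remaining edges; K_4 is done by hand.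
module Submission where

open import Defs
open import Data.Nat using (ℕ; zero; suc; _+_; _*_; _∸_; _≤_; _<_; z≤n; s≤s; _≤?_)
open import Data.Nat.Properties using (≤-trans; ≤-reflexive; ≤-refl; ≤-pred; n≤1+n; ≤-antisym; <⇒≤; <⇒≱; ≮⇒≥; ≰⇒>; +-suc; +-comm; +-assoc; +-mono-≤; +-cancelˡ-≤; m+[n∸m]≡n)
open import Data.Nat.DivMod using (_/_; m*n/n≡m; /-monoˡ-≤)
open import Data.Fin using (Fin)
open import Data.List using (List)
open import Data.Product using (Σ; _×_; _,_; proj₁; proj₂)
open import Data.Sum using (_⊎_; inj₁; inj₂)
open import Data.Empty using (⊥-elim)
open import Relation.Nullary using (yes; no)
open import Function.Definitions using (Injective)
open import Relation.Binary.PropositionalEquality using (_≡_; refl; sym; trans; cong; subst)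
open import Data.Nat.Tactic.RingSolver using (solve-∀)

module Relabelling where

  open import Data.Nat using (ℕ; zero; suc; _∸_; _≤_; _<_; z≤n; s≤s; NonZero)
  open import Data.Nat.Properties using (≤-trans; ≤-refl; ≤-pred; <⇒≤; n≤1+n; m∸n≤m)
  open import Data.Nat.DivMod using (_mod_; m<n⇒m%n≡m)
  open import Data.Fin using (Fin; toℕ; fromℕ<; fromℕ) renaming (zero to fzero; suc to fsuc)
  open import Data.Fin.Properties using (toℕ-fromℕ<; toℕ-fromℕ; toℕ-injective; toℕ<n; suc-injective)
  import Data.Fin.Properties as Fin
  open import Data.Fin.Permutation using (Permutation′; _⟨$⟩ʳ_; _⟨$⟩ˡ_; _∘ₚ_; inverseʳ; transpose; id)
  open import Data.List using (List; []; _∷_; map)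
  open import Data.List.Relation.Unary.All using (All; []; _∷_)
  open import Data.List.Relation.Unary.Unique.Propositional using (Unique)
  open import Data.List.Relation.Unary.AllPairs using ([]; _∷_)
  open import Data.List.Relation.Unary.Linked using (Linked; []; [-]; _∷_)
  open import Data.Product using (Σ; _×_; _,_; proj₁; proj₂)
  open import Data.Sum using (_⊎_; inj₁; inj₂)
  open import Data.Empty using (⊥-elim)
  open import Function.Definitions using (Injective)
  open import Function.Bundles using (Injection)
  open import Function.Properties.Inverse using (↔⇒↣)
  open import Relation.Nullary using (¬_; yes; no)
  open import Relation.Binary.PropositionalEquality

  data EdgeInℕ (u v : ℕ) : List ℕ → Set where
    here  : ∀ {x y xs} → (x ≡ u × y ≡ v) ⊎ (x ≡ v × y ≡ u) → EdgeInℕ u v (x ∷ y ∷ xs)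
    there : ∀ {x xs} → EdgeInℕ u v xs → EdgeInℕ u v (x ∷ xs)

  EdgeIn-sym : ∀ {u v xs} → EdgeInℕ u v xs → EdgeInℕ v u xs
  EdgeIn-sym (here (inj₁ e)) = here (inj₂ e)
  EdgeIn-sym (here (inj₂ e)) = here (inj₁ e)
  EdgeIn-sym (there e) = there (EdgeIn-sym e)

  SameEdge : ℕ × ℕ → ℕ → ℕ → Set
  SameEdge p a b = p ≡ (a , b) ⊎ p ≡ (b , a)

  SameEdge-swap : ∀ {p a b} → SameEdge p b a → SameEdge p a b
  SameEdge-swap (inj₁ e) = inj₂ e
  SameEdge-swap (inj₂ e) = inj₁ e

  OwnedEdge : ∀ {K} → (ℕ → ℕ → Set) → (ℕ → ℕ → Fin K) → Fin K → ℕ → ℕ → Set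
  OwnedEdge T owner i x y = x ≢ y × ¬ T x y × owner x y ≡ i × owner y x ≡ i

  -- A path decomposition of K_n minus T on the vertices 0 … n-1 in which every
  -- edge {a,b} is routed to the path owner a b; exclusivity is then automatic.
  record OwnedDecomposition (n K : ℕ) (T : ℕ → ℕ → Set) (P : Fin K → List ℕ) (owner : ℕ → ℕ → Fin K) : Set where
    field
      bounded : ∀ i → All (_< n) (P i)
      unique  : ∀ i → Unique (P i)
      linked  : ∀ i → Linked (OwnedEdge T owner i) (P i)
      covers  : ∀ a b → a < n → b < n → a ≢ b → ¬ T a b → EdgeInℕ a b (P (owner a b))

  data TadpoleEdge (m : ℕ) (v : ℕ → ℕ) : ℕ → ℕ → Set where
    cyc   : ∀ i → suc i < m → TadpoleEdge m v (v i) (v (suc i))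
    close : TadpoleEdge m v (v (m ∸ 1)) (v 0)
    pend  : TadpoleEdge m v (v 0) (v m)

  TadpoleAdj : ℕ → (ℕ → ℕ) → ℕ → ℕ → Set
  TadpoleAdj m v a b = TadpoleEdge m v a b ⊎ TadpoleEdge m v b a

  TadpoleAdj-sym : ∀ {m v a b} → TadpoleAdj m v a b → TadpoleAdj m v b a
  TadpoleAdj-sym (inj₁ t) = inj₂ t
  TadpoleAdj-sym (inj₂ t) = inj₁ t

  permutation-injective : ∀ {n} (π : Permutation′ n) → Injective _≡_ _≡_ (π ⟨$⟩ʳ_)
  permutation-injective π = Injection.injective (↔⇒↣ π)

  transpose-source : ∀ {n} (x y : Fin n) → transpose x y ⟨$⟩ʳ x ≡ y
  transpose-source x y with x Fin.≟ x
  ... | yes _ = refl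
  ... | no x≢x = ⊥-elim (x≢x refl)

  transpose-fixes : ∀ {n} (x y z : Fin n) → z ≢ x → z ≢ y → transpose x y ⟨$⟩ʳ z ≡ z
  transpose-fixes x y z z≢x z≢y with z Fin.≟ x
  ... | yes z≡x = ⊥-elim (z≢x z≡x)
  ... | no _ with z Fin.≟ y
  ...   | yes z≡y = ⊥-elim (z≢y z≡y)
  ...   | no _ = refl

  extend-to-permutation : ∀ {m n} (g f : Fin m → Fin n) → Injective _≡_ _≡_ g → Injective _≡_ _≡_ f →
    Σ (Permutation′ n) λ π → ∀ i → π ⟨$⟩ʳ g i ≡ f i
  extend-to-permutation {zero} g f _ _ = id , λ ()
  extend-to-permutation {suc m} g f g-inj f-inj = π ∘ₚ transpose x (f fzero) , agrees
    where
    restrict : Σ (Permutation′ _) λ ρ → ∀ i → ρ ⟨$⟩ʳ g (fsuc i) ≡ f (fsuc i)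
    restrict = extend-to-permutation (λ i → g (fsuc i)) (λ i → f (fsuc i))
                 (λ e → suc-injective (g-inj e)) (λ e → suc-injective (f-inj e))
    π : Permutation′ _
    π = proj₁ restrict
    x : Fin _
    x = π ⟨$⟩ʳ g fzero
    agrees : ∀ i → transpose x (f fzero) ⟨$⟩ʳ (π ⟨$⟩ʳ g i) ≡ f i
    agrees fzero = transpose-source x (f fzero)
    agrees (fsuc i) = trans (cong (transpose x (f fzero) ⟨$⟩ʳ_) (proj₂ restrict i))
      (transpose-fixes x (f fzero) (f (fsuc i)) f≢x (λ e → Fin.0≢1+n (f-inj (sym e))))
      where
      f≢x : f (fsuc i) ≢ x
      f≢x e = Fin.0≢1+n (g-inj (permutation-injective π (trans (sym e) (sym (proj₂ restrict i)))))

  module Transport {n m : ℕ} .{{_ : NonZero n}}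
    (f : Fin (suc m) → Fin n) (f-inj : Injective _≡_ _≡_ f)
    (v : ℕ → ℕ) (v<n : ∀ i → i ≤ m → v i < n) (v-inj : ∀ i j → i ≤ m → j ≤ m → v i ≡ v j → i ≡ j) where

    toℕ-mod : ∀ a → a < n → toℕ (a mod n) ≡ a
    toℕ-mod a a<n = trans (toℕ-fromℕ< _) (m<n⇒m%n≡m a<n)

    g : Fin (suc m) → Fin n
    g i = v (toℕ i) mod n

    g-inj : Injective _≡_ _≡_ g
    g-inj {i} {j} e = toℕ-injective (v-inj (toℕ i) (toℕ j) (≤-pred (toℕ<n i)) (≤-pred (toℕ<n j))
      (trans (sym (toℕ-mod _ (v<n _ (≤-pred (toℕ<n i))))) (trans (cong toℕ e) (toℕ-mod _ (v<n _ (≤-pred (toℕ<n j)))))))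

    π : Permutation′ n
    π = proj₁ (extend-to-permutation g f g-inj f-inj)

    ψ : ℕ → Fin n
    ψ a = π ⟨$⟩ʳ (a mod n)

    ψ-inj : ∀ a b → a < n → b < n → ψ a ≡ ψ b → a ≡ b
    ψ-inj a b a<n b<n e = trans (sym (toℕ-mod a a<n)) (trans (cong toℕ (permutation-injective π e)) (toℕ-mod b b<n))

    ψ-surj : ∀ u → Σ ℕ λ a → a < n × ψ a ≡ u
    ψ-surj u = toℕ (π ⟨$⟩ˡ u) , toℕ<n _ ,
      trans (cong (π ⟨$⟩ʳ_) (toℕ-injective (toℕ-mod _ (toℕ<n _)))) (inverseʳ π)

    ψ-vertex : ∀ i (p : i < suc m) → ψ (v i) ≡ f (fromℕ< p)
    ψ-vertex i p = trans (cong (λ w → π ⟨$⟩ʳ (v w mod n)) (sym (toℕ-fromℕ< p)))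
                         (proj₂ (extend-to-permutation g f g-inj f-inj) (fromℕ< p))

    ψ-pendant : ψ (v m) ≡ f (fromℕ m)
    ψ-pendant = trans (cong (λ w → π ⟨$⟩ʳ (v w mod n)) (sym (toℕ-fromℕ m)))
                      (proj₂ (extend-to-permutation g f g-inj f-inj) (fromℕ m))

    is-vertex : ∀ i a → i ≤ m → a < n → ψ a ≡ ψ (v i) → a ≡ v i
    is-vertex i a i≤m a<n = ψ-inj a (v i) a<n (v<n i i≤m)

    pull-edge : ∀ {u w} → TEdge f u w → ∀ a b → a < n → b < n → ψ a ≡ u → ψ b ≡ w → TadpoleEdge m v a b
    pull-edge (cyc i h p q) a b a<n b<n ea eb
      rewrite is-vertex i a (≤-pred p) a<n (trans ea (sym (ψ-vertex i p)))
            | is-vertex (suc i) b (≤-pred q) b<n (trans eb (sym (ψ-vertex (suc i) q))) = cyc i h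
    pull-edge (close p z) a b a<n b<n ea eb
      rewrite is-vertex (m ∸ 1) a (≤-pred p) a<n (trans ea (sym (ψ-vertex (m ∸ 1) p)))
            | is-vertex 0 b z≤n b<n (trans eb (sym (ψ-vertex 0 z))) = close
    pull-edge (pend z) a b a<n b<n ea eb
      rewrite is-vertex 0 a z≤n a<n (trans ea (sym (ψ-vertex 0 z)))
            | is-vertex m b ≤-refl b<n (trans eb (sym ψ-pendant)) = pend

    push-edge : ∀ a b → TadpoleEdge m v a b → TEdge f (ψ a) (ψ b)
    push-edge _ _ (cyc i h) rewrite ψ-vertex i (≤-trans (<⇒≤ h) (n≤1+n m)) | ψ-vertex (suc i) (≤-trans h (n≤1+n m)) =
      cyc i h (≤-trans (<⇒≤ h) (n≤1+n m)) (≤-trans h (n≤1+n m))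
    push-edge _ _ close rewrite ψ-vertex (m ∸ 1) (s≤s (m∸n≤m m 1)) | ψ-vertex 0 (s≤s z≤n) =
      close (s≤s (m∸n≤m m 1)) (s≤s z≤n)
    push-edge _ _ pend rewrite ψ-vertex 0 (s≤s z≤n) | ψ-pendant = pend (s≤s z≤n)

    pull : ∀ a b → a < n → b < n → TAdj f (ψ a) (ψ b) → TadpoleAdj m v a b
    pull a b a<n b<n (inj₁ t) = inj₁ (pull-edge t a b a<n b<n refl refl)
    pull a b a<n b<n (inj₂ t) = inj₂ (pull-edge t b a b<n a<n refl refl)

    push : ∀ a b → TadpoleAdj m v a b → TAdj f (ψ a) (ψ b)
    push a b (inj₁ t) = inj₁ (push-edge a b t)
    push a b (inj₂ t) = inj₂ (push-edge b a t)

    module _ {K} {P : Fin K → List ℕ} {owner : ℕ → ℕ → Fin K}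
             (D : OwnedDecomposition n K (TadpoleAdj m v) P owner) where
      open OwnedDecomposition D

      map-unique : ∀ xs → All (_< n) xs → Unique xs → Unique (map ψ xs)
      map-unique [] _ _ = []
      map-unique (x ∷ xs) (x<n ∷ xs<n) (x∉ ∷ u) = distinct xs xs<n x∉ ∷ map-unique xs xs<n u
        where
        distinct : ∀ ys → All (_< n) ys → All (x ≢_) ys → All (ψ x ≢_) (map ψ ys)
        distinct [] _ _ = []
        distinct (y ∷ ys) (y<n ∷ ys<n) (x≢y ∷ rest) = (λ e → x≢y (ψ-inj x y x<n y<n e)) ∷ distinct ys ys<n rest

      map-linked : ∀ i xs → All (_< n) xs → Linked (OwnedEdge (TadpoleAdj m v) owner i) xs → Linked (KminusT f) (map ψ xs)
      map-linked i [] _ _ = []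
      map-linked i (x ∷ []) _ _ = [-]
      map-linked i (x ∷ y ∷ xs) (x<n ∷ y<n ∷ xs<n) ((x≢y , ¬t , _) ∷ l) =
        ((λ e → x≢y (ψ-inj x y x<n y<n e)) , (λ t → ¬t (pull x y x<n y<n t))) ∷ map-linked i (y ∷ xs) (y<n ∷ xs<n) l

      map-edge : ∀ a b xs → EdgeInℕ a b xs → EdgeIn (ψ a) (ψ b) (map ψ xs)
      map-edge a b (x ∷ y ∷ xs) (here (inj₁ (refl , refl))) = here (inj₁ (refl , refl))
      map-edge a b (x ∷ y ∷ xs) (here (inj₂ (refl , refl))) = here (inj₂ (refl , refl))
      map-edge a b (x ∷ xs) (there e) = there (map-edge a b xs e)

      owner-of-edge : ∀ i a b xs → a < n → b < n → All (_< n) xs → Linked (OwnedEdge (TadpoleAdj m v) owner i) xs →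
        EdgeIn (ψ a) (ψ b) (map ψ xs) → owner a b ≡ i
      owner-of-edge i a b (x ∷ y ∷ xs) a<n b<n (x<n ∷ y<n ∷ _) ((_ , _ , o , _) ∷ _) (here (inj₁ (e₁ , e₂)))
        rewrite ψ-inj x a x<n a<n e₁ | ψ-inj y b y<n b<n e₂ = o
      owner-of-edge i a b (x ∷ y ∷ xs) a<n b<n (x<n ∷ y<n ∷ _) ((_ , _ , _ , o) ∷ _) (here (inj₂ (e₁ , e₂)))
        rewrite ψ-inj x b x<n b<n e₁ | ψ-inj y a y<n a<n e₂ = o
      owner-of-edge i a b (x ∷ y ∷ xs) a<n b<n (_ ∷ y<n ∷ xs<n) (_ ∷ l) (there e) =
        owner-of-edge i a b (y ∷ xs) a<n b<n (y<n ∷ xs<n) l e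
      owner-of-edge i a b (x ∷ []) _ _ _ _ (there ())

      transport : IsPathDecomposition (KminusT f) K (λ i → map ψ (P i))
      transport = (λ i → map-unique (P i) (bounded i) (unique i) , map-linked i (P i) (bounded i) (linked i)) , cover
        where
        cover : ∀ u w → KminusT f u w → Σ (Fin K) λ i → EdgeIn u w (map ψ (P i)) × (∀ j → EdgeIn u w (map ψ (P j)) → j ≡ i)
        cover u w (u≢w , ¬t) with ψ-surj u | ψ-surj w
        ... | a , a<n , refl | b , b<n , refl =
          owner a b ,
          map-edge a b (P (owner a b)) (covers a b a<n b<n (λ e → u≢w (cong ψ e)) (λ t → ¬t (push a b t))) ,
          λ j e → sym (owner-of-edge j a b (P j) a<n b<n (bounded j) (linked j) e)

module TadpoleLists where

  open Relabelling
  open import Data.Nat using (ℕ; zero; suc; _≤_; _<_; z≤n; s≤s; NonZero)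
  open import Data.Nat.Properties using (≤-trans; ≤-refl; ≤-reflexive; n≤1+n; +-comm)
  open import Data.Fin using (Fin)
  open import Data.List using (List; []; _∷_; _++_; length)
  open import Data.List.Properties using (length-++)
  open import Data.List.Relation.Unary.All using (All; []; _∷_)
  open import Data.List.Relation.Unary.Unique.Propositional using (Unique)
  open import Data.List.Relation.Unary.AllPairs using ([]; _∷_)
  open import Data.List.Relation.Unary.Linked using (Linked; _∷_)
  open import Data.Product using (Σ; _×_; _,_)
  open import Data.Sum using (_⊎_; inj₁; inj₂)
  open import Data.Empty using (⊥-elim)
  open import Function.Definitions using (Injective)
  open import Relation.Binary.PropositionalEquality

  -- Indexing with junk value 0 past the end.
  at : List ℕ → ℕ → ℕ
  at [] _ = 0
  at (x ∷ xs) zero = x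
  at (x ∷ xs) (suc i) = at xs i

  lastOr : ℕ → List ℕ → ℕ
  lastOr x [] = x
  lastOr x (y ∷ ys) = lastOr y ys

  data Consecutive (a b : ℕ) : List ℕ → Set where
    here  : ∀ {xs} → Consecutive a b (a ∷ b ∷ xs)
    there : ∀ {x xs} → Consecutive a b xs → Consecutive a b (x ∷ xs)

  Linked-consecutive : ∀ {R : ℕ → ℕ → Set} {a b xs} → Consecutive a b xs → Linked R xs → R a b
  Linked-consecutive here (r ∷ _) = r
  Linked-consecutive (there c) (_ ∷ rs) = Linked-consecutive c rs

  EdgeIn⇒consecutive : ∀ {a b xs} → EdgeInℕ a b xs → Consecutive a b xs ⊎ Consecutive b a xs
  EdgeIn⇒consecutive (here (inj₁ (refl , refl))) = inj₁ here
  EdgeIn⇒consecutive (here (inj₂ (refl , refl))) = inj₂ here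
  EdgeIn⇒consecutive (there e) with EdgeIn⇒consecutive e
  ... | inj₁ c = inj₁ (there c)
  ... | inj₂ c = inj₂ (there c)

  at-++ˡ : ∀ xs ys i → i < length xs → at (xs ++ ys) i ≡ at xs i
  at-++ˡ (x ∷ xs) ys zero _ = refl
  at-++ˡ (x ∷ xs) ys (suc i) (s≤s i<) = at-++ˡ xs ys i i<

  at-++-length : ∀ xs ys → at (xs ++ ys) (length xs) ≡ at ys 0
  at-++-length [] ys = refl
  at-++-length (x ∷ xs) ys = at-++-length xs ys

  at-last : ∀ x xs → at (x ∷ xs) (length xs) ≡ lastOr x xs
  at-last x [] = refl
  at-last x (y ∷ ys) = at-last y ys

  at-consecutive : ∀ xs i → suc i < length xs → Consecutive (at xs i) (at xs (suc i)) xs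
  at-consecutive (x ∷ y ∷ xs) zero _ = here
  at-consecutive (x ∷ xs) (suc i) (s≤s i<) = there (at-consecutive xs i i<)

  consecutive-at : ∀ {a b} xs → Consecutive a b xs → Σ ℕ λ i → suc i < length xs × a ≡ at xs i × b ≡ at xs (suc i)
  consecutive-at (a ∷ b ∷ xs) here = 0 , s≤s (s≤s z≤n) , refl , refl
  consecutive-at (x ∷ xs) (there c) with consecutive-at xs c
  ... | i , i< , e₁ , e₂ = suc i , s≤s i< , e₁ , e₂

  All-at : ∀ {P : ℕ → Set} xs i → All P xs → i < length xs → P (at xs i)
  All-at (x ∷ xs) zero (p ∷ _) _ = p
  All-at (x ∷ xs) (suc i) (_ ∷ ps) (s≤s i<) = All-at xs i ps i<

  at-injective : ∀ xs i j → Unique xs → i < length xs → j < length xs → at xs i ≡ at xs j → i ≡ j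
  at-injective (x ∷ xs) zero zero _ _ _ _ = refl
  at-injective (x ∷ xs) zero (suc j) (x∉ ∷ _) _ (s≤s j<) e = ⊥-elim (All-at xs j x∉ j< e)
  at-injective (x ∷ xs) (suc i) zero (x∉ ∷ _) (s≤s i<) _ e = ⊥-elim (All-at xs i x∉ i< (sym e))
  at-injective (x ∷ xs) (suc i) (suc j) (_ ∷ u) (s≤s i<) (s≤s j<) e = cong suc (at-injective xs i j u i< j< e)

  module ListTadpole (a₀ : ℕ) (B : List ℕ) (p : ℕ) where

    cycle : List ℕ
    cycle = a₀ ∷ B

    vertices : List ℕ
    vertices = cycle ++ p ∷ []

    m : ℕ
    m = suc (length B)

    vertex : ℕ → ℕ
    vertex = at vertices

    last : ℕ
    last = lastOr a₀ B

    length-vertices : length vertices ≡ suc m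
    length-vertices = trans (length-++ cycle) (+-comm m 1)

    vertex-cycle : ∀ i → i < m → vertex i ≡ at cycle i
    vertex-cycle i = at-++ˡ cycle (p ∷ []) i

    edge-cases : ∀ {a b} → TadpoleEdge m vertex a b → Consecutive a b cycle ⊎ (a ≡ last × b ≡ a₀) ⊎ (a ≡ a₀ × b ≡ p)
    edge-cases (cyc i h) rewrite vertex-cycle i (≤-trans (n≤1+n _) h) | vertex-cycle (suc i) h = inj₁ (at-consecutive cycle i h)
    edge-cases close rewrite vertex-cycle (length B) ≤-refl | at-last a₀ B = inj₂ (inj₁ (refl , refl))
    edge-cases pend rewrite at-++-length cycle (p ∷ []) = inj₂ (inj₂ (refl , refl))

    consecutive-edge : ∀ {a b} → Consecutive a b cycle → TadpoleEdge m vertex a b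
    consecutive-edge c with consecutive-at cycle c
    ... | i , h , refl , refl = subst₂ (TadpoleEdge m vertex) (vertex-cycle i (≤-trans (n≤1+n _) h)) (vertex-cycle (suc i) h) (cyc i h)

    closing-edge : TadpoleEdge m vertex last a₀
    closing-edge = subst (λ z → TadpoleEdge m vertex z a₀) (trans (vertex-cycle (length B) ≤-refl) (at-last a₀ B)) close

    pendant-edge : TadpoleEdge m vertex a₀ p
    pendant-edge = subst (TadpoleEdge m vertex a₀) (at-++-length cycle (p ∷ [])) pend

    cycle-edge : ∀ {a b} → EdgeInℕ a b cycle → TadpoleAdj m vertex a b
    cycle-edge e with EdgeIn⇒consecutive e
    ... | inj₁ c = inj₁ (consecutive-edge c)
    ... | inj₂ c = inj₂ (consecutive-edge c)

    edges-satisfy : ∀ {R : ℕ → ℕ → Set} → Linked R cycle → R last a₀ → R a₀ p → ∀ {a b} → TadpoleEdge m vertex a b → R a b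
    edges-satisfy along closing pendant t with edge-cases t
    ... | inj₁ c = Linked-consecutive c along
    ... | inj₂ (inj₁ (refl , refl)) = closing
    ... | inj₂ (inj₂ (refl , refl)) = pendant

    transport-decomposition : ∀ {n K m′} .{{_ : NonZero n}} → m ≡ m′ → All (_< n) vertices → Unique vertices →
      ∀ {P owner} → OwnedDecomposition n K (TadpoleAdj m vertex) P owner →
      (f : Fin (suc m′) → Fin n) → Injective _≡_ _≡_ f → Σ (Fin K → List (Fin n)) (IsPathDecomposition (KminusT f) K)
    transport-decomposition refl bounded distinct D f f-inj = _ , Transport.transport f f-inj vertex v<n v-inj D
      where
      i<length : ∀ {i} → i ≤ m → i < length vertices
      i<length i≤m = ≤-trans (s≤s i≤m) (≤-reflexive (sym length-vertices))
      v<n : ∀ i → i ≤ m → vertex i < _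
      v<n i i≤m = All-at vertices i bounded (i<length i≤m)
      v-inj : ∀ i j → i ≤ m → j ≤ m → vertex i ≡ vertex j → i ≡ j
      v-inj i j i≤m j≤m = at-injective vertices i j distinct (i<length i≤m) (i<length j≤m)

module Classification where

  open Relabelling
  open import Data.Nat using (ℕ; zero; suc; _≤_; _<_; _<?_; s≤s)
  open import Data.Nat.Properties using (≤-pred)
  open import Data.Fin using (Fin; toℕ; fromℕ<)
  open import Data.Fin.Properties using (toℕ-fromℕ<; toℕ<n; toℕ-injective)
  open import Data.List using (List)
  open import Data.List.Relation.Unary.All using (All)
  open import Data.List.Relation.Unary.Unique.Propositional using (Unique)
  open import Data.List.Relation.Unary.Linked using (Linked)
  open import Data.Product using (_×_; _,_; proj₁; proj₂)
  open import Data.Sum using (inj₁; inj₂)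
  open import Data.Empty using (⊥-elim)
  open import Relation.Nullary using (¬_; yes; no)
  open import Relation.Binary.PropositionalEquality

  data Class : Set where
    tadpole : Class
    onPath  : ℕ → Class

  onPath-injective : ∀ {i j} → onPath i ≡ onPath j → i ≡ j
  onPath-injective refl = refl

  onPath≢tadpole : ∀ {i} → onPath i ≢ tadpole
  onPath≢tadpole ()

  tadpole≢onPath : ∀ {i} → tadpole ≢ onPath i
  tadpole≢onPath ()

  toFin : ∀ {k} → ℕ → Fin (suc k)
  toFin {k} i with i <? suc k
  ... | yes i< = fromℕ< i<
  ... | no _ = Fin.zero
    where import Data.Fin as Fin

  toFin-toℕ : ∀ {k} (i : Fin (suc k)) → toFin (toℕ i) ≡ i
  toFin-toℕ {k} i with toℕ i <? suc k
  ... | yes i< = toℕ-injective (toℕ-fromℕ< i<)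
  ... | no i≮ = ⊥-elim (i≮ (toℕ<n i))

  toℕ-toFin : ∀ {k} i → i ≤ k → toℕ (toFin {k} i) ≡ i
  toℕ-toFin {k} i i≤k with i <? suc k
  ... | yes i< = toℕ-fromℕ< i<
  ... | no i≮ = ⊥-elim (i≮ (s≤s i≤k))

  -- Classifying coordinates as tadpole edges or as edges of
  -- path i, with path i ending up as P i, yields an owned decomposition.
  module Classify {n k : ℕ} {E : Set} (pair : E → ℕ × ℕ) (Valid : E → Set) (position : ℕ → ℕ → E)
    (position-pair : ∀ e → Valid e → position (proj₁ (pair e)) (proj₂ (pair e)) ≡ e × position (proj₂ (pair e)) (proj₁ (pair e)) ≡ e)
    (position-valid : ∀ a b → a < n → b < n → a ≢ b → Valid (position a b) × SameEdge (pair (position a b)) a b)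
    (pair-distinct : ∀ e → Valid e → proj₁ (pair e) ≢ proj₂ (pair e))
    (T : ℕ → ℕ → Set) (T-sym : ∀ {a b} → T a b → T b a)
    (classify : E → Class) where

    index : Class → ℕ
    index tadpole = 0
    index (onPath i) = i

    owner : ℕ → ℕ → Fin (suc k)
    owner a b = toFin (index (classify (position a b)))

    Tadpole : ℕ → ℕ → Set
    Tadpole a b = classify (position a b) ≡ tadpole × classify (position b a) ≡ tadpole

    tadpole-pair : ∀ e → Valid e → classify e ≡ tadpole →
      Tadpole (proj₁ (pair e)) (proj₂ (pair e)) × Tadpole (proj₂ (pair e)) (proj₁ (pair e))
    tadpole-pair e v c = (c₁ , c₂) , (c₂ , c₁)
      where
      c₁ : classify (position (proj₁ (pair e)) (proj₂ (pair e))) ≡ tadpole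
      c₁ = trans (cong classify (proj₁ (position-pair e v))) c
      c₂ : classify (position (proj₂ (pair e)) (proj₁ (pair e))) ≡ tadpole
      c₂ = trans (cong classify (proj₂ (position-pair e v))) c

    module _ (T⇒tadpole : ∀ {a b} → T a b → Tadpole a b) where

      owned-pair : ∀ e i → Valid e → classify e ≡ onPath i →
        OwnedEdge T owner (toFin i) (proj₁ (pair e)) (proj₂ (pair e)) × OwnedEdge T owner (toFin i) (proj₂ (pair e)) (proj₁ (pair e))
      owned-pair e i v c = (distinct , ¬T , o₁ , o₂) , ((λ x → distinct (sym x)) , (λ t → ¬T (T-sym t)) , o₂ , o₁)
        where
        distinct : proj₁ (pair e) ≢ proj₂ (pair e)
        distinct = pair-distinct e v
        c₁ : classify (position (proj₁ (pair e)) (proj₂ (pair e))) ≡ onPath i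
        c₁ = trans (cong classify (proj₁ (position-pair e v))) c
        c₂ : classify (position (proj₂ (pair e)) (proj₁ (pair e))) ≡ onPath i
        c₂ = trans (cong classify (proj₂ (position-pair e v))) c
        ¬T : ¬ T (proj₁ (pair e)) (proj₂ (pair e))
        ¬T t with trans (sym (proj₁ (T⇒tadpole t))) c₁
        ... | ()
        o₁ : owner (proj₁ (pair e)) (proj₂ (pair e)) ≡ toFin i
        o₁ = cong (λ z → toFin (index z)) c₁
        o₂ : owner (proj₂ (pair e)) (proj₁ (pair e)) ≡ toFin i
        o₂ = cong (λ z → toFin (index z)) c₂

      decomposition : (P : ℕ → List ℕ) →
        (∀ i → i ≤ k → All (_< n) (P i) × Unique (P i) × Linked (OwnedEdge T owner (toFin i)) (P i)) →
        (∀ e → Valid e → classify e ≡ tadpole → T (proj₁ (pair e)) (proj₂ (pair e))) →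
        (∀ e i → Valid e → classify e ≡ onPath i → i ≤ k × EdgeInℕ (proj₁ (pair e)) (proj₂ (pair e)) (P i)) →
        OwnedDecomposition n (suc k) T (λ i → P (toℕ i)) owner
      decomposition P paths tadpole-edge on-path = record
        { bounded = λ i → proj₁ (facts i)
        ; unique  = λ i → proj₁ (proj₂ (facts i))
        ; linked  = λ i → subst (λ z → Linked (OwnedEdge T owner z) (P (toℕ i))) (toFin-toℕ i) (proj₂ (proj₂ (facts i)))
        ; covers  = covers
        }
        where
        facts : ∀ (i : Fin (suc k)) → _
        facts i = paths (toℕ i) (≤-pred (toℕ<n i))
        covers : ∀ a b → a < n → b < n → a ≢ b → ¬ T a b → EdgeInℕ a b (P (toℕ (owner a b)))
        covers a b a<n b<n a≢b ¬T with position-valid a b a<n b<n a≢b | classify (position a b) in c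
        ... | v , same | tadpole = ⊥-elim (¬T (orient same (tadpole-edge _ v c)))
          where
          orient : ∀ {p} → SameEdge p a b → T (proj₁ p) (proj₂ p) → T a b
          orient (inj₁ refl) t = t
          orient (inj₂ refl) t = T-sym t
        ... | v , same | onPath i with on-path _ i v c
        ...   | i≤k , e = subst (λ z → EdgeInℕ a b (P z)) (sym (toℕ-toFin i i≤k)) (orient same e)
          where
          orient : ∀ {p} → SameEdge p a b → EdgeInℕ (proj₁ p) (proj₂ p) (P i) → EdgeInℕ a b (P i)
          orient (inj₁ refl) e = e
          orient (inj₂ refl) e = EdgeIn-sym e

-- Walecki's decomposition of K_{2k+1} on the vertices 0 … N with N = 2k playing the
-- role of ∞: for j < k the Hamiltonian cycle H_j is
--   ∞, j, j+1, j-1, j+2, j-2, …, j-(k-1), j+k, ∞   (arithmetic mod N),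
-- and Slot names its edges: infL = {∞, j}, infR = {j+k, ∞}, up t = {j-t, j+t+1},
-- dn t = {j+t+1, j-t-1}.  A finite edge {a, b} lies on H_j for j = ⌊(a + b mod N) / 2⌋.
module Walecki (k : ℕ) where

  open import Data.Nat
  open import Data.Nat.Properties
  open import Data.Bool using (Bool; true; false)
  open import Data.Product using (Σ; _×_; _,_; proj₁; proj₂; map₂)
  open import Data.Sum using (_⊎_; inj₁; inj₂; [_,_]′)
  import Data.Sum as Sum
  open import Data.Empty using (⊥; ⊥-elim)
  open import Data.Unit using (⊤; tt)
  open import Relation.Nullary using (¬_; Dec; yes; no)
  open import Relation.Nullary.Decidable using (_×-dec_)
  open import Relation.Binary.PropositionalEquality
  open import Data.Nat.Tactic.RingSolver using (solve-∀)
  open Relabelling using (SameEdge; SameEdge-swap)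

  N : ℕ
  N = k + k

  ≤-split : ∀ {a b} → a ≤ b → Σ ℕ λ d → b ≡ a + d
  ≤-split p with m≤n⇒∃[o]m+o≡n p
  ... | d , e = d , sym e

  sub : ℕ → ℕ → ℕ
  sub j t with t ≤? j
  ... | yes _ = j ∸ t
  ... | no _ = (N + j) ∸ t

  sub-spec : ∀ j t → t ≤ N → (t ≤ j × sub j t + t ≡ j) ⊎ (j < t × sub j t + t ≡ N + j)
  sub-spec j t t≤N with t ≤? j
  ... | yes t≤j = inj₁ (t≤j , m∸n+n≡m t≤j)
  ... | no t≰j = inj₂ (≰⇒> t≰j , m∸n+n≡m (≤-trans t≤N (m≤m+n N j)))

  sub-unique : ∀ j t b → b < N → t ≤ N → (b + t ≡ j ⊎ b + t ≡ j + N) → b ≡ sub j t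
  sub-unique j t b b<N t≤N h with sub-spec j t t≤N | h
  ... | inj₁ (_ , e) | inj₁ e′ = +-cancelʳ-≡ t b (sub j t) (trans e′ (sym e))
  ... | inj₁ (t≤j , e) | inj₂ e′ = ⊥-elim (<⇒≱ b<N (+-cancelʳ-≤ t N b (≤-trans (+-monoʳ-≤ N t≤j) (≤-reflexive (trans (+-comm N j) (sym e′))))))
  ... | inj₂ (j<t , e) | inj₁ e′ = ⊥-elim (<⇒≱ j<t (≤-trans (m≤n+m t b) (≤-reflexive e′)))
  ... | inj₂ (_ , e) | inj₂ e′ = +-cancelʳ-≡ t b (sub j t) (trans e′ (trans (+-comm j N) (sym e)))

  sub<N : ∀ j t → j < k → t < k → sub j t < N
  sub<N j t j<k t<k with sub-spec j t (≤-trans (<⇒≤ t<k) (m≤m+n k k))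
  ... | inj₁ (_ , e) = ≤-<-trans (≤-trans (m≤m+n (sub j t) t) (≤-reflexive e)) (≤-trans j<k (m≤m+n k k))
  ... | inj₂ (j<t , e) = +-cancelʳ-< t (sub j t) N (≤-trans (≤-reflexive (trans (cong suc e) (sym (+-suc N j)))) (+-monoʳ-≤ N j<t))

  sub-injective : ∀ j s₁ s₂ → s₁ < k → s₂ < k → sub j s₁ ≡ sub j s₂ → s₁ ≡ s₂
  sub-injective j s₁ s₂ s₁<k s₂<k e with sub-spec j s₁ (≤-trans (<⇒≤ s₁<k) (m≤m+n k k)) | sub-spec j s₂ (≤-trans (<⇒≤ s₂<k) (m≤m+n k k))
  ... | inj₁ (_ , e₁) | inj₁ (_ , e₂) = +-cancelˡ-≡ (sub j s₁) s₁ s₂ (trans e₁ (sym (trans (cong (_+ s₂) e) e₂)))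
  ... | inj₂ (_ , e₁) | inj₂ (_ , e₂) = +-cancelˡ-≡ (sub j s₁) s₁ s₂ (trans e₁ (sym (trans (cong (_+ s₂) e) e₂)))
  ... | inj₁ (_ , e₁) | inj₂ (_ , e₂) = ⊥-elim (wraps s₁ s₂ s₂<k e₁ (trans (cong (_+ s₂) e) e₂))
    where
    wraps : ∀ s₁ s₂ → s₂ < k → sub j s₁ + s₁ ≡ j → sub j s₁ + s₂ ≡ N + j → ⊥
    wraps s₁ s₂ s₂<k e₁ e₂ = <⇒≱ s₂<k (≤-trans (m≤m+n k k) (+-cancelˡ-≤ (sub j s₁) N s₂
      (≤-trans (≤-reflexive (+-comm (sub j s₁) N)) (≤-trans (+-monoʳ-≤ N (≤-trans (m≤m+n (sub j s₁) s₁) (≤-reflexive e₁))) (≤-reflexive (sym e₂))))))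
  ... | inj₂ (_ , e₁) | inj₁ (_ , e₂) = ⊥-elim (<⇒≱ s₁<k (≤-trans (m≤m+n k k) (+-cancelˡ-≤ (sub j s₂) N s₁
      (≤-trans (≤-reflexive (+-comm (sub j s₂) N)) (≤-trans (+-monoʳ-≤ N (≤-trans (m≤m+n (sub j s₂) s₂) (≤-reflexive e₂))) (≤-reflexive (sym (trans (cong (_+ s₁) (sym e)) e₁))))))))

  plus<N : ∀ j t → j < k → t < k → j + suc t < N
  plus<N j t j<k t<k = +-mono-<-≤ j<k t<k

  -- s mod N, for s < 2N
  reduce : ℕ → ℕ
  reduce s with s <? N
  ... | yes _ = s
  ... | no _ = s ∸ N

  reduce-spec : ∀ s → s < N + N → reduce s < N × (s ≡ reduce s ⊎ s ≡ reduce s + N)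
  reduce-spec s s< with s <? N
  ... | yes s<N = s<N , inj₁ refl
  ... | no s≮N = +-cancelʳ-< N (s ∸ N) N (subst (_< N + N) (sym (m∸n+n≡m (≮⇒≥ s≮N))) s<) , inj₂ (sym (m∸n+n≡m (≮⇒≥ s≮N)))

  reduce-small : ∀ s → s < N → reduce s ≡ s
  reduce-small s s<N with s <? N
  ... | yes _ = refl
  ... | no s≮N = ⊥-elim (s≮N s<N)

  reduce-big : ∀ s → reduce (s + N) ≡ s
  reduce-big s with (s + N) <? N
  ... | yes s+N<N = ⊥-elim (<⇒≱ s+N<N (m≤n+m N s))
  ... | no _ = m+n∸n≡m s N

  bit : Bool → ℕ
  bit true = 1
  bit false = 0

  half : ℕ → ℕ × Bool
  half zero = 0 , false
  half (suc zero) = 0 , true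
  half (suc (suc n)) = suc (proj₁ (half n)) , proj₂ (half n)

  half-spec : ∀ n → n ≡ proj₁ (half n) + proj₁ (half n) + bit (proj₂ (half n))
  half-spec zero = refl
  half-spec (suc zero) = refl
  half-spec (suc (suc n)) = trans (cong (λ x → suc (suc x)) (half-spec n))
    (cong suc (sym (cong (_+ bit (proj₂ (half n))) (+-suc (proj₁ (half n)) (proj₁ (half n))))))

  half-odd : ∀ j → half (j + j + 1) ≡ (j , true)
  half-odd zero = refl
  half-odd (suc j) rewrite +-suc j j = cong (λ p → suc (proj₁ p) , proj₂ p) (half-odd j)

  half-even : ∀ j → half (j + j) ≡ (j , false)
  half-even zero = refl
  half-even (suc j) rewrite +-suc j j = cong (λ p → suc (proj₁ p) , proj₂ p) (half-even j)

  data Slot : Set where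
    infL infR : Slot
    up dn : ℕ → Slot

  Valid : Slot → Set
  Valid infL = ⊤
  Valid infR = ⊤
  Valid (up t) = t < k
  Valid (dn t) = suc t < k

  pair : ℕ → Slot → ℕ × ℕ
  pair j infL = N , j
  pair j infR = j + k , N
  pair j (up t) = sub j t , j + suc t
  pair j (dn t) = j + suc t , sub j (suc t)

  -- The vertices j+1, …, j+k visited by the upward half of the zigzag of H_j.
  Above : ℕ → ℕ → Set
  Above j x = j < x × x ≤ j + k

  above? : ∀ j x → Dec (Above j x)
  above? j x = (j <? x) ×-dec (x ≤? j + k)

  plus-above : ∀ j t → t < k → Above j (j + suc t)
  plus-above j t t<k = m<m+n j z<s , +-monoʳ-≤ j t<k

  sub-not-above : ∀ j t → j < k → t < k → ¬ Above j (sub j t)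
  sub-not-above j t j<k t<k (j< , ≤j+k) with sub-spec j t (≤-trans (<⇒≤ t<k) (m≤m+n k k))
  ... | inj₁ (_ , e) = <⇒≱ j< (≤-trans (m≤m+n (sub j t) t) (≤-reflexive e))
  ... | inj₂ (_ , e) = <⇒≱ t<k (+-cancelˡ-≤ (j + k) k t (≤-trans (≤-reflexive (trans (rearrange j k) (sym e))) (+-monoˡ-≤ t ≤j+k)))
    where
    rearrange : ∀ j k → j + k + k ≡ k + k + j
    rearrange = solve-∀

  sub≢plus : ∀ j s₁ s₂ → j < k → s₁ < k → s₂ < k → sub j s₁ ≢ j + suc s₂
  sub≢plus j s₁ s₂ j<k s₁<k s₂<k e = sub-not-above j s₁ j<k s₁<k (subst (Above j) (sym e) (plus-above j s₂ s₂<k))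

  pair-distinct : ∀ j P → j < k → Valid P → proj₁ (pair j P) ≢ proj₂ (pair j P)
  pair-distinct j infL j<k _ e = <⇒≢ (≤-trans j<k (m≤m+n k k)) (sym e)
  pair-distinct j infR j<k _ e = <⇒≢ (+-monoˡ-< k j<k) e
  pair-distinct j (up t) j<k t<k e = sub≢plus j t t j<k t<k t<k e
  pair-distinct j (dn t) j<k 1+t<k e = sub≢plus j (suc t) t j<k 1+t<k (≤-trans (n≤1+n _) 1+t<k) (sym e)

  -- Locating a finite edge {a, b} of H_j: the sum a + b is 2j + 1 on up-edges and 2j on
  -- dn-edges (mod N), and the endpoint above j determines the offset t.
  slotOf : Bool → ℕ → Slot
  slotOf true = up
  slotOf false = dn

  offset : ℕ → ℕ → ℕ → ℕ
  offset j a b with above? j a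
  ... | yes _ = a ∸ j
  ... | no _ = b ∸ j

  offset-above : ∀ j a b → Above j a → offset j a b ≡ a ∸ j
  offset-above j a b a-above with above? j a
  ... | yes _ = refl
  ... | no ¬above = ⊥-elim (¬above a-above)

  offset-below : ∀ j a b → ¬ Above j a → offset j a b ≡ b ∸ j
  offset-below j a b ¬above with above? j a
  ... | yes a-above = ⊥-elim (¬above a-above)
  ... | no _ = refl

  finitePosition : ℕ → ℕ → ℕ × Slot
  finitePosition a b = let (j , r) = half (reduce (a + b)) in j , slotOf r (offset j a b ∸ 1)

  infinitePosition : ℕ → ℕ × Slot
  infinitePosition x with x <? k
  ... | yes _ = x , infL
  ... | no _ = x ∸ k , infR

  position : ℕ → ℕ → ℕ × Slot
  position a b with a ≟ N | b ≟ N
  ... | yes _ | _ = infinitePosition b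
  ... | no _ | yes _ = infinitePosition a
  ... | no _ | no _ = finitePosition a b

  SumClass : ℕ → ℕ → ℕ → Bool → Set
  SumClass a b j r = a + b ≡ j + j + bit r ⊎ a + b ≡ j + j + bit r + N

  SumClass-comm : ∀ {a b j r} → SumClass a b j r → SumClass b a j r
  SumClass-comm {a} {b} = Sum.map (trans (+-comm b a)) (trans (+-comm b a))

  half<k : ∀ j → j + j < N → j < k
  half<k j j+j<N with j <? k
  ... | yes j<k = j<k
  ... | no j≮k = ⊥-elim (<⇒≱ j+j<N (+-mono-≤ (≮⇒≥ j≮k) (≮⇒≥ j≮k)))

  edge-from-above : ∀ a b j t r → j < k → a ≡ j + suc t → a ≤ j + k → b < N → a ≢ b → SumClass a b j r →
    Valid (slotOf r t) × SameEdge (pair j (slotOf r t)) a b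
  edge-from-above a b j t true j<k refl a≤ b<N a≢b h = t<k , inj₂ (cong₂ _,_ (sym b≡) refl)
    where
    t<k : t < k
    t<k = +-cancelˡ-≤ j (suc t) k a≤
    shift : ∀ j t b → j + suc t + b ≡ (b + t) + suc j
    shift = solve-∀
    b≡ : b ≡ sub j t
    b≡ = sub-unique j t b b<N (≤-trans (<⇒≤ t<k) (m≤m+n k k)) (
      [ (λ e → inj₁ (+-cancelʳ-≡ (suc j) (b + t) j (trans (sym (shift j t b)) (trans e (odd j)))))
      , (λ e → inj₂ (+-cancelʳ-≡ (suc j) (b + t) (j + N) (trans (sym (shift j t b)) (trans e (odd+N j N))))) ]′ h)
      where
      odd : ∀ j → j + j + 1 ≡ j + suc j
      odd = solve-∀
      odd+N : ∀ j n → j + j + 1 + n ≡ (j + n) + suc j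
      odd+N = solve-∀
  edge-from-above a b j t false j<k refl a≤ b<N a≢b h = 1+t<k , inj₁ (cong₂ _,_ refl (sym b≡))
    where
    shift : ∀ j t b → j + suc t + b ≡ (b + suc t) + j
    shift = solve-∀
    even : ∀ j → j + j + 0 ≡ j + j
    even = solve-∀
    even+N : ∀ j n → j + j + 0 + n ≡ (j + n) + j
    even+N = solve-∀
    h′ : b + suc t ≡ j ⊎ b + suc t ≡ j + N
    h′ = [ (λ e → inj₁ (+-cancelʳ-≡ j (b + suc t) j (trans (sym (shift j t b)) (trans e (even j)))))
         , (λ e → inj₂ (+-cancelʳ-≡ j (b + suc t) (j + N) (trans (sym (shift j t b)) (trans e (even+N j N))))) ]′ h
    1+t≤k : suc t ≤ k
    1+t≤k = +-cancelˡ-≤ j (suc t) k a≤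
    b≡ : b ≡ sub j (suc t)
    b≡ = sub-unique j (suc t) b b<N (≤-trans 1+t≤k (m≤m+n k k)) h′
    1+t<k : suc t < k
    1+t<k = ≤∧≢⇒< 1+t≤k λ q →
      [ (λ e → <⇒≱ j<k (≤-trans (≤-reflexive (sym q)) (≤-trans (m≤n+m (suc t) b) (≤-reflexive e))))
      , (λ e → a≢b (sym (+-cancelʳ-≡ (suc t) b (j + suc t) (trans e (trans (sym (+-assoc j k k)) (cong (λ z → j + z + z) (sym q))))))) ]′ h′

  private
    not-above : ∀ j x → ¬ Above j x → x ≤ j ⊎ j + k < x
    not-above j x ¬above with j <? x
    ... | no j≮x = inj₁ (≮⇒≥ j≮x)
    ... | yes j<x = inj₂ (≰⇒> (λ x≤ → ¬above (j<x , x≤)))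

    absurd-eq : ∀ {P Q} R → P ≡ Q + suc R → P ≡ Q → ⊥
    absurd-eq {P} {Q} R s e = m+1+n≢m Q (trans (sym s) e)

    low-low : ∀ a b j K r → j < K → a ≢ b → (a + b ≡ j + j + bit r ⊎ a + b ≡ j + j + bit r + (K + K)) → a ≤ j → b ≤ j → ⊥
    low-low a b j K r j<K a≢b h a≤j b≤j with ≤-split j<K | ≤-split a≤j
    ... | d₄ , refl | d₁ , refl with ≤-split b≤j
    ... | d₂ , e₂ with h
    ... | inj₁ e = ends r (sym (+-cancelˡ-≡ (a + b) 0 (d₁ + d₂ + bit r)
            (trans (+-identityʳ (a + b)) (trans e (trans (cong (λ z → (a + d₁) + z + bit r) e₂) (regroup a b d₁ d₂ (bit r)))))))
      where
      regroup : ∀ a b d₁ d₂ r → (a + d₁) + (b + d₂) + r ≡ (a + b) + (d₁ + d₂ + r)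
      regroup = solve-∀
      ends : ∀ r → d₁ + d₂ + bit r ≡ 0 → ⊥
      ends true x = 1+n≢0 (trans (+-comm 1 (d₁ + d₂)) x)
      ends false x = a≢b (+-cancelʳ-≡ 0 a b (trans (cong (a +_) (sym (m+n≡0⇒m≡0 d₁ (m+n≡0⇒m≡0 (d₁ + d₂) x))))
                       (trans e₂ (cong (b +_) (m+n≡0⇒n≡0 d₁ (m+n≡0⇒m≡0 (d₁ + d₂) x))))))
    ... | inj₂ e = m+1+n≢m (a + b) (sym (trans e (trans (cong (λ z → (a + d₁) + z + bit r + ((suc (a + d₁) + d₄) + (suc (a + d₁) + d₄))) e₂)
                     (regroup a b d₁ d₂ d₄ (bit r)))))
      where
      regroup : ∀ a b d₁ d₂ d₄ r → (a + d₁) + (b + d₂) + r + ((suc (a + d₁) + d₄) + (suc (a + d₁) + d₄)) ≡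
                                   (a + b) + suc (d₁ + d₂ + r + (a + d₁ + d₄) + suc (a + d₁ + d₄))
      regroup = solve-∀

    low-high : ∀ a b j K r → j < K → b < K + K → (a + b ≡ j + j + bit r ⊎ a + b ≡ j + j + bit r + (K + K)) → a ≤ j → j + K < b → ⊥
    low-high a b j K r j<K b<2K h a≤j b> with ≤-split j<K | ≤-split a≤j
    ... | d₄ , refl | d₁ , refl with h
    ... | inj₂ e with ≤-split b<2K
    ...   | d₃ , e₃ = m+1+n≢m (a + b) (sym (trans e (trans (cong (λ z → (a + d₁) + (a + d₁) + bit r + z) e₃) (regroup a b d₁ d₃ (bit r)))))
      where
      regroup : ∀ a b d₁ d₃ r → (a + d₁) + (a + d₁) + r + (suc b + d₃) ≡ (a + b) + suc (d₁ + (a + d₁) + r + d₃)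
      regroup = solve-∀
    low-high a b j K r j<K b<2K h a≤j b> | d₄ , refl | d₁ , refl | inj₁ e with ≤-split b>
    ... | d₂ , refl with r
    ... | true = absurd-eq _ (regroup a d₁ d₂ d₄) e
      where
      regroup : ∀ a d₁ d₂ d₄ → a + (suc ((a + d₁) + (suc (a + d₁) + d₄)) + d₂) ≡ ((a + d₁) + (a + d₁) + 1) + suc (a + d₄ + d₂)
      regroup = solve-∀
    ... | false = absurd-eq _ (regroup a d₁ d₂ d₄) e
      where
      regroup : ∀ a d₁ d₂ d₄ → a + (suc ((a + d₁) + (suc (a + d₁) + d₄)) + d₂) ≡ ((a + d₁) + (a + d₁) + 0) + suc (suc (a + d₄ + d₂))
      regroup = solve-∀

    high-high : ∀ a b j K r → j < K → (a + b ≡ j + j + bit r ⊎ a + b ≡ j + j + bit r + (K + K)) → j + K < a → j + K < b → ⊥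
    high-high a b j K r j<K h a> b> with ≤-split j<K
    ... | d₄ , refl with ≤-split a> | ≤-split b>
    ... | d₁ , refl | d₂ , refl with r | h
    ... | true | inj₁ e = absurd-eq _ (regroup j d₁ d₂ d₄) e
      where
      regroup : ∀ j d₁ d₂ d₄ → suc (j + (suc j + d₄)) + d₁ + (suc (j + (suc j + d₄)) + d₂) ≡ (j + j + 1) + suc (suc (j + d₄ + d₁ + (suc j + d₄) + d₂))
      regroup = solve-∀
    ... | false | inj₁ e = absurd-eq _ (regroup j d₁ d₂ d₄) e
      where
      regroup : ∀ j d₁ d₂ d₄ → suc (j + (suc j + d₄)) + d₁ + (suc (j + (suc j + d₄)) + d₂) ≡ (j + j + 0) + suc (suc (suc (j + d₄ + d₁ + (suc j + d₄) + d₂)))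
      regroup = solve-∀
    ... | true | inj₂ e = absurd-eq _ (regroup j d₁ d₂ d₄) e
      where
      regroup : ∀ j d₁ d₂ d₄ → suc (j + (suc j + d₄)) + d₁ + (suc (j + (suc j + d₄)) + d₂) ≡ (j + j + 1 + ((suc j + d₄) + (suc j + d₄))) + suc (d₁ + d₂)
      regroup = solve-∀
    ... | false | inj₂ e = absurd-eq _ (regroup j d₁ d₂ d₄) e
      where
      regroup : ∀ j d₁ d₂ d₄ → suc (j + (suc j + d₄)) + d₁ + (suc (j + (suc j + d₄)) + d₂) ≡ (j + j + 0 + ((suc j + d₄) + (suc j + d₄))) + suc (suc (d₁ + d₂))
      regroup = solve-∀

  some-endpoint-above : ∀ a b j r → j < k → a < N → b < N → a ≢ b → SumClass a b j r → ¬ Above j a → ¬ Above j b → ⊥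
  some-endpoint-above a b j r j<k a<N b<N a≢b h ¬a ¬b with not-above j a ¬a | not-above j b ¬b
  ... | inj₁ a≤ | inj₁ b≤ = low-low a b j k r j<k a≢b h a≤ b≤
  ... | inj₁ a≤ | inj₂ b> = low-high a b j k r j<k b<N h a≤ b>
  ... | inj₂ a> | inj₁ b≤ = low-high b a j k r j<k a<N (SumClass-comm {a} {b} {j} {r} h) b≤ a>
  ... | inj₂ a> | inj₂ b> = high-high a b j k r j<k h a> b>

  above-as-plus : ∀ j a → j < a → a ≡ j + suc (a ∸ j ∸ 1)
  above-as-plus j a j<a with ≤-split j<a
  ... | d , refl = trans (sym (+-suc j d)) (cong (λ z → j + suc (z ∸ 1)) (sym (drop j d)))
    where
    drop : ∀ j d → suc (j + d) ∸ j ≡ suc d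
    drop zero d = refl
    drop (suc j) d = drop j d

  ValidPosition : ℕ × Slot → Set
  ValidPosition p = proj₁ p < k × Valid (proj₂ p)

  finitePosition-valid : ∀ a b → a < N → b < N → a ≢ b →
    ValidPosition (finitePosition a b) × SameEdge (pair (proj₁ (finitePosition a b)) (proj₂ (finitePosition a b))) a b
  finitePosition-valid a b a<N b<N a≢b = (j<k , proj₁ located) , proj₂ located
    where
    reduced : reduce (a + b) < N × (a + b ≡ reduce (a + b) ⊎ a + b ≡ reduce (a + b) + N)
    reduced = reduce-spec (a + b) (+-mono-< a<N b<N)
    j : ℕ
    j = proj₁ (half (reduce (a + b)))
    r : Bool
    r = proj₂ (half (reduce (a + b)))
    j+j+r : reduce (a + b) ≡ j + j + bit r
    j+j+r = half-spec (reduce (a + b))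
    j<k : j < k
    j<k = half<k j (≤-<-trans (≤-trans (m≤m+n (j + j) (bit r)) (≤-reflexive (sym j+j+r))) (proj₁ reduced))
    h : SumClass a b j r
    h = Sum.map (λ e → trans e j+j+r) (λ e → trans e (cong (_+ N) j+j+r)) (proj₂ reduced)
    located : Valid (slotOf r (offset j a b ∸ 1)) × SameEdge (pair j (slotOf r (offset j a b ∸ 1))) a b
    located with above? j a
    ... | yes (j<a , a≤) = edge-from-above a b j (a ∸ j ∸ 1) r j<k (above-as-plus j a j<a) a≤ b<N a≢b h
    ... | no ¬a with above? j b
    ...   | yes (j<b , b≤) = map₂ SameEdge-swap
              (edge-from-above b a j (b ∸ j ∸ 1) r j<k (above-as-plus j b j<b) b≤ a<N (λ e → a≢b (sym e)) (SumClass-comm {a} {b} {j} {r} h))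
    ...   | no ¬b = ⊥-elim (some-endpoint-above a b j r j<k a<N b<N a≢b h ¬a ¬b)

  infinitePosition-valid : ∀ x → x < N → ValidPosition (infinitePosition x) ×
    (pair (proj₁ (infinitePosition x)) (proj₂ (infinitePosition x)) ≡ (N , x) ⊎ pair (proj₁ (infinitePosition x)) (proj₂ (infinitePosition x)) ≡ (x , N))
  infinitePosition-valid x x<N with x <? k
  ... | yes x<k = (x<k , tt) , inj₁ refl
  ... | no x≮k = (+-cancelʳ-< k (x ∸ k) k (subst (_< N) (sym (m∸n+n≡m (≮⇒≥ x≮k))) x<N) , tt) , inj₂ (cong (_, N) (m∸n+n≡m (≮⇒≥ x≮k)))

  position-valid : ∀ a b → a ≤ N → b ≤ N → a ≢ b →
    ValidPosition (position a b) × SameEdge (pair (proj₁ (position a b)) (proj₂ (position a b))) a b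
  position-valid a b a≤N b≤N a≢b with a ≟ N | b ≟ N
  ... | yes refl | yes refl = ⊥-elim (a≢b refl)
  ... | yes refl | no b≢N = infinitePosition-valid b (≤∧≢⇒< b≤N b≢N)
  ... | no a≢N | yes refl = map₂ SameEdge-swap (infinitePosition-valid a (≤∧≢⇒< a≤N a≢N))
  ... | no a≢N | no b≢N = finitePosition-valid a b (≤∧≢⇒< a≤N a≢N) (≤∧≢⇒< b≤N b≢N) a≢b

  reduce-odd : ∀ j S → j < k → (S ≡ j + suc j ⊎ S ≡ N + j + suc j) → reduce S ≡ j + j + 1
  reduce-odd j S j<k (inj₁ refl) = trans (reduce-small _ (subst (_< N) (odd j) odd<N)) (sym (odd j))
    where
    odd : ∀ j → j + j + 1 ≡ j + suc j
    odd = solve-∀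
    odd<N : j + j + 1 < N
    odd<N = ≤-trans (≤-reflexive (double j)) (+-mono-≤ j<k j<k)
      where
      double : ∀ j → suc (j + j + 1) ≡ suc j + suc j
      double = solve-∀
  reduce-odd j S j<k (inj₂ refl) = trans (cong reduce (regroup N j)) (reduce-big (j + j + 1))
    where
    regroup : ∀ n j → n + j + suc j ≡ j + j + 1 + n
    regroup = solve-∀

  reduce-even : ∀ j S → j < k → (S ≡ j + j ⊎ S ≡ N + j + j) → reduce S ≡ j + j
  reduce-even j S j<k (inj₁ refl) = reduce-small _ (+-mono-≤ j<k (<⇒≤ j<k))
  reduce-even j S j<k (inj₂ refl) = trans (cong reduce (regroup N j)) (reduce-big (j + j))
    where
    regroup : ∀ n j → n + j + j ≡ j + j + n
    regroup = solve-∀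

  sum-comm : ∀ {a b S T} → (a + b ≡ S ⊎ a + b ≡ T) → (b + a ≡ S ⊎ b + a ≡ T)
  sum-comm {a} {b} = Sum.map (trans (+-comm b a)) (trans (+-comm b a))

  up-sum : ∀ j t → t < k → (sub j t + (j + suc t) ≡ j + suc j ⊎ sub j t + (j + suc t) ≡ N + j + suc j)
  up-sum j t t<k with sub-spec j t (≤-trans (<⇒≤ t<k) (m≤m+n k k))
  ... | inj₁ (_ , e) = inj₁ (trans (regroup (sub j t) t j) (cong (_+ suc j) e))
    where
    regroup : ∀ x t j → x + (j + suc t) ≡ (x + t) + suc j
    regroup = solve-∀
  ... | inj₂ (_ , e) = inj₂ (trans (regroup (sub j t) t j) (cong (_+ suc j) e))
    where
    regroup : ∀ x t j → x + (j + suc t) ≡ (x + t) + suc j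
    regroup = solve-∀

  dn-sum : ∀ j t → suc t < k → ((j + suc t) + sub j (suc t) ≡ j + j ⊎ (j + suc t) + sub j (suc t) ≡ N + j + j)
  dn-sum j t 1+t<k with sub-spec j (suc t) (≤-trans (<⇒≤ 1+t<k) (m≤m+n k k))
  ... | inj₁ (_ , e) = inj₁ (trans (regroup (sub j (suc t)) t j) (cong (_+ j) e))
    where
    regroup : ∀ x t j → (j + suc t) + x ≡ (x + suc t) + j
    regroup = solve-∀
  ... | inj₂ (_ , e) = inj₂ (trans (regroup (sub j (suc t)) t j) (cong (_+ j) e))
    where
    regroup : ∀ x t j → (j + suc t) + x ≡ (x + suc t) + j
    regroup = solve-∀

  finitePosition-from : ∀ a b j r → half (reduce (a + b)) ≡ (j , r) → finitePosition a b ≡ (j , slotOf r (offset j a b ∸ 1))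
  finitePosition-from a b j r e rewrite e = refl

  finitePosition-up : ∀ j t → j < k → t < k →
    finitePosition (sub j t) (j + suc t) ≡ (j , up t) × finitePosition (j + suc t) (sub j t) ≡ (j , up t)
  finitePosition-up j t j<k t<k =
    trans (finitePosition-from (sub j t) (j + suc t) j true (trans (cong half (reduce-odd j _ j<k (up-sum j t t<k))) (half-odd j)))
          (cong (λ z → j , up (z ∸ 1)) (trans (offset-below j (sub j t) (j + suc t) (sub-not-above j t j<k t<k)) (m+n∸m≡n j (suc t)))) ,
    trans (finitePosition-from (j + suc t) (sub j t) j true (trans (cong half (reduce-odd j _ j<k (sum-comm {sub j t} (up-sum j t t<k)))) (half-odd j)))
          (cong (λ z → j , up (z ∸ 1)) (trans (offset-above j (j + suc t) (sub j t) (plus-above j t t<k)) (m+n∸m≡n j (suc t))))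

  finitePosition-dn : ∀ j t → j < k → suc t < k →
    finitePosition (j + suc t) (sub j (suc t)) ≡ (j , dn t) × finitePosition (sub j (suc t)) (j + suc t) ≡ (j , dn t)
  finitePosition-dn j t j<k 1+t<k =
    trans (finitePosition-from (j + suc t) (sub j (suc t)) j false (trans (cong half (reduce-even j _ j<k (dn-sum j t 1+t<k))) (half-even j)))
          (cong (λ z → j , dn (z ∸ 1)) (trans (offset-above j (j + suc t) (sub j (suc t)) (plus-above j t (≤-trans (n≤1+n _) 1+t<k))) (m+n∸m≡n j (suc t)))) ,
    trans (finitePosition-from (sub j (suc t)) (j + suc t) j false (trans (cong half (reduce-even j _ j<k (sum-comm {j + suc t} (dn-sum j t 1+t<k)))) (half-even j)))
          (cong (λ z → j , dn (z ∸ 1)) (trans (offset-below j (sub j (suc t)) (j + suc t) (sub-not-above j (suc t) j<k 1+t<k)) (m+n∸m≡n j (suc t))))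

  infinitePosition-left : ∀ j → j < k → infinitePosition j ≡ (j , infL)
  infinitePosition-left j j<k with j <? k
  ... | yes _ = refl
  ... | no j≮k = ⊥-elim (j≮k j<k)

  infinitePosition-right : ∀ j → infinitePosition (j + k) ≡ (j , infR)
  infinitePosition-right j with (j + k) <? k
  ... | yes j+k<k = ⊥-elim (<⇒≱ j+k<k (m≤n+m k j))
  ... | no _ = cong (_, infR) (m+n∸n≡m j k)

  position-finite : ∀ a b → a < N → b < N → position a b ≡ finitePosition a b
  position-finite a b a<N b<N with a ≟ N | b ≟ N
  ... | yes e | _ = ⊥-elim (<⇒≢ a<N e)
  ... | no _ | yes e = ⊥-elim (<⇒≢ b<N e)
  ... | no _ | no _ = refl

  position-∞ˡ : ∀ b → position N b ≡ infinitePosition b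
  position-∞ˡ b with N ≟ N
  ... | yes _ = refl
  ... | no N≢N = ⊥-elim (N≢N refl)

  position-∞ʳ : ∀ a → a < N → position a N ≡ infinitePosition a
  position-∞ʳ a a<N with a ≟ N | N ≟ N
  ... | yes e | _ = ⊥-elim (<⇒≢ a<N e)
  ... | no _ | yes _ = refl
  ... | no _ | no N≢N = ⊥-elim (N≢N refl)

  position-pair : ∀ j P → j < k → Valid P →
    position (proj₁ (pair j P)) (proj₂ (pair j P)) ≡ (j , P) × position (proj₂ (pair j P)) (proj₁ (pair j P)) ≡ (j , P)
  position-pair j infL j<k _ = trans (position-∞ˡ j) (infinitePosition-left j j<k) ,
                               trans (position-∞ʳ j (≤-trans j<k (m≤m+n k k))) (infinitePosition-left j j<k)
  position-pair j infR j<k _ = trans (position-∞ʳ (j + k) (+-monoˡ-< k j<k)) (infinitePosition-right j) ,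
                               trans (position-∞ˡ (j + k)) (infinitePosition-right j)
  position-pair j (up t) j<k t<k =
    trans (position-finite _ _ (sub<N j t j<k t<k) (plus<N j t j<k t<k)) (proj₁ (finitePosition-up j t j<k t<k)) ,
    trans (position-finite _ _ (plus<N j t j<k t<k) (sub<N j t j<k t<k)) (proj₂ (finitePosition-up j t j<k t<k))
  position-pair j (dn t) j<k 1+t<k =
    trans (position-finite _ _ (plus<N j t j<k (≤-trans (n≤1+n _) 1+t<k)) (sub<N j (suc t) j<k 1+t<k)) (proj₁ (finitePosition-dn j t j<k 1+t<k)) ,
    trans (position-finite _ _ (sub<N j (suc t) j<k 1+t<k) (plus<N j t j<k (≤-trans (n≤1+n _) 1+t<k))) (proj₂ (finitePosition-dn j t j<k 1+t<k))

module Segments (k : ℕ) where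

  open Relabelling using (EdgeInℕ; here; there)
  open Walecki k
  open import Data.Nat
  open import Data.Nat.Properties
  open import Data.List using (List; []; _∷_; _++_; length)
  open TadpoleLists using (lastOr)
  open import Data.Nat.Tactic.RingSolver using (solve-∀)
  open import Data.List.Relation.Unary.All as All using (All; []; _∷_)
  open import Data.List.Relation.Unary.Unique.Propositional using (Unique)
  open import Data.List.Relation.Unary.AllPairs using ([]; _∷_)
  open import Data.List.Relation.Unary.Linked using (Linked; _∷_)
  open import Data.Product using (Σ; _×_; _,_; proj₁; proj₂)
  open import Data.Sum using (_⊎_; inj₁; inj₂)
  open import Data.Empty using (⊥-elim)
  open import Relation.Nullary using (¬_; yes; no)
  open import Relation.Binary.PropositionalEquality

  ∸≡suc∸suc : ∀ m n → m < n → n ∸ m ≡ suc (n ∸ suc m)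
  ∸≡suc∸suc zero (suc n) _ = refl
  ∸≡suc∸suc (suc m) (suc n) (s≤s m<n) = ∸≡suc∸suc m n m<n

  zigzag : ℕ → ℕ → ℕ → List ℕ → List ℕ
  zigzag j t zero rest = rest
  zigzag j t (suc c) rest = sub j t ∷ (j + suc t) ∷ zigzag j (suc t) c rest

  OnZigzag : ℕ → ℕ → ℕ → ℕ → Set
  OnZigzag j t c x = Σ ℕ λ s → t ≤ s × s < t + c × (x ≡ sub j s ⊎ x ≡ j + suc s)

  All-zigzag : ∀ (P : ℕ → Set) j t c rest → (∀ s → t ≤ s → s < t + c → P (sub j s) × P (j + suc s)) → All P rest → All P (zigzag j t c rest)
  All-zigzag P j t zero rest h a = a
  All-zigzag P j t (suc c) rest h a = proj₁ (h t ≤-refl (m<m+n t z<s)) ∷ proj₂ (h t ≤-refl (m<m+n t z<s)) ∷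
    All-zigzag P j (suc t) c rest (λ s t<s s< → h s (≤-trans (n≤1+n t) t<s) (≤-trans s< (≤-reflexive (sym (+-suc t c))))) a

  zigzag-unique : ∀ j t c rest → j < k → t + c ≤ k → Unique rest → All (λ x → ¬ OnZigzag j t c x) rest → Unique (zigzag j t c rest)
  zigzag-unique j t zero rest j<k t+c≤k u off = u
  zigzag-unique j t (suc c) rest j<k t+c≤k u off =
    (sub≢plus j t t j<k t<k t<k ∷ All-zigzag (sub j t ≢_) j (suc t) c rest (λ s t<s s< → sub≢sub s t<s s< , sub≢plus j t s j<k t<k (<k s s<))
                                    (All.map (λ ¬on e → ¬on (t , ≤-refl , m<m+n t z<s , inj₁ (sym e))) off)) ∷
    All-zigzag ((j + suc t) ≢_) j (suc t) c rest (λ s t<s s< → (λ e → sub≢plus j s t j<k (<k s s<) t<k (sym e)) , plus≢plus s t<s)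
      (All.map (λ ¬on e → ¬on (t , ≤-refl , m<m+n t z<s , inj₂ (sym e))) off) ∷
    zigzag-unique j (suc t) c rest j<k (≤-trans (≤-reflexive (sym (+-suc t c))) t+c≤k) u (All.map (λ ¬on on → ¬on (widen on)) off)
    where
    <k : ∀ s → s < suc t + c → s < k
    <k s s< = ≤-trans s< (≤-trans (≤-reflexive (sym (+-suc t c))) t+c≤k)
    t<k : t < k
    t<k = <k t (s≤s (m≤m+n t c))
    sub≢sub : ∀ s → suc t ≤ s → s < suc t + c → sub j t ≢ sub j s
    sub≢sub s t<s s< e = <-irrefl (sub-injective j t s t<k (<k s s<) e) t<s
    plus≢plus : ∀ s → suc t ≤ s → j + suc t ≢ j + suc s
    plus≢plus s t<s e = <-irrefl (suc-injective (+-cancelˡ-≡ j (suc t) (suc s) e)) t<s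
    widen : ∀ {x} → OnZigzag j (suc t) c x → OnZigzag j t (suc c) x
    widen (s , t<s , s< , h) = s , ≤-trans (n≤1+n t) t<s , ≤-trans s< (≤-reflexive (sym (+-suc t c))) , h

  zigzag-linked : ∀ (R : ℕ → ℕ → Set) j t c rest → (∀ s → t ≤ s → s < t + suc c → R (sub j s) (j + suc s)) →
    (∀ s → t ≤ s → s < t + c → R (j + suc s) (sub j (suc s))) → Linked R ((j + suc (t + c)) ∷ rest) → Linked R (zigzag j t (suc c) rest)
  zigzag-linked R j t zero rest ups dns l = ups t ≤-refl (m<m+n t z<s) ∷ subst (λ z → Linked R ((j + suc z) ∷ rest)) (+-identityʳ t) l
  zigzag-linked R j t (suc c) rest ups dns l = ups t ≤-refl (m<m+n t z<s) ∷ (dns t ≤-refl (m<m+n t z<s) ∷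
    zigzag-linked R j (suc t) c rest (λ s t<s s< → ups s (≤-trans (n≤1+n t) t<s) (≤-trans s< (≤-reflexive (sym (+-suc t (suc c))))))
                                     (λ s t<s s< → dns s (≤-trans (n≤1+n t) t<s) (≤-trans s< (≤-reflexive (sym (+-suc t c)))))
                                     (subst (λ z → Linked R ((j + suc z) ∷ rest)) (+-suc t c) l))

  EdgeIn-zigzag-rest : ∀ {u v} j t c rest → EdgeInℕ u v rest → EdgeInℕ u v (zigzag j t c rest)
  EdgeIn-zigzag-rest j t zero rest e = e
  EdgeIn-zigzag-rest j t (suc c) rest e = there (there (EdgeIn-zigzag-rest j (suc t) c rest e))

  EdgeIn-zigzag-up : ∀ j t c rest s → t ≤ s → s < t + c → EdgeInℕ (sub j s) (j + suc s) (zigzag j t c rest)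
  EdgeIn-zigzag-up j t zero rest s t≤s s< = ⊥-elim (<⇒≱ s< (≤-trans (≤-reflexive (+-identityʳ t)) t≤s))
  EdgeIn-zigzag-up j t (suc c) rest s t≤s s< with t ≟ s
  ... | yes refl = here (inj₁ (refl , refl))
  ... | no t≢s = there (there (EdgeIn-zigzag-up j (suc t) c rest s (≤∧≢⇒< t≤s t≢s) (≤-trans s< (≤-reflexive (+-suc t c)))))

  EdgeIn-zigzag-dn : ∀ c j t rest s → t ≤ s → suc s < t + c → EdgeInℕ (j + suc s) (sub j (suc s)) (zigzag j t c rest)
  EdgeIn-zigzag-dn zero j t rest s t≤s s< = ⊥-elim (<⇒≱ s< (≤-trans (≤-reflexive (+-identityʳ t)) (≤-trans t≤s (n≤1+n s))))
  EdgeIn-zigzag-dn (suc c) j t rest s t≤s s< with t ≟ s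
  ... | yes refl = first c s<
    where
    first : ∀ c → suc t < t + suc c → EdgeInℕ (j + suc t) (sub j (suc t)) (zigzag j t (suc c) rest)
    first zero s< = ⊥-elim (<⇒≱ s< (≤-reflexive (+-comm t 1)))
    first (suc c) _ = there (here (inj₁ (refl , refl)))
  ... | no t≢s = there (there (EdgeIn-zigzag-dn c j (suc t) rest s (≤∧≢⇒< t≤s t≢s) (≤-trans s< (≤-reflexive (+-suc t c)))))

  EdgeIn-zigzag-last : ∀ j t c x rest → EdgeInℕ (j + suc (t + c)) x (zigzag j t (suc c) (x ∷ rest))
  EdgeIn-zigzag-last j t zero x rest = there (here (inj₁ (cong (λ z → j + suc z) (sym (+-identityʳ t)) , refl)))
  EdgeIn-zigzag-last j t (suc c) x rest = there (there (subst (λ z → EdgeInℕ (j + suc z) x (zigzag j (suc t) (suc c) (x ∷ rest)))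
    (sym (+-suc t c)) (EdgeIn-zigzag-last j (suc t) c x rest)))

  ascending : ℕ → ℕ → List ℕ → List ℕ
  ascending lo zero rest = rest
  ascending lo (suc q) rest = lo ∷ ascending (lo + 1) q rest

  InRange : ℕ → ℕ → ℕ → Set
  InRange lo q x = lo ≤ x × x < lo + q

  All-ascending : ∀ (P : ℕ → Set) lo q rest → (∀ x → lo ≤ x → x < lo + q → P x) → All P rest → All P (ascending lo q rest)
  All-ascending P lo zero rest h a = a
  All-ascending P lo (suc q) rest h a = h lo ≤-refl (m<m+n lo z<s) ∷
    All-ascending P (lo + 1) q rest (λ x lo< x< → h x (≤-trans (m≤m+n lo 1) lo<) (≤-trans x< (≤-reflexive (+-assoc lo 1 q)))) a

  ascending-unique : ∀ lo q rest → Unique rest → All (λ x → ¬ InRange lo q x) rest → Unique (ascending lo q rest)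
  ascending-unique lo zero rest u off = u
  ascending-unique lo (suc q) rest u off =
    All-ascending (lo ≢_) (lo + 1) q rest (λ x lo< _ e → <-irrefl refl (≤-trans (≤-reflexive (+-comm 1 lo)) (subst (lo + 1 ≤_) (sym e) lo<)))
      (All.map (λ ¬in e → ¬in (≤-reflexive e , ≤-trans (≤-reflexive (cong suc (sym e))) (m<m+n lo z<s))) off) ∷
    ascending-unique (lo + 1) q rest u (All.map (λ ¬in r → ¬in (≤-trans (m≤m+n lo 1) (proj₁ r) , ≤-trans (proj₂ r) (≤-reflexive (+-assoc lo 1 q)))) off)

  ascending-linked : ∀ (R : ℕ → ℕ → Set) lo q rest → (∀ x → lo ≤ x → x < lo + q → R x (x + 1)) → Linked R ((lo + q) ∷ rest) →
    Linked R (lo ∷ ascending (lo + 1) q rest)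
  ascending-linked R lo zero rest h l = subst (λ z → Linked R (z ∷ rest)) (+-identityʳ lo) l
  ascending-linked R lo (suc q) rest h l = h lo ≤-refl (m<m+n lo z<s) ∷
    ascending-linked R (lo + 1) q rest (λ x lo< x< → h x (≤-trans (m≤m+n lo 1) lo<) (≤-trans x< (≤-reflexive (+-assoc lo 1 q))))
      (subst (λ z → Linked R (z ∷ rest)) (sym (+-assoc lo 1 q)) l)

  EdgeIn-ascending : ∀ lo q rest x → lo ≤ x → x < lo + q → EdgeInℕ x (x + 1) (lo ∷ ascending (lo + 1) q rest)
  EdgeIn-ascending lo zero rest x lo≤x x< = ⊥-elim (<⇒≱ x< (≤-trans (≤-reflexive (+-identityʳ lo)) lo≤x))
  EdgeIn-ascending lo (suc q) rest x lo≤x x< with lo ≟ x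
  ... | yes refl = here (inj₁ (refl , refl))
  ... | no lo≢x = there (EdgeIn-ascending (lo + 1) q rest x (≤-trans (≤-reflexive (+-comm lo 1)) (≤∧≢⇒< lo≤x lo≢x))
                          (≤-trans x< (≤-reflexive (sym (+-assoc lo 1 q)))))

  EdgeIn-ascending-rest : ∀ {u v} lo q rest → EdgeInℕ u v rest → EdgeInℕ u v (ascending lo q rest)
  EdgeIn-ascending-rest lo zero rest e = e
  EdgeIn-ascending-rest lo (suc q) rest e = there (EdgeIn-ascending-rest (lo + 1) q rest e)

  EdgeIn-ascending-last : ∀ lo q x rest → EdgeInℕ (lo + q) x (lo ∷ ascending (lo + 1) q (x ∷ rest))
  EdgeIn-ascending-last lo zero x rest = here (inj₁ (sym (+-identityʳ lo) , refl))
  EdgeIn-ascending-last lo (suc q) x rest = there (subst (λ z → EdgeInℕ z x ((lo + 1) ∷ ascending (lo + 1 + 1) q (x ∷ rest)))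
    (+-assoc lo 1 q) (EdgeIn-ascending-last (lo + 1) q x rest))

  zigzag-++ : ∀ j t c rest more → zigzag j t c rest ++ more ≡ zigzag j t c (rest ++ more)
  zigzag-++ j t zero rest more = refl
  zigzag-++ j t (suc c) rest more = cong (λ z → sub j t ∷ (j + suc t) ∷ z) (zigzag-++ j (suc t) c rest more)

  ascending-++ : ∀ lo q rest more → ascending lo q rest ++ more ≡ ascending lo q (rest ++ more)
  ascending-++ lo zero rest more = refl
  ascending-++ lo (suc q) rest more = cong (lo ∷_) (ascending-++ (lo + 1) q rest more)

  length-zigzag : ∀ j t c rest → length (zigzag j t c rest) ≡ c + c + length rest
  length-zigzag j t zero rest = refl
  length-zigzag j t (suc c) rest = trans (cong (λ z → suc (suc z)) (length-zigzag j (suc t) c rest)) (regroup c (length rest))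
    where
    regroup : ∀ c l → suc (suc (c + c + l)) ≡ suc c + suc c + l
    regroup = solve-∀

  length-ascending : ∀ lo q rest → length (ascending lo q rest) ≡ q + length rest
  length-ascending lo zero rest = refl
  length-ascending lo (suc q) rest = cong suc (length-ascending (lo + 1) q rest)

  lastOr-zigzag : ∀ x j t c z zs → lastOr x (zigzag j t c (z ∷ zs)) ≡ lastOr z zs
  lastOr-zigzag x j t zero z zs = refl
  lastOr-zigzag x j t (suc c) z zs = lastOr-zigzag (j + suc t) j (suc t) c z zs

  lastOr-ascending : ∀ x lo q z zs → lastOr x (ascending lo q (z ∷ zs)) ≡ lastOr z zs
  lastOr-ascending x lo zero z zs = refl
  lastOr-ascending x lo (suc q) z zs = lastOr-ascending lo (lo + 1) q z zs

-- The tadpole for n = 2k + 1 and m = y + c + 2: its cycle is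
--   c+1, c+2, …, y, ∞, 0, 1, -1, 2, …, c, -c   (closed by the edge {-c, c+1} of H_0)
-- with pendant vertex -(c+1) on c+1.  The edges {x, x+1} with c < x < y open the cycles
-- H_x, the edge {y, ∞} opens H_y and the other tadpole edges are an initial stretch of H_0.
-- Every other H_j is opened by removing {j, j+1}; those edges not on the tadpole form the
-- extra path, a run of consecutive numbers, which is why c = 0 or y = k is required.
module OddOrder (k c y : ℕ) (2≤k : 2 ≤ k) (c<y : c < y) (y≤k : y ≤ k) (c+2≤k : suc (suc c) ≤ k) (c≡0⊎y≡k : c ≡ 0 ⊎ y ≡ k) where

  open import Function.Definitions using (Injective)
  open Walecki k
  open Segments k
  open Relabelling using (EdgeInℕ; here; there; OwnedEdge; TadpoleEdge; TadpoleAdj; TadpoleAdj-sym)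
  open TadpoleLists
  open Classification
  open import Data.Nat hiding (_≤_; _<_; _+_; suc)
  open import Data.Nat.Properties
  open import Data.Fin using (Fin)
  open import Data.List using (List; []; _∷_)
  open import Data.List.Relation.Unary.All using (All; []; _∷_)
  open import Data.List.Relation.Unary.Unique.Propositional using (Unique)
  open import Data.List.Relation.Unary.AllPairs using ([]; _∷_)
  open import Data.List.Relation.Unary.Linked using (Linked; []; [-]; _∷_)
  open import Data.Product using (Σ; _×_; _,_; proj₁; proj₂)
  open import Data.Sum using (inj₁; inj₂; [_,_]′)
  open import Data.Empty using (⊥; ⊥-elim)
  open import Data.Unit using (tt)
  open import Relation.Nullary using (¬_; Dec; yes; no)
  open import Relation.Binary.PropositionalEquality hiding (_≡_)
  open import Data.Nat.Tactic.RingSolver using (solve-∀)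


  n : ℕ
  n = suc N

  0<k : 0 < k
  0<k = ≤-trans (s≤s z≤n) 2≤k

  ℓ : ℕ
  ℓ = y ∸ suc c

  c+1+ℓ≡y : suc c + ℓ ≡ y
  c+1+ℓ≡y = m+[n∸m]≡n c<y

  tail : List ℕ
  tail = N ∷ zigzag 0 0 c (sub 0 c ∷ [])

  B : List ℕ
  B = ascending (suc c + 1) ℓ tail

  open ListTadpole (suc c) B (sub 0 (suc c)) public

  last≡ : last ≡ sub 0 c
  last≡ = trans (lastOr-ascending (suc c) (suc c + 1) ℓ N _) (lastOr-zigzag N 0 0 c (sub 0 c) [])

  classify₀ : Slot → Class
  classify₀ infL = tadpole
  classify₀ infR with y ≟ k
  ... | yes _ = tadpole
  ... | no _ = onPath 0
  classify₀ (up t) with t ≤? c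
  ... | yes _ = tadpole
  ... | no _ = onPath 0
  classify₀ (dn t) with t ≤? c
  ... | yes _ = tadpole
  ... | no _ = onPath 0

  classifyOther : ℕ → Slot → Class
  classifyOther j infL with j ≟ y
  ... | yes _ = tadpole
  ... | no _ = onPath j
  classifyOther j infR = onPath j
  classifyOther j (up zero) with c <? j | j <? y
  ... | yes _ | yes _ = tadpole
  ... | _ | _ with j ≟ y
  ...   | yes _ = onPath j
  ...   | no _ = onPath k
  classifyOther j (up (suc t)) = onPath j
  classifyOther j (dn t) = onPath j

  classifyAt : ℕ → Slot → Class
  classifyAt zero P = classify₀ P
  classifyAt (suc j) P = classifyOther (suc j) P

  T : ℕ → ℕ → Set
  T = TadpoleAdj m vertex

  open Classify {n} {k} (λ e → pair (proj₁ e) (proj₂ e)) ValidPosition position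
    (λ e v → position-pair (proj₁ e) (proj₂ e) (proj₁ v) (proj₂ v))
    (λ a b a<n b<n → position-valid a b (≤-pred a<n) (≤-pred b<n))
    (λ e v → pair-distinct (proj₁ e) (proj₂ e) (proj₁ v) (proj₂ v))
    T TadpoleAdj-sym (λ e → classifyAt (proj₁ e) (proj₂ e))
    renaming (decomposition to owned-decomposition)

  tadpole-slot : ∀ j P → j < k → Valid P → classifyAt j P ≡ tadpole →
    Tadpole (proj₁ (pair j P)) (proj₂ (pair j P)) × Tadpole (proj₂ (pair j P)) (proj₁ (pair j P))
  tadpole-slot j P j<k v = tadpole-pair (j , P) (j<k , v)

  tadpole-0-infR : y ≡ k → classifyAt 0 infR ≡ tadpole
  tadpole-0-infR e with y ≟ k
  ... | yes _ = refl
  ... | no p = ⊥-elim (p e)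

  tadpole-0-up : ∀ t → t ≤ c → classifyAt 0 (up t) ≡ tadpole
  tadpole-0-up t h with t ≤? c
  ... | yes _ = refl
  ... | no p = ⊥-elim (p h)

  tadpole-0-dn : ∀ t → t ≤ c → classifyAt 0 (dn t) ≡ tadpole
  tadpole-0-dn t h with t ≤? c
  ... | yes _ = refl
  ... | no p = ⊥-elim (p h)

  tadpole-y-infL : ∀ j → suc j ≡ y → classifyAt (suc j) infL ≡ tadpole
  tadpole-y-infL j e with suc j ≟ y
  ... | yes _ = refl
  ... | no p = ⊥-elim (p e)

  tadpole-range-up0′ : ∀ j → c < suc j → suc j < y → classifyAt (suc j) (up 0) ≡ tadpole
  tadpole-range-up0′ j h1 h2 with c <? suc j | suc j <? y
  ... | yes _ | yes _ = refl
  ... | no p | _ = ⊥-elim (p h1)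
  ... | yes _ | no p = ⊥-elim (p h2)

  tadpole-range-up0 : ∀ x → c < x → x < y → classifyAt x (up 0) ≡ tadpole
  tadpole-range-up0 zero () _
  tadpole-range-up0 (suc j) h1 h2 = tadpole-range-up0′ j h1 h2

  tadpole-y∞ : Tadpole y N
  tadpole-y∞ with y ≟ k
  ... | yes e = subst (λ z → Tadpole z N) (sym e) (proj₁ (tadpole-slot 0 infR 0<k tt (tadpole-0-infR e)))
  ... | no ne = proj₂ (tadpole-slot y infL (≤∧≢⇒< y≤k ne) tt (cyl y refl))
    where
    cyl : ∀ x → x ≡ y → classifyAt x infL ≡ tadpole
    cyl zero _ = refl
    cyl (suc j) e = tadpole-y-infL j e

  tadpole-along-tail : ∀ c′ → c ≡ c′ → Linked Tadpole (N ∷ zigzag 0 0 c′ (sub 0 c′ ∷ []))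
  tadpole-along-tail zero e = proj₁ (tadpole-slot 0 infL 0<k tt refl) ∷ [-]
  tadpole-along-tail (suc c′) e = proj₁ (tadpole-slot 0 infL 0<k tt refl) ∷
    zigzag-linked Tadpole 0 0 c′ (sub 0 (suc c′) ∷ [])
      (λ s _ sl → proj₁ (tadpole-slot 0 (up s) 0<k (≤-trans sl (≤-trans (≤-reflexive (sym e)) (≤-trans (n≤1+n _) (<⇒≤ c+2≤k)))) (tadpole-0-up s (≤-trans (<⇒≤ sl) (≤-reflexive (sym e))))))
      (λ s _ sl → proj₁ (tadpole-slot 0 (dn s) 0<k (≤-trans (s≤s sl) (≤-trans (≤-reflexive (sym e)) (≤-trans (n≤1+n c) (≤-trans (n≤1+n _) c+2≤k)))) (tadpole-0-dn s (≤-trans (≤-trans (n≤1+n _) sl) (≤-trans (n≤1+n _) (≤-reflexive (sym e)))))))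
      (proj₁ (tadpole-slot 0 (dn c′) 0<k (≤-trans (≤-reflexive (cong (λ z → suc z) (sym e))) (≤-trans (n≤1+n _) c+2≤k)) (tadpole-0-dn c′ (≤-trans (n≤1+n _) (≤-reflexive (sym e))))) ∷ [-])

  tadpole-along-cycle : Linked Tadpole cycle
  tadpole-along-cycle = ascending-linked Tadpole (suc c) ℓ tail
    (λ x lx xl → proj₁ (tadpole-slot x (up 0) (≤-trans xl (≤-trans (≤-reflexive c+1+ℓ≡y) y≤k)) 0<k (tadpole-range-up0 x lx (≤-trans xl (≤-reflexive c+1+ℓ≡y)))))
    (subst (λ z → Linked Tadpole (z ∷ tail)) (sym c+1+ℓ≡y) (tadpole-y∞ ∷ tadpole-along-tail c refl))

  tadpole-edge : ∀ {a b} → TadpoleEdge m vertex a b → Tadpole a b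
  tadpole-edge = edges-satisfy tadpole-along-cycle (subst (λ z → Tadpole z (suc c)) (sym last≡) (proj₁ (tadpole-slot 0 (up c) 0<k (≤-trans (n≤1+n _) c+2≤k) (tadpole-0-up c ≤-refl))))
    (proj₁ (tadpole-slot 0 (dn c) 0<k c+2≤k (tadpole-0-dn c ≤-refl)))

  T⇒tadpole : ∀ {a b} → T a b → Tadpole a b
  T⇒tadpole (inj₁ t) = tadpole-edge t
  T⇒tadpole (inj₂ t) = proj₂ (tadpole-edge t) , proj₁ (tadpole-edge t)

  EdgeIn-tail : ∀ {u v} → EdgeInℕ u v tail → EdgeInℕ u v cycle
  EdgeIn-tail e = there (EdgeIn-ascending-rest (suc c + 1) ℓ tail e)

  EdgeIn-tail-head : ∀ c′ → EdgeInℕ N 0 (N ∷ zigzag 0 0 c′ (sub 0 c′ ∷ []))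
  EdgeIn-tail-head zero = here (inj₁ (refl , refl))
  EdgeIn-tail-head (suc c′) = here (inj₁ (refl , refl))

  EdgeIn-tail-last : ∀ c′ → EdgeInℕ (suc c′) (sub 0 (suc c′)) (N ∷ zigzag 0 0 (suc c′) (sub 0 (suc c′) ∷ []))
  EdgeIn-tail-last c′ = there (EdgeIn-zigzag-last 0 0 c′ (sub 0 (suc c′)) [])

  EdgeIn-y∞ : EdgeInℕ y N cycle
  EdgeIn-y∞ = subst (λ z → EdgeInℕ z N cycle) c+1+ℓ≡y (EdgeIn-ascending-last (suc c) ℓ N _)

  tadpole-class-edge : ∀ j P → j < k → Valid P → classifyAt j P ≡ tadpole → TadpoleAdj m vertex (proj₁ (pair j P)) (proj₂ (pair j P))
  tadpole-class-edge zero infL jk v e = cycle-edge (EdgeIn-tail (EdgeIn-tail-head c))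
  tadpole-class-edge zero infR jk v e with y ≟ k
  ... | yes yk' = cycle-edge (subst (λ z → EdgeInℕ z N cycle) yk' EdgeIn-y∞)
  ... | no _ = ⊥-elim (onPath≢tadpole e)
  tadpole-class-edge zero (up t) jk v e with t ≤? c
  ... | no _ = ⊥-elim (onPath≢tadpole e)
  ... | yes tc with t ≟ c
  ...   | yes refl = inj₁ (subst (λ z → TadpoleEdge m vertex z (suc t)) last≡ closing-edge)
  ...   | no tc' = cycle-edge (EdgeIn-tail (there (EdgeIn-zigzag-up 0 0 c _ t z≤n (≤∧≢⇒< tc tc'))))
  tadpole-class-edge zero (dn t) jk v e with t ≤? c
  ... | no _ = ⊥-elim (onPath≢tadpole e)
  ... | yes tc with t ≟ c
  ...   | yes refl = inj₁ pendant-edge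
  ...   | no tc' with suc t ≟ c
  ...     | yes refl = cycle-edge (EdgeIn-tail (EdgeIn-tail-last t))
  ...     | no tc'' = cycle-edge (EdgeIn-tail (there (EdgeIn-zigzag-dn c 0 0 _ t z≤n (≤∧≢⇒< (≤∧≢⇒< tc tc') tc''))))
  tadpole-class-edge (suc j) infL jk v e with suc j ≟ y
  ... | yes refl = TadpoleAdj-sym (cycle-edge EdgeIn-y∞)
  ... | no _ = ⊥-elim (onPath≢tadpole e)
  tadpole-class-edge (suc j) infR jk v ()
  tadpole-class-edge (suc j) (up zero) jk v e with c <? suc j | suc j <? y
  ... | yes h1 | yes h2 = cycle-edge (EdgeIn-ascending (suc c) ℓ tail (suc j) h1 (≤-trans h2 (≤-reflexive (sym c+1+ℓ≡y))))
  ... | yes _ | no _ with suc j ≟ y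
  ...   | yes _ = ⊥-elim (onPath≢tadpole e)
  ...   | no _ = ⊥-elim (onPath≢tadpole e)
  tadpole-class-edge (suc j) (up zero) jk v e | no _ | _ with suc j ≟ y
  ...   | yes _ = ⊥-elim (onPath≢tadpole e)
  ...   | no _ = ⊥-elim (onPath≢tadpole e)
  tadpole-class-edge (suc j) (up (suc t)) jk v ()
  tadpole-class-edge (suc j) (dn t) jk v ()

  Owned : ℕ → ℕ → ℕ → Set
  Owned i = OwnedEdge T owner (toFin i)

  owned-slot : ∀ j P i → j < k → Valid P → classifyAt j P ≡ onPath i →
    Owned i (proj₁ (pair j P)) (proj₂ (pair j P)) × Owned i (proj₂ (pair j P)) (proj₁ (pair j P))
  owned-slot j P i j<k v = owned-pair T⇒tadpole (j , P) i (j<k , v)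

  end₀ : List ℕ
  end₀ with y <? k
  ... | yes _ = N ∷ []
  ... | no _ = []

  pathH₀ : List ℕ
  pathH₀ = zigzag 0 (suc c) (k ∸ suc c) end₀

  pathHy : List ℕ
  pathHy = zigzag y 0 k (N ∷ [])

  pathHj : ℕ → List ℕ
  pathHj j = (j + 1) ∷ zigzag j 1 (k ∸ 1) (N ∷ j ∷ [])

  extraPath : List ℕ
  extraPath with c ≟ 0
  ... | yes _ = ascending (y + 1) (k ∸ y) []
  ... | no _ = ascending 1 (suc c) []

  paths : ℕ → List ℕ
  paths i with i ≟ k
  ... | yes _ = extraPath
  ... | no _ = pathOf i
    where
    pathOf : ℕ → List ℕ
    pathOf zero = pathH₀
    pathOf (suc j) with suc j ≟ y
    ... | yes _ = pathHy
    ... | no _ = pathHj (suc j)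

  paths-k : paths k ≡ extraPath
  paths-k with k ≟ k
  ... | yes _ = refl
  ... | no p = ⊥-elim (p refl)

  paths-0 : paths 0 ≡ pathH₀
  paths-0 with 0 ≟ k
  ... | yes e = ⊥-elim (<⇒≢ 0<k e)
  ... | no _ = refl

  paths-y : ∀ j → suc j ≡ y → suc j < k → paths (suc j) ≡ pathHy
  paths-y j e jk with suc j ≟ k
  ... | yes e' = ⊥-elim (<⇒≢ jk e')
  ... | no _ with suc j ≟ y
  ...   | yes _ = refl
  ...   | no p = ⊥-elim (p e)

  paths-j : ∀ j → suc j ≢ y → suc j < k → paths (suc j) ≡ pathHj (suc j)
  paths-j j e jk with suc j ≟ k
  ... | yes e' = ⊥-elim (<⇒≢ jk e')
  ... | no _ with suc j ≟ y
  ...   | yes p = ⊥-elim (e p)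
  ...   | no _ = refl

  ℓ₀ : ℕ
  ℓ₀ = k ∸ suc (suc c)

  k∸[c+1]≡1+ℓ₀ : k ∸ suc c ≡ suc ℓ₀
  k∸[c+1]≡1+ℓ₀ = ∸≡suc∸suc (suc c) k c+2≤k

  c+1+[1+ℓ₀]≡k : suc c + suc ℓ₀ ≡ k
  c+1+[1+ℓ₀]≡k = trans (cong (suc c +_) (sym k∸[c+1]≡1+ℓ₀)) (m+[n∸m]≡n (≤-trans (n≤1+n _) c+2≤k))

  path0-up : ∀ t → c < t → classifyAt 0 (up t) ≡ onPath 0
  path0-up t h with t ≤? c
  ... | yes p = ⊥-elim (<⇒≱ h p)
  ... | no _ = refl

  path0-dn : ∀ t → c < t → classifyAt 0 (dn t) ≡ onPath 0
  path0-dn t h with t ≤? c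
  ... | yes p = ⊥-elim (<⇒≱ h p)
  ... | no _ = refl

  path0-infR : y ≢ k → classifyAt 0 infR ≡ onPath 0
  path0-infR h with y ≟ k
  ... | yes p = ⊥-elim (h p)
  ... | no _ = refl

  pathj-infL : ∀ j → suc j ≢ y → classifyAt (suc j) infL ≡ onPath (suc j)
  pathj-infL j h with suc j ≟ y
  ... | yes p = ⊥-elim (h p)
  ... | no _ = refl

  pathy-up0 : ∀ j → suc j ≡ y → classifyAt (suc j) (up 0) ≡ onPath (suc j)
  pathy-up0 j e with c <? suc j | suc j <? y
  ... | _ | yes p = ⊥-elim (<⇒≢ p e)
  ... | yes _ | no _ with suc j ≟ y
  ...   | yes _ = refl
  ...   | no p = ⊥-elim (p e)
  pathy-up0 j e | no _ | no _ with suc j ≟ y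
  ...   | yes _ = refl
  ...   | no p = ⊥-elim (p e)

  extra-up0 : ∀ j → ¬ (c < suc j × suc j < y) → suc j ≢ y → classifyAt (suc j) (up 0) ≡ onPath k
  extra-up0 j h ne with c <? suc j | suc j <? y
  ... | yes p1 | yes p2 = ⊥-elim (h (p1 , p2))
  ... | yes _ | no _ with suc j ≟ y
  ...   | yes p = ⊥-elim (ne p)
  ...   | no _ = refl
  extra-up0 j h ne | no _ | _ with suc j ≟ y
  ...   | yes p = ⊥-elim (ne p)
  ...   | no _ = refl

  linked-end₀ : Linked (Owned 0) (k ∷ end₀)
  linked-end₀ with y <? k
  ... | yes y<k = proj₁ (owned-slot 0 infR 0 0<k tt (path0-infR (<⇒≢ y<k))) ∷ [-]
  ... | no _ = [-]

  linked-H₀ : Linked (Owned 0) pathH₀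
  linked-H₀ rewrite k∸[c+1]≡1+ℓ₀ = zigzag-linked (Owned 0) 0 (suc c) ℓ₀ end₀
    (λ s l1 l2 → proj₁ (owned-slot 0 (up s) 0 0<k (≤-trans l2 (≤-reflexive c+1+[1+ℓ₀]≡k)) (path0-up s l1)))
    (λ s l1 l2 → proj₁ (owned-slot 0 (dn s) 0 0<k (≤-trans (s≤s l2) (≤-trans (≤-reflexive (sym (+-suc (suc c) ℓ₀))) (≤-reflexive c+1+[1+ℓ₀]≡k))) (path0-dn s l1)))
    (subst (λ z → Linked (Owned 0) (z ∷ end₀)) (sym (trans (sym (+-suc (suc c) ℓ₀)) c+1+[1+ℓ₀]≡k)) linked-end₀)

  k≡1+[k∸1] : k ≡ suc (k ∸ 1)
  k≡1+[k∸1] = sym (m+[n∸m]≡n 0<k)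

  k∸1≡1+[k∸2] : k ∸ 1 ≡ suc (k ∸ 2)
  k∸1≡1+[k∸2] = ∸≡suc∸suc 1 k 2≤k

  1+[1+[k∸2]]≡k : 1 + suc (k ∸ 2) ≡ k
  1+[1+[k∸2]]≡k = trans (cong suc (sym k∸1≡1+[k∸2])) (sym k≡1+[k∸1])

  linked-Hy : ∀ j → suc j ≡ y → suc j < k → Linked (Owned (suc j)) (zigzag (suc j) 0 k (N ∷ []))
  linked-Hy j e jk = subst (λ z → Linked (Owned (suc j)) (zigzag (suc j) 0 z (N ∷ []))) (sym k≡1+[k∸1])
    (zigzag-linked (Owned (suc j)) (suc j) 0 (k ∸ 1) (N ∷ [])
      (λ s _ l2 → proj₁ (owned-slot (suc j) (up s) (suc j) jk (≤-trans l2 (≤-reflexive (sym k≡1+[k∸1]))) (cu s)))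
      (λ s _ l2 → proj₁ (owned-slot (suc j) (dn s) (suc j) jk (≤-trans (s≤s l2) (≤-reflexive (sym k≡1+[k∸1]))) refl))
      (subst (λ z → Linked (Owned (suc j)) ((suc j + z) ∷ N ∷ [])) k≡1+[k∸1]
        (proj₁ (owned-slot (suc j) infR (suc j) jk tt refl) ∷ [-])))
    where
    cu : ∀ s → classifyAt (suc j) (up s) ≡ onPath (suc j)
    cu zero = pathy-up0 j e
    cu (suc s) = refl

  linked-Hj : ∀ j → suc j ≢ y → suc j < k → Linked (Owned (suc j)) (pathHj (suc j))
  linked-Hj j ne jk = subst (λ z → Linked (Owned (suc j)) ((suc j + 1) ∷ zigzag (suc j) 1 z (N ∷ suc j ∷ []))) (sym k∸1≡1+[k∸2])
    (proj₁ (owned-slot (suc j) (dn 0) (suc j) jk (≤-trans (s≤s (s≤s z≤n)) 2≤k) refl) ∷ zigzag-linked (Owned (suc j)) (suc j) 1 (k ∸ 2) (N ∷ suc j ∷ [])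
      (λ s l1 l2 → proj₁ (owned-slot (suc j) (up s) (suc j) jk (≤-trans l2 (≤-reflexive 1+[1+[k∸2]]≡k)) (cu s l1)))
      (λ s _ l2 → proj₁ (owned-slot (suc j) (dn s) (suc j) jk (≤-trans (s≤s l2) (≤-trans (≤-reflexive (sym (+-suc 1 (k ∸ 2)))) (≤-reflexive 1+[1+[k∸2]]≡k))) refl))
      (subst (λ z → Linked (Owned (suc j)) ((suc j + z) ∷ N ∷ suc j ∷ [])) (sym 1+[1+[k∸2]]≡k)
        (proj₁ (owned-slot (suc j) infR (suc j) jk tt refl) ∷ (proj₁ (owned-slot (suc j) infL (suc j) jk tt (pathj-infL j ne)) ∷ [-]))))
    where
    cu : ∀ s → 1 ≤ s → classifyAt (suc j) (up s) ≡ onPath (suc j)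
    cu (suc s) _ = refl

  linked-extra-above : ∀ cnt → y + cnt ≡ k → Linked (Owned k) (ascending (y + 1) cnt [])
  linked-extra-above zero _ = []
  linked-extra-above (suc cnt) e = ascending-linked (Owned k) (y + 1) cnt []
    (λ x l1 l2 → proj₁ (owned-slot x (up 0) k (xk x l2) 0<k (cx x l1)))
    [-]
    where
    xk : ∀ x → x < y + 1 + cnt → x < k
    xk x l = ≤-trans l (≤-reflexive (trans (+-assoc y 1 cnt) e))
    cx : ∀ x → y + 1 ≤ x → classifyAt x (up 0) ≡ onPath k
    cx zero l = ⊥-elim (<⇒≱ (≤-trans (≤-reflexive (+-comm 1 y)) l) z≤n)
    cx (suc x) l = extra-up0 x (λ h → <⇒≱ (proj₂ h) (≤-trans (m≤m+n y 1) l))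
                            (λ h → <-irrefl refl (≤-trans (≤-reflexive (+-comm 1 y)) (subst (y + 1 ≤_) h l)))

  linked-extra-below : Linked (Owned k) (ascending 1 (suc c) [])
  linked-extra-below = ascending-linked (Owned k) 1 c []
    (λ x l1 l2 → proj₁ (owned-slot x (up 0) k (≤-trans l2 (≤-trans (n≤1+n _) c+2≤k)) 0<k (cx x l1 l2)))
    [-]
    where
    cx : ∀ x → 1 ≤ x → x < 1 + c → classifyAt x (up 0) ≡ onPath k
    cx (suc x) _ l = extra-up0 x (λ h → <⇒≱ (proj₁ h) (≤-pred l)) (λ h → <⇒≢ (≤-trans l c<y) h)

  linked-extra : Linked (Owned k) extraPath
  linked-extra with c ≟ 0
  ... | yes _ = linked-extra-above (k ∸ y) (m+[n∸m]≡n y≤k)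
  ... | no _ = linked-extra-below

  bounded-zigzag : ∀ j t c′ rest → j < k → t + c′ ≤ k → All (_< n) rest → All (_< n) (zigzag j t c′ rest)
  bounded-zigzag j t c′ rest jk tc a = All-zigzag (_< n) j t c′ rest (λ s _ sl → ≤-trans (sub<N j s jk (≤-trans sl tc)) (n≤1+n N) , ≤-trans (plus<N j s jk (≤-trans sl tc)) (n≤1+n N)) a

  bounded-ascending : ∀ lo len rest → lo + len ≤ n → All (_< n) rest → All (_< n) (ascending lo len rest)
  bounded-ascending lo len rest h a = All-ascending (_< n) lo len rest (λ x _ xl → ≤-trans xl h) a

  N<n : N < n
  N<n = ≤-refl

  ∞-not-on-zigzag : ∀ j t c′ → j < k → t + c′ ≤ k → ¬ OnZigzag j t c′ N
  ∞-not-on-zigzag j t c′ jk tc (s , _ , sl , inj₁ e) = <⇒≢ (sub<N j s jk (≤-trans sl tc)) (sym e)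
  ∞-not-on-zigzag j t c′ jk tc (s , _ , sl , inj₂ e) = <⇒≢ (plus<N j s jk (≤-trans sl tc)) (sym e)

  j-not-on-zigzag : ∀ j t c′ → j < k → 1 ≤ t → t + c′ ≤ k → ¬ OnZigzag j t c′ j
  j-not-on-zigzag j t c′ jk t1 tc (s , ts , sl , inj₁ e) = <⇒≢ (≤-trans t1 ts) (sub-injective j 0 s 0<k (≤-trans sl tc) e)
  j-not-on-zigzag j t c′ jk t1 tc (s , ts , sl , inj₂ e) = m+1+n≢m j (sym e)

  c+1+[k∸[c+1]]≤k : suc c + (k ∸ suc c) ≤ k
  c+1+[k∸[c+1]]≤k = ≤-reflexive (m+[n∸m]≡n (≤-trans (n≤1+n _) c+2≤k))

  end₀-ok : All (_< n) end₀ × Unique end₀ × All (λ x → ¬ OnZigzag 0 (suc c) (k ∸ suc c) x) end₀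
  end₀-ok with y <? k
  ... | yes _ = N<n ∷ [] , [] ∷ [] , ∞-not-on-zigzag 0 (suc c) (k ∸ suc c) 0<k c+1+[k∸[c+1]]≤k ∷ []
  ... | no _ = [] , [] , []

  pathH₀-ok : All (_< n) pathH₀ × Unique pathH₀
  pathH₀-ok = bounded-zigzag 0 (suc c) (k ∸ suc c) end₀ 0<k c+1+[k∸[c+1]]≤k (proj₁ end₀-ok) ,
              zigzag-unique 0 (suc c) (k ∸ suc c) end₀ 0<k c+1+[k∸[c+1]]≤k (proj₁ (proj₂ end₀-ok)) (proj₂ (proj₂ end₀-ok))

  pathHy-ok : y < k → All (_< n) pathHy × Unique pathHy
  pathHy-ok yk' = bounded-zigzag y 0 k (N ∷ []) yk' ≤-refl (N<n ∷ []) , zigzag-unique y 0 k (N ∷ []) yk' ≤-refl ([] ∷ []) (∞-not-on-zigzag y 0 k yk' ≤-refl ∷ [])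

  pathHj-ok : ∀ j → j < k → All (_< n) (pathHj j) × Unique (pathHj j)
  pathHj-ok j jk = (≤-trans (plus<N j 0 jk 0<k) (n≤1+n N) ∷ bounded-zigzag j 1 (k ∸ 1) (N ∷ j ∷ []) jk tc (N<n ∷ ≤-trans jk (≤-trans (m≤m+n k k) (n≤1+n N)) ∷ [])) ,
    (All-zigzag ((j + 1) ≢_) j 1 (k ∸ 1) (N ∷ j ∷ []) (λ s ts sl → (λ e → sub≢plus j s 0 jk (≤-trans sl tc) 0<k (sym e)) , (λ e → <⇒≢ ts (suc-injective (+-cancelˡ-≡ j 1 (suc s) e))))
       ((λ e → <⇒≢ (plus<N j 0 jk 0<k) e) ∷ (λ e → m+1+n≢m j e) ∷ [])) ∷
    zigzag-unique j 1 (k ∸ 1) (N ∷ j ∷ []) jk tc (((λ e → <⇒≢ (≤-trans jk (m≤m+n k k)) (sym e)) ∷ []) ∷ ([] ∷ []))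
       (∞-not-on-zigzag j 1 (k ∸ 1) jk tc ∷ j-not-on-zigzag j 1 (k ∸ 1) jk ≤-refl tc ∷ [])
    where
    tc : 1 + (k ∸ 1) ≤ k
    tc = ≤-reflexive (sym k≡1+[k∸1])

  extraPath-ok : All (_< n) extraPath × Unique extraPath
  extraPath-ok with c ≟ 0
  ... | yes _ = bounded-ascending (y + 1) (k ∸ y) [] (≤-trans (≤-reflexive (trans (+-assoc y 1 (k ∸ y)) (trans (+-suc y (k ∸ y)) (cong suc (m+[n∸m]≡n y≤k))))) (s≤s (m≤m+n k k))) [] , ascending-unique (y + 1) (k ∸ y) [] [] []
  ... | no _ = bounded-ascending 1 (suc c) [] (s≤s (≤-trans (≤-trans (n≤1+n _) c+2≤k) (m≤m+n k k))) [] , ascending-unique 1 (suc c) [] [] []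

  EdgeIn-pathHy : ∀ P → Valid P → (P ≡ infL → ⊥) → EdgeInℕ (proj₁ (pair y P)) (proj₂ (pair y P)) pathHy
  EdgeIn-pathHy infL v ne = ⊥-elim (ne refl)
  EdgeIn-pathHy infR v ne = subst (λ z → EdgeInℕ (y + z) N (zigzag y 0 z (N ∷ []))) (sym k≡1+[k∸1]) (EdgeIn-zigzag-last y 0 (k ∸ 1) N [])
  EdgeIn-pathHy (up t) v ne = EdgeIn-zigzag-up y 0 k (N ∷ []) t z≤n v
  EdgeIn-pathHy (dn t) v ne = EdgeIn-zigzag-dn k y 0 (N ∷ []) t z≤n v

  EdgeIn-pathHj′ : ∀ j d → 1 + suc d ≡ k → ∀ P → Valid P → (P ≡ up 0 → ⊥) → EdgeInℕ (proj₁ (pair j P)) (proj₂ (pair j P)) ((j + 1) ∷ zigzag j 1 (suc d) (N ∷ j ∷ []))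
  EdgeIn-pathHj′ j d e infL v ne = there (EdgeIn-zigzag-rest j 1 (suc d) _ (here (inj₁ (refl , refl))))
  EdgeIn-pathHj′ j d e infR v ne = there (subst (λ z → EdgeInℕ (j + z) N (zigzag j 1 (suc d) (N ∷ j ∷ []))) e (EdgeIn-zigzag-last j 1 d N (j ∷ [])))
  EdgeIn-pathHj′ j d e (up zero) v ne = ⊥-elim (ne refl)
  EdgeIn-pathHj′ j d e (up (suc t)) v ne = there (EdgeIn-zigzag-up j 1 (suc d) _ (suc t) (s≤s z≤n) (≤-trans v (≤-reflexive (sym e))))
  EdgeIn-pathHj′ j d e (dn zero) v ne = here (inj₁ (refl , refl))
  EdgeIn-pathHj′ j d e (dn (suc t)) v ne = there (EdgeIn-zigzag-dn (suc d) j 1 _ (suc t) (s≤s z≤n) (≤-trans v (≤-reflexive (sym e))))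

  EdgeIn-pathHj : ∀ j P → Valid P → (P ≡ up 0 → ⊥) → EdgeInℕ (proj₁ (pair j P)) (proj₂ (pair j P)) (pathHj j)
  EdgeIn-pathHj j P v ne = subst (λ z → EdgeInℕ (proj₁ (pair j P)) (proj₂ (pair j P)) ((j + 1) ∷ zigzag j 1 z (N ∷ j ∷ []))) (sym k∸1≡1+[k∸2])
    (EdgeIn-pathHj′ j (k ∸ 2) 1+[1+[k∸2]]≡k P v ne)

  EdgeIn-extra-above : ∀ cnt → y + cnt ≡ k → ∀ x → y < x → x < k → EdgeInℕ x (x + 1) (ascending (y + 1) cnt [])
  EdgeIn-extra-above zero e x yx xk = ⊥-elim (<⇒≱ yx (≤-trans (<⇒≤ xk) (≤-reflexive (trans (sym e) (+-identityʳ y)))))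
  EdgeIn-extra-above (suc cnt) e x yx xk = EdgeIn-ascending (y + 1) cnt [] x (≤-trans (≤-reflexive (+-comm y 1)) yx) (≤-trans xk (≤-reflexive (sym (trans (+-assoc y 1 cnt) e))))

  EdgeIn-extraPath : ∀ x → 1 ≤ x → x < k → ¬ (c < x × x < y) → x ≢ y → EdgeInℕ x (x + 1) extraPath
  EdgeIn-extraPath x x1 xk h ne with c ≟ 0
  ... | yes c0 = EdgeIn-extra-above (k ∸ y) (m+[n∸m]≡n y≤k) x (≤∧≢⇒< (≮⇒≥ (λ xy → h (subst (_< x) (sym c0) x1 , xy))) (λ e → ne (sym e))) xk
  ... | no c0 = let y≡k = [ (λ e → ⊥-elim (c0 e)) , (λ e → e) ]′ c≡0⊎y≡k in EdgeIn-ascending 1 c [] x x1 (s≤s (≮⇒≥ (λ cx → h (cx , ≤-trans xk (≤-reflexive (sym y≡k))))))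

  Placed : ℕ → ℕ × ℕ → Set
  Placed i p = i ≤ k × EdgeInℕ (proj₁ p) (proj₂ p) (paths i)

  EdgeIn-end₀ : y < k → EdgeInℕ k N pathH₀
  EdgeIn-end₀ y<k with y <? k
  ... | yes _ rewrite k∸[c+1]≡1+ℓ₀ = subst (λ z → EdgeInℕ z N (zigzag 0 (suc c) (suc ℓ₀) (N ∷ []))) (trans (sym (+-suc (suc c) ℓ₀)) c+1+[1+ℓ₀]≡k)
                             (EdgeIn-zigzag-last 0 (suc c) ℓ₀ N [])
  ... | no y≮k = ⊥-elim (y≮k y<k)

  placed-H₀ : ∀ P i → Valid P → classifyAt 0 P ≡ onPath i → Placed i (pair 0 P)
  placed-H₀ infL i v ()
  placed-H₀ infR i v e with y ≟ k
  ... | yes _ = ⊥-elim (tadpole≢onPath e)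
  ... | no y≢k rewrite sym (onPath-injective e) | paths-0 = z≤n , EdgeIn-end₀ (≤∧≢⇒< y≤k y≢k)
  placed-H₀ (up t) i v e with t ≤? c
  ... | yes _ = ⊥-elim (tadpole≢onPath e)
  ... | no t≰c rewrite sym (onPath-injective e) | paths-0 =
    z≤n , EdgeIn-zigzag-up 0 (suc c) (k ∸ suc c) end₀ t (≰⇒> t≰c) (≤-trans v (≤-reflexive (sym (m+[n∸m]≡n (≤-trans (n≤1+n _) c+2≤k)))))
  placed-H₀ (dn t) i v e with t ≤? c
  ... | yes _ = ⊥-elim (tadpole≢onPath e)
  ... | no t≰c rewrite sym (onPath-injective e) | paths-0 =
    z≤n , EdgeIn-zigzag-dn (k ∸ suc c) 0 (suc c) end₀ t (≰⇒> t≰c) (≤-trans v (≤-reflexive (sym (m+[n∸m]≡n (≤-trans (n≤1+n _) c+2≤k)))))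

  placed-H : ∀ j P i → suc j < k → Valid P → classifyAt (suc j) P ≡ onPath i → Placed i (pair (suc j) P)
  placed-H j P i j<k = go P
    where
    on-Hy : ∀ P → Valid P → P ≢ infL → suc j ≡ y → suc j ≡ i → Placed i (pair (suc j) P)
    on-Hy P v ne j≡y refl rewrite paths-y j j≡y j<k =
      <⇒≤ j<k , subst (λ z → EdgeInℕ (proj₁ (pair z P)) (proj₂ (pair z P)) pathHy) (sym j≡y) (EdgeIn-pathHy P v ne)
    on-Hj : ∀ P → Valid P → P ≢ up 0 → suc j ≢ y → suc j ≡ i → Placed i (pair (suc j) P)
    on-Hj P v ne j≢y refl rewrite paths-j j j≢y j<k = <⇒≤ j<k , EdgeIn-pathHj (suc j) P v ne
    on-own-cycle : ∀ P → Valid P → P ≢ infL → P ≢ up 0 → suc j ≡ i → Placed i (pair (suc j) P)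
    on-own-cycle P v ≢infL ≢up0 j≡i with suc j ≟ y
    ... | yes j≡y = on-Hy P v ≢infL j≡y j≡i
    ... | no j≢y = on-Hj P v ≢up0 j≢y j≡i
    on-extra : ¬ (c < suc j × suc j < y) → suc j ≢ y → k ≡ i → Placed i (pair (suc j) (up 0))
    on-extra outside j≢y refl rewrite paths-k = ≤-refl , EdgeIn-extraPath (suc j) (s≤s z≤n) j<k outside j≢y
    go : ∀ P → Valid P → classifyOther (suc j) P ≡ onPath i → Placed i (pair (suc j) P)
    go infL v e with suc j ≟ y
    ... | yes _ = ⊥-elim (tadpole≢onPath e)
    ... | no j≢y = on-Hj infL v (λ ()) j≢y (onPath-injective e)
    go infR v e = on-own-cycle infR v (λ ()) (λ ()) (onPath-injective e)
    go (up (suc t)) v e = on-own-cycle (up (suc t)) v (λ ()) (λ ()) (onPath-injective e)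
    go (dn t) v e = on-own-cycle (dn t) v (λ ()) (λ ()) (onPath-injective e)
    go (up zero) v e with c <? suc j | suc j <? y
    ... | yes _ | yes _ = ⊥-elim (tadpole≢onPath e)
    ... | yes _ | no j≮y with suc j ≟ y
    ...   | yes j≡y = on-Hy (up 0) v (λ ()) j≡y (onPath-injective e)
    ...   | no j≢y = on-extra (λ h → j≮y (proj₂ h)) j≢y (onPath-injective e)
    go (up zero) v e | no c≮j | _ with suc j ≟ y
    ...   | yes j≡y = on-Hy (up 0) v (λ ()) j≡y (onPath-injective e)
    ...   | no j≢y = on-extra (λ h → c≮j (proj₁ h)) j≢y (onPath-injective e)

  placed : ∀ j P i → j < k → Valid P → classifyAt j P ≡ onPath i → Placed i (pair j P)
  placed zero P i _ = placed-H₀ P i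
  placed (suc j) P i j<k = placed-H j P i j<k

  PathFacts : ℕ → Set
  PathFacts i = All (_< n) (paths i) × Unique (paths i) × Linked (Owned i) (paths i)

  path-facts : ∀ i → i ≤ k → PathFacts i
  path-facts i ik = go (i ≟ k)
    where
    at-k : PathFacts k
    at-k rewrite paths-k = proj₁ extraPath-ok , proj₂ extraPath-ok , linked-extra
    below-k : ∀ i → i < k → PathFacts i
    below-k zero _ rewrite paths-0 = proj₁ pathH₀-ok , proj₂ pathH₀-ok , linked-H₀
    below-k (suc j) jk with suc j ≟ y
    ... | yes ey rewrite paths-y j ey jk = proj₁ (pathHy-ok (subst (_< k) ey jk)) , proj₂ (pathHy-ok (subst (_< k) ey jk)) ,
                                        subst (λ z → Linked (Owned (suc j)) (zigzag z 0 k (N ∷ []))) ey (linked-Hy j ey jk)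
    ... | no ny rewrite paths-j j ny jk = proj₁ (pathHj-ok (suc j) jk) , proj₂ (pathHj-ok (suc j) jk) , linked-Hj j ny jk
    go : Dec (i ≡ k) → PathFacts i
    go (yes e) = subst PathFacts (sym e) at-k
    go (no ik') = below-k i (≤∧≢⇒< ik ik')

  regroup-length : ∀ ℓ c → suc (ℓ + suc (c + c + 1)) ≡ (suc c + ℓ) + suc (suc c)
  regroup-length = solve-∀

  m≡ : m ≡ y + suc (suc c)
  m≡ = trans (cong suc (trans (length-ascending (suc c + 1) ℓ tail) (cong (ℓ +_) (cong suc (length-zigzag 0 0 c (sub 0 c ∷ [])))))) (trans (regroup-length ℓ c) (cong (_+ suc (suc c)) c+1+ℓ≡y))

  tail′ : List ℕ
  tail′ = N ∷ zigzag 0 0 c (sub 0 c ∷ sub 0 (suc c) ∷ [])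

  vertices≡ : vertices ≡ ascending (suc c) (suc ℓ) tail′
  vertices≡ = cong (suc c ∷_) (trans (ascending-++ (suc c + 1) ℓ tail _) (cong (λ z → ascending (suc c + 1) ℓ (N ∷ z)) (zigzag-++ 0 0 c (sub 0 c ∷ []) _)))

  k<sub0 : ∀ s → 1 ≤ s → s < k → k < sub 0 s
  k<sub0 s s1 sk with sub-spec 0 s (≤-trans (<⇒≤ sk) (m≤m+n k k))
  ... | inj₁ (s0 , _) = ⊥-elim (<⇒≱ s1 s0)
  ... | inj₂ (_ , e) = +-cancelʳ-< s k (sub 0 s) (≤-trans (+-monoʳ-< k sk) (≤-reflexive (sym (trans e (+-identityʳ N)))))

  y<N : y < N
  y<N = ≤-trans (s≤s y≤k) (≤-trans (≤-reflexive (+-comm 1 k)) (+-monoʳ-≤ k 0<k))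

  c+1+[1+ℓ]≡1+y : suc c + suc ℓ ≡ suc y
  c+1+[1+ℓ]≡1+y = trans (+-suc (suc c) ℓ) (cong suc c+1+ℓ≡y)

  sub0-not-in-range : ∀ s → s < k → ¬ InRange (suc c) (suc ℓ) (sub 0 s)
  sub0-not-in-range zero _ (l , _) = <⇒≱ (s≤s z≤n) l
  sub0-not-in-range (suc s) sk (_ , h) = <⇒≱ (≤-trans (s≤s y≤k) (k<sub0 (suc s) (s≤s z≤n) sk)) (≤-pred (≤-trans h (≤-reflexive c+1+[1+ℓ]≡1+y)))

  vertices-ok : All (_< n) vertices × Unique vertices
  vertices-ok = subst (λ l → All (_< n) l × Unique l) (sym vertices≡) (bounded , unique)
    where
    tail-ends-bounded : All (_< n) (sub 0 c ∷ sub 0 (suc c) ∷ [])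
    tail-ends-bounded = ≤-trans (sub<N 0 c 0<k (≤-trans (n≤1+n _) c+2≤k)) (n≤1+n N) ∷ ≤-trans (sub<N 0 (suc c) 0<k c+2≤k) (n≤1+n N) ∷ []
    tail′-bounded : All (_< n) tail′
    tail′-bounded = N<n ∷ bounded-zigzag 0 0 c _ 0<k (≤-trans (n≤1+n _) (≤-trans (n≤1+n _) c+2≤k)) tail-ends-bounded
    bounded : All (_< n) (ascending (suc c) (suc ℓ) tail′)
    bounded = bounded-ascending (suc c) (suc ℓ) tail′ (≤-trans (≤-reflexive c+1+[1+ℓ]≡1+y) (s≤s (≤-trans y≤k (m≤m+n k k)))) tail′-bounded
    tail-ends-unique : Unique (sub 0 c ∷ sub 0 (suc c) ∷ [])
    tail-ends-unique = ((λ e → <⇒≢ (n<1+n c) (sub-injective 0 c (suc c) (≤-trans (n≤1+n _) c+2≤k) c+2≤k e)) ∷ []) ∷ ([] ∷ [])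
    sub0-off-zigzag : ∀ s' → c ≤ s' → s' < k → ¬ OnZigzag 0 0 c (sub 0 s')
    sub0-off-zigzag s' cs sk (s , _ , sl , inj₁ e) = <⇒≱ sl (≤-trans cs (≤-reflexive (sub-injective 0 s' s sk (≤-trans sl (≤-trans (n≤1+n _) (≤-trans (n≤1+n _) c+2≤k))) e)))
    sub0-off-zigzag s' cs sk (s , _ , sl , inj₂ e) = sub≢plus 0 s' s 0<k sk (≤-trans sl (≤-trans (n≤1+n _) (≤-trans (n≤1+n _) c+2≤k))) e
    tail′-unique : Unique tail′
    tail′-unique = All-zigzag (N ≢_) 0 0 c _ (λ s _ sl → (λ e → <⇒≢ (sub<N 0 s 0<k (sl' s sl)) (sym e)) , (λ e → <⇒≢ (plus<N 0 s 0<k (sl' s sl)) (sym e)))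
            ((λ e → <⇒≢ (sub<N 0 c 0<k (≤-trans (n≤1+n _) c+2≤k)) (sym e)) ∷ (λ e → <⇒≢ (sub<N 0 (suc c) 0<k c+2≤k) (sym e)) ∷ []) ∷
          zigzag-unique 0 0 c _ 0<k (≤-trans (n≤1+n _) (≤-trans (n≤1+n _) c+2≤k)) tail-ends-unique (sub0-off-zigzag c ≤-refl (≤-trans (n≤1+n _) c+2≤k) ∷ sub0-off-zigzag (suc c) (n≤1+n c) c+2≤k ∷ [])
      where
      sl' : ∀ s → s < 0 + c → s < k
      sl' s sl = ≤-trans sl (≤-trans (n≤1+n _) (≤-trans (n≤1+n _) c+2≤k))
    tail′-outside-range : All (λ x → ¬ InRange (suc c) (suc ℓ) x) tail′
    tail′-outside-range = (λ r → <⇒≱ y<N (≤-pred (≤-trans (proj₂ r) (≤-reflexive c+1+[1+ℓ]≡1+y)))) ∷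
            All-zigzag _ 0 0 c _ (λ s _ sl → sub0-not-in-range s (≤-trans sl (≤-trans (n≤1+n _) (≤-trans (n≤1+n _) c+2≤k))) ,
                                       (λ r → <⇒≱ (≤-trans (s≤s sl) (≤-reflexive refl)) (≤-pred (≤-trans (s≤s (proj₁ r)) ≤-refl))))
              (sub0-not-in-range c (≤-trans (n≤1+n _) c+2≤k) ∷ sub0-not-in-range (suc c) c+2≤k ∷ [])
    unique : Unique (ascending (suc c) (suc ℓ) tail′)
    unique = ascending-unique (suc c) (suc ℓ) tail′ tail′-unique tail′-outside-range

  decomposition : ∀ {m′} → y + suc (suc c) ≡ m′ → (f : Fin (suc m′) → Fin n) → Injective _≡_ _≡_ f →
    Σ (Fin (suc k) → List (Fin n)) (IsPathDecomposition (KminusT f) (suc k))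
  decomposition e = transport-decomposition (trans m≡ e) (proj₁ vertices-ok) (proj₂ vertices-ok)
    (owned-decomposition T⇒tadpole paths path-facts (λ e v → tadpole-class-edge (proj₁ e) (proj₂ e) (proj₁ v) (proj₂ v))
      (λ e i v → placed (proj₁ e) (proj₂ e) i (proj₁ v) (proj₂ v)))

-- The tadpole for n = 2k + 2 and m = y + 2 lives on 0, …, N-1, ∞ = N and W = N+1: its cycle
-- is ∞, 0, 1, …, y (closed by {y, ∞}) and its pendant vertex W hangs off ∞.  For i < k, path i
-- is H_i without its edges {i, i+1} and {i+k, i+k+1}: the zigzag middle i+1, i-1, …, i+k+1
-- is joined through W to what the tadpole leaves of i, ∞, i+k.  The removed edges {x, x+1}
-- not on the tadpole form the extra path y, y+1, …, N-1, 0.  When y > k the closing edge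
-- {y, ∞} is the edge {i₀ + k, ∞} of H_i₀.
module EvenOrder (k y : ℕ) (2≤k : 2 ≤ k) (1≤y : 1 ≤ y) (y<2k : y < k + k) where

  open import Function.Definitions using (Injective)
  open Walecki k
  open Segments k
  open Relabelling using (EdgeInℕ; here; there; EdgeIn-sym; SameEdge; OwnedEdge; TadpoleEdge; TadpoleAdj; TadpoleAdj-sym)
  open TadpoleLists
  open Classification
  open import Data.Nat hiding (_≤_; _<_; _+_; suc)
  open import Data.Nat.Properties
  open import Data.Fin using (Fin)
  open import Data.List using (List; []; _∷_; _++_)
  open import Data.List.Relation.Unary.All as All using (All; []; _∷_)
  open import Data.List.Relation.Unary.Unique.Propositional using (Unique)
  open import Data.List.Relation.Unary.AllPairs using ([]; _∷_)
  open import Data.List.Relation.Unary.Linked using (Linked; []; [-]; _∷_)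
  open import Data.Product using (Σ; _×_; _,_; proj₁; proj₂)
  open import Data.Sum using (_⊎_; inj₁; inj₂; [_,_]′)
  open import Data.Bool using (Bool; true; false)
  open import Data.Empty
  open import Data.Unit using (tt)
  open import Relation.Nullary
  open import Relation.Binary.PropositionalEquality
  open import Data.Nat.Tactic.RingSolver

  W : ℕ
  W = suc N

  n : ℕ
  n = suc W

  0<k : 0 < k
  0<k = ≤-trans (s≤s z≤n) 2≤k

  i₀ : ℕ
  i₀ with k <? y
  ... | yes _ = y ∸ k
  ... | no _ = k

  data Coord : Set where
    walecki : ℕ → Slot → Coord
    spoke : ℕ → Coord

  ValidCoord : Coord → Set
  ValidCoord (walecki j P) = j < k × Valid P
  ValidCoord (spoke x) = x ≤ N

  coordPair : Coord → ℕ × ℕ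
  coordPair (walecki j P) = pair j P
  coordPair (spoke x) = W , x

  coordPosition : ℕ → ℕ → Coord
  coordPosition a b with a ≟ W | b ≟ W
  ... | yes _ | _ = spoke b
  ... | no _ | yes _ = spoke a
  ... | no _ | no _ = walecki (proj₁ (position a b)) (proj₂ (position a b))

  ≤N⇒≢W : ∀ x → x ≤ N → x ≢ W
  ≤N⇒≢W x h e = <-irrefl refl (≤-trans (s≤s (≤-reflexive (sym e))) (s≤s h))

  pair≤N : ∀ j P → j < k → Valid P → proj₁ (pair j P) ≤ N × proj₂ (pair j P) ≤ N
  pair≤N j infL jk v = ≤-refl , ≤-trans (<⇒≤ jk) (m≤m+n k k)
  pair≤N j infR jk v = <⇒≤ (+-monoˡ-< k jk) , ≤-refl
  pair≤N j (up t) jk v = <⇒≤ (sub<N j t jk v) , <⇒≤ (plus<N j t jk v)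
  pair≤N j (dn t) jk v = <⇒≤ (plus<N j t jk (≤-trans (n≤1+n _) v)) , <⇒≤ (sub<N j (suc t) jk v)

  coordPosition-walecki : ∀ a b → a ≤ N → b ≤ N → coordPosition a b ≡ walecki (proj₁ (position a b)) (proj₂ (position a b))
  coordPosition-walecki a b aN bN with a ≟ W | b ≟ W
  ... | yes e | _ = ⊥-elim (≤N⇒≢W a aN e)
  ... | no _ | yes e = ⊥-elim (≤N⇒≢W b bN e)
  ... | no _ | no _ = refl

  coordPosition-pair : ∀ ep → ValidCoord ep → coordPosition (proj₁ (coordPair ep)) (proj₂ (coordPair ep)) ≡ ep × coordPosition (proj₂ (coordPair ep)) (proj₁ (coordPair ep)) ≡ ep
  coordPosition-pair (walecki j P) (jk , v) = trans (coordPosition-walecki _ _ (proj₁ (pair≤N j P jk v)) (proj₂ (pair≤N j P jk v))) (cong (λ p → walecki (proj₁ p) (proj₂ p)) (proj₁ (position-pair j P jk v))) ,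
                          trans (coordPosition-walecki _ _ (proj₂ (pair≤N j P jk v)) (proj₁ (pair≤N j P jk v))) (cong (λ p → walecki (proj₁ p) (proj₂ p)) (proj₂ (position-pair j P jk v)))
  coordPosition-pair (spoke x) xN = e1 , e2
    where
    e1 : coordPosition W x ≡ spoke x
    e1 with W ≟ W
    ... | yes _ = refl
    ... | no p = ⊥-elim (p refl)
    e2 : coordPosition x W ≡ spoke x
    e2 with x ≟ W | W ≟ W
    ... | yes e | _ = ⊥-elim (≤N⇒≢W x xN e)
    ... | no _ | yes _ = refl
    ... | no _ | no p = ⊥-elim (p refl)

  coordPosition-valid : ∀ a b → a ≤ W → b ≤ W → a ≢ b → ValidCoord (coordPosition a b) × SameEdge (coordPair (coordPosition a b)) a b
  coordPosition-valid a b aW bW ab with a ≟ W | b ≟ W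
  ... | yes refl | yes refl = ⊥-elim (ab refl)
  ... | yes refl | no q = ≤-pred (≤∧≢⇒< bW q) , inj₁ refl
  ... | no p | yes refl = ≤-pred (≤∧≢⇒< aW p) , inj₂ refl
  ... | no p | no q with position-valid a b (≤-pred (≤∧≢⇒< aW p)) (≤-pred (≤∧≢⇒< bW q)) ab
  ...   | v , sp = v , sp

  coordPair-distinct : ∀ ep → ValidCoord ep → proj₁ (coordPair ep) ≢ proj₂ (coordPair ep)
  coordPair-distinct (walecki j P) (jk , v) = pair-distinct j P jk v
  coordPair-distinct (spoke x) xN e = ≤N⇒≢W x xN (sym e)

  classifyWalecki : ℕ → Slot → Class
  classifyWalecki j infL with j ≟ 0 | j ≟ y
  ... | yes _ | _ = tadpole
  ... | no _ | yes _ = tadpole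
  ... | no _ | no _ = onPath j
  classifyWalecki j infR with j + k ≟ y
  ... | yes _ = tadpole
  ... | no _ = onPath j
  classifyWalecki j (up t) with t ≟ 0 | t ≟ k ∸ 1
  ... | yes _ | _ with j <? y
  ...   | yes _ = tadpole
  ...   | no _ = onPath k
  classifyWalecki j (up t) | no _ | yes _ with j + k <? y
  ...   | yes _ = tadpole
  ...   | no _ = onPath k
  classifyWalecki j (up t) | no _ | no _ = onPath j
  classifyWalecki j (dn t) = onPath j

  spokeOwner : ℕ → ℕ
  spokeOwner x with x <? k
  ... | yes _ with x ≟ 0 | x ≟ i₀
  ...   | yes _ | _ = k ∸ 1
  ...   | no _ | yes _ = i₀
  ...   | no _ | no _ = x ∸ 1
  spokeOwner x | no _ with x ∸ k ≟ i₀
  ...   | yes _ = i₀ ∸ 1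
  ...   | no _ = x ∸ k

  classify : Coord → Class
  classify (walecki j P) = classifyWalecki j P
  classify (spoke x) with x ≟ N
  ... | yes _ = tadpole
  ... | no _ = onPath (spokeOwner x)

  B : List ℕ
  B = ascending 0 (suc y) []

  open ListTadpole N B W public

  T : ℕ → ℕ → Set
  T = TadpoleAdj m vertex

  open Classify {n} {k} coordPair ValidCoord coordPosition coordPosition-pair
    (λ a b a<n b<n → coordPosition-valid a b (≤-pred a<n) (≤-pred b<n)) coordPair-distinct T TadpoleAdj-sym classify
    renaming (tadpole-pair to tadpole-coord; decomposition to owned-decomposition)

  lastOr-run : ∀ x lo q → lastOr x (ascending lo (suc q) []) ≡ lo + q
  lastOr-run x lo zero = sym (+-identityʳ lo)
  lastOr-run x lo (suc q) = trans (lastOr-run lo (lo + 1) q) (trans (+-assoc lo 1 q) refl)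

  last≡ : last ≡ y
  last≡ = lastOr-run N 0 y

  plus-k : ∀ j → j + suc (k ∸ 1) ≡ j + k
  plus-k j = cong (j +_) (m+[n∸m]≡n 0<k)

  sub-k-1 : ∀ j → j < k → j + suc k < N → sub j (k ∸ 1) ≡ j + suc k
  sub-k-1 j jk h = sym (sub-unique j (k ∸ 1) (j + suc k) h (≤-trans (m∸n≤m k 1) (m≤m+n k k)) (inj₂ eq))
    where
    eq : j + suc k + (k ∸ 1) ≡ j + N
    eq = wrap j k 0<k
      where
      regroup : ∀ j K → j + suc (suc K) + K ≡ j + (suc K + suc K)
      regroup = solve-∀
      wrap : ∀ j K → 1 ≤ K → j + suc K + (K ∸ 1) ≡ j + (K + K)
      wrap j (suc K) _ = regroup j K

  sub-self : sub (k ∸ 1) (k ∸ 1) ≡ 0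
  sub-self = sym (sub-unique (k ∸ 1) (k ∸ 1) 0 (≤-trans 0<k (m≤m+n k k)) (≤-trans (m∸n≤m k 1) (m≤m+n k k)) (inj₁ refl))

  tadpole-up0 : ∀ x → x < y → classifyWalecki x (up 0) ≡ tadpole
  tadpole-up0 x h with x <? y
  ... | yes _ = refl
  ... | no p = ⊥-elim (p h)

  k-1≢0 : k ∸ 1 ≢ 0
  k-1≢0 e = <⇒≱ 2≤k (≤-trans (≤-reflexive (sym (m+[n∸m]≡n 0<k))) (≤-reflexive (cong suc e)))

  tadpole-upK : ∀ j → j + k < y → classifyWalecki j (up (k ∸ 1)) ≡ tadpole
  tadpole-upK j h with k ∸ 1 ≟ 0 | k ∸ 1 ≟ k ∸ 1
  ... | yes e | _ = ⊥-elim (k-1≢0 e)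
  ... | no _ | no p = ⊥-elim (p refl)
  ... | no _ | yes _ with j + k <? y
  ...   | yes _ = refl
  ...   | no p = ⊥-elim (p h)

  k-1<k : k ∸ 1 < k
  k-1<k = ≤-trans (≤-reflexive (m+[n∸m]≡n 0<k)) ≤-refl

  y≤N : y ≤ N
  y≤N = <⇒≤ y<2k

  tadpole-run-high : ∀ x → k ≤ x → x < y → Tadpole x (x + 1)
  tadpole-run-high x kx xy = subst₂ Tadpole (trans (plus-k j) xe) (trans (sub-k-1 j jk j1) (trans (+-suc j k) (trans (cong suc xe) (+-comm 1 x))))
      (proj₂ (tadpole-coord (walecki j (up (k ∸ 1))) (jk , k-1<k) (tadpole-upK j (≤-trans (s≤s (≤-reflexive xe)) xy))))
    where
    j : ℕ
    j = x ∸ k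
    xe : j + k ≡ x
    xe = m∸n+n≡m kx
    jk : j < k
    jk = +-cancelʳ-< k j k (≤-trans (s≤s (≤-reflexive xe)) (≤-trans xy y≤N))
    j1 : j + suc k < N
    j1 = ≤-trans (s≤s (≤-reflexive (trans (+-suc j k) (cong suc xe)))) (≤-trans (s≤s xy) y<2k)

  tadpole-along-cycle : Linked Tadpole cycle
  tadpole-along-cycle = proj₁ (tadpole-coord (walecki 0 infL) (0<k , tt) refl) ∷ ascending-linked Tadpole 0 y [] h [-]
    where
    h : ∀ x → 0 ≤ x → x < 0 + y → Tadpole x (x + 1)
    h x _ xy with x <? k
    ... | yes xk = proj₁ (tadpole-coord (walecki x (up 0)) (xk , 0<k) (tadpole-up0 x xy))
    ... | no xk = tadpole-run-high x (≮⇒≥ xk) xy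

  tadpole-y-infL : ∀ j → j ≡ y → classifyWalecki j infL ≡ tadpole
  tadpole-y-infL j e with j ≟ 0 | j ≟ y
  ... | yes _ | _ = refl
  ... | no _ | yes _ = refl
  ... | no _ | no p = ⊥-elim (p e)

  tadpole-y-infR : ∀ j → j + k ≡ y → classifyWalecki j infR ≡ tadpole
  tadpole-y-infR j e with j + k ≟ y
  ... | yes _ = refl
  ... | no p = ⊥-elim (p e)

  tadpole-pendant : classify (spoke N) ≡ tadpole
  tadpole-pendant with N ≟ N
  ... | yes _ = refl
  ... | no p = ⊥-elim (p refl)

  tadpole-closing : Tadpole y N
  tadpole-closing with y <? k
  ... | yes yk = proj₂ (tadpole-coord (walecki y infL) (yk , tt) (tadpole-y-infL y refl))
  ... | no yk = subst (λ z → Tadpole z N) (m∸n+n≡m (≮⇒≥ yk)) (proj₁ (tadpole-coord (walecki (y ∸ k) infR) (jk , tt) (tadpole-y-infR (y ∸ k) (m∸n+n≡m (≮⇒≥ yk)))))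
    where
    jk : y ∸ k < k
    jk = +-cancelʳ-< k (y ∸ k) k (≤-trans (s≤s (≤-reflexive (m∸n+n≡m (≮⇒≥ yk)))) y<2k)

  tadpole-edge : ∀ {a b} → TadpoleEdge m vertex a b → Tadpole a b
  tadpole-edge = edges-satisfy tadpole-along-cycle (subst (λ z → Tadpole z N) (sym last≡) tadpole-closing) (proj₂ (tadpole-coord (spoke N) ≤-refl tadpole-pendant))

  T⇒tadpole : ∀ {a b} → T a b → Tadpole a b
  T⇒tadpole (inj₁ t) = tadpole-edge t
  T⇒tadpole (inj₂ t) = proj₂ (tadpole-edge t) , proj₁ (tadpole-edge t)

  Owned : ℕ → ℕ → ℕ → Set
  Owned i = OwnedEdge T owner (toFin i)

  owned-coord : ∀ e i → ValidCoord e → classify e ≡ onPath i →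
    Owned i (proj₁ (coordPair e)) (proj₂ (coordPair e)) × Owned i (proj₂ (coordPair e)) (proj₁ (coordPair e))
  owned-coord = owned-pair T⇒tadpole

  closing-T : T y N
  closing-T = inj₁ (subst (λ z → TadpoleEdge m vertex z N) last≡ closing-edge)

  tadpole-class-edge : ∀ ep → ValidCoord ep → classify ep ≡ tadpole → T (proj₁ (coordPair ep)) (proj₂ (coordPair ep))
  tadpole-class-edge (spoke x) v e with x ≟ N
  ... | yes refl = inj₂ pendant-edge
  ... | no _ = ⊥-elim (onPath≢tadpole e)
  tadpole-class-edge (walecki j infL) v e with j ≟ 0 | j ≟ y
  ... | yes refl | _ = inj₁ (consecutive-edge here)
  ... | no _ | yes refl = TadpoleAdj-sym closing-T
  ... | no _ | no _ = ⊥-elim (onPath≢tadpole e)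
  tadpole-class-edge (walecki j infR) v e with j + k ≟ y
  ... | yes ey = subst (λ z → T z N) (sym ey) closing-T
  ... | no _ = ⊥-elim (onPath≢tadpole e)
  tadpole-class-edge (walecki j (dn t)) v ()
  tadpole-class-edge (walecki j (up t)) (jk , tk) e with t ≟ 0 | t ≟ k ∸ 1
  ... | yes refl | _ = g e
    where
    g : classifyWalecki j (up 0) ≡ tadpole → T (sub j 0) (j + 1)
    g e' with j <? y
    ... | yes jy = cycle-edge (there (EdgeIn-ascending 0 y [] j z≤n jy))
    ... | no _ = ⊥-elim (onPath≢tadpole e')
  ... | no t0 | yes refl with j + k <? y
  ...   | no _ = ⊥-elim (onPath≢tadpole e)
  ...   | yes jy = TadpoleAdj-sym (subst₂ T (sym (plus-k j)) (sym (trans (sub-k-1 j jk j1) (trans (+-suc j k) (+-comm 1 (j + k))))) (cycle-edge (there (EdgeIn-ascending 0 y [] (j + k) z≤n jy))))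
      where
      j1 : j + suc k < N
      j1 = ≤-trans (s≤s (≤-reflexive (+-suc j k))) (≤-trans (s≤s jy) y<2k)
  tadpole-class-edge (walecki j (up t)) (jk , tk) e | no t0 | no tk' = ⊥-elim (onPath≢tadpole e)

  middle : ℕ → List ℕ → List ℕ
  middle i rest = (i + 1) ∷ zigzag i 1 (k ∸ 2) (sub i (k ∸ 1) ∷ rest)

  path-up-middle : ∀ i t → 1 ≤ t → t < k ∸ 1 → classifyWalecki i (up t) ≡ onPath i
  path-up-middle i t t1 tk with t ≟ 0 | t ≟ k ∸ 1
  ... | yes e | _ = ⊥-elim (<⇒≢ t1 (sym e))
  ... | no _ | yes e = ⊥-elim (<⇒≢ tk e)
  ... | no _ | no _ = refl

  k-1≡suc : ∀ d → k ∸ 2 ≡ d → k ∸ 1 ≡ suc d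
  k-1≡suc d e = trans (∸≡suc∸suc 1 k 2≤k) (cong suc e)

  linked-middle′ : ∀ i d rest → i < k → k ∸ 2 ≡ d → Linked (Owned i) (sub i (k ∸ 1) ∷ rest) → Linked (Owned i) (middle i rest)
  linked-middle′ i zero rest ik e h rewrite e | k-1≡suc 0 e = proj₁ (owned-coord (walecki i (dn 0)) i (ik , 2≤k) refl) ∷ h
  linked-middle′ i (suc d) rest ik e h rewrite e | k-1≡suc (suc d) e =
    proj₁ (owned-coord (walecki i (dn 0)) i (ik , vdn 0 z≤n) refl) ∷
    zigzag-linked (Owned i) i 1 d (sub i (suc (suc d)) ∷ rest)
      (λ s l1 l2 → proj₁ (owned-coord (walecki i (up s)) i (ik , ≤-trans l2 vup) (path-up-middle i s l1 (≤-trans l2 (≤-reflexive (sym (k-1≡suc (suc d) e)))))))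
      (λ s l1 l2 → proj₁ (owned-coord (walecki i (dn s)) i (ik , vdn s (≤-trans (n≤1+n s) l2)) refl))
      (proj₁ (owned-coord (walecki i (dn (suc d))) i (ik , vdn (suc d) ≤-refl) refl) ∷ h)
    where
    vup : suc (suc d) ≤ k
    vup = ≤-trans (≤-reflexive (sym (k-1≡suc (suc d) e))) (m∸n≤m k 1)
    vdn : ∀ s → s ≤ suc d → suc s < k
    vdn s sd = ≤-trans (s≤s (s≤s sd)) (≤-trans (≤-reflexive (cong suc (sym (k-1≡suc (suc d) e)))) (≤-reflexive (m+[n∸m]≡n 0<k)))

  linked-middle : ∀ i rest → i < k → Linked (Owned i) (sub i (k ∸ 1) ∷ rest) → Linked (Owned i) (middle i rest)
  linked-middle i rest ik h = linked-middle′ i (k ∸ 2) rest ik refl h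

  EdgeIn-middle-rest : ∀ {u v} i rest → EdgeInℕ u v (sub i (k ∸ 1) ∷ rest) → EdgeInℕ u v (middle i rest)
  EdgeIn-middle-rest i rest e = there (EdgeIn-zigzag-rest i 1 (k ∸ 2) _ e)

  EdgeIn-middle-dn′ : ∀ i d rest t → k ∸ 2 ≡ d → suc t < k → EdgeInℕ (proj₁ (pair i (dn t))) (proj₂ (pair i (dn t))) (middle i rest)
  EdgeIn-middle-dn′ i zero rest zero e tk rewrite e | k-1≡suc 0 e = here (inj₁ (refl , refl))
  EdgeIn-middle-dn′ i zero rest (suc t) e tk = ⊥-elim (<⇒≱ tk (≤-trans (≤-reflexive (trans (sym (m+[n∸m]≡n 2≤k)) (cong (2 +_) e))) (s≤s (s≤s z≤n))))
  EdgeIn-middle-dn′ i (suc d) rest zero e tk rewrite e = here (inj₁ (refl , refl))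
  EdgeIn-middle-dn′ i (suc d) rest (suc t) e tk rewrite e with suc t ≟ suc d
  ... | yes refl rewrite k-1≡suc (suc d) e = there (EdgeIn-zigzag-last i 1 d (sub i (suc (suc d))) rest)
  ... | no ne = there (EdgeIn-zigzag-dn (suc d) i 1 _ (suc t) (s≤s z≤n) (≤∧≢⇒< (≤-pred (≤-trans tk (≤-reflexive (trans (sym (m+[n∸m]≡n {2} 2≤k)) (cong (λ z → 2 + z) e))))) (λ x → ne (suc-injective x))))

  EdgeIn-middle-dn : ∀ i rest t → suc t < k → EdgeInℕ (proj₁ (pair i (dn t))) (proj₂ (pair i (dn t))) (middle i rest)
  EdgeIn-middle-dn i rest t tk = EdgeIn-middle-dn′ i (k ∸ 2) rest t refl tk

  EdgeIn-middle-up : ∀ i rest t → 1 ≤ t → t < k ∸ 1 → EdgeInℕ (proj₁ (pair i (up t))) (proj₂ (pair i (up t))) (middle i rest)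
  EdgeIn-middle-up i rest t t1 tk = there (EdgeIn-zigzag-up i 1 (k ∸ 2) _ t t1 (≤-trans tk (≤-reflexive (k-1≡suc (k ∸ 2) refl))))

  OffMiddle : ℕ → ℕ → Set
  OffMiddle i x = x ≡ i ⊎ x ≡ i + k ⊎ N ≤ x

  sub-off-middle : ∀ i s → i < k → 1 ≤ s → s < k → ¬ OffMiddle i (sub i s)
  sub-off-middle i s ik s1 sk (inj₁ e) = <⇒≢ s1 (sub-injective i 0 s 0<k sk (sym e))
  sub-off-middle i s ik s1 sk (inj₂ (inj₁ e)) = sub≢plus i s (k ∸ 1) ik sk k-1<k (trans e (sym (plus-k i)))
  sub-off-middle i s ik s1 sk (inj₂ (inj₂ e)) = <⇒≱ (sub<N i s ik sk) e

  plus-off-middle : ∀ i s → i < k → suc s < k → ¬ OffMiddle i (i + suc s)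
  plus-off-middle i s ik sk (inj₁ e) = m+1+n≢m i e
  plus-off-middle i s ik sk (inj₂ (inj₁ e)) = <⇒≢ sk (+-cancelˡ-≡ i (suc s) k e)
  plus-off-middle i s ik sk (inj₂ (inj₂ e)) = <⇒≱ (plus<N i s ik (≤-trans (n≤1+n _) sk)) e

  <N⇒<n : ∀ x → x < N → x < n
  <N⇒<n x h = ≤-trans h (≤-trans (n≤1+n N) (n≤1+n W))

  bounded-middle : ∀ i rest → i < k → All (_< n) rest → All (_< n) (middle i rest)
  bounded-middle i rest ik a = <N⇒<n _ (plus<N i 0 ik 0<k) ∷ All-zigzag (_< n) i 1 (k ∸ 2) _ (λ s _ sl → <N⇒<n _ (sub<N i s ik (sk s sl)) , <N⇒<n _ (plus<N i s ik (sk s sl))) (<N⇒<n _ (sub<N i (k ∸ 1) ik k-1<k) ∷ a)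
    where
    sk : ∀ s → s < 1 + (k ∸ 2) → s < k
    sk s sl = ≤-trans sl (≤-trans (≤-reflexive (sym (k-1≡suc (k ∸ 2) refl))) (m∸n≤m k 1))

  middle-unique : ∀ i rest → i < k → Unique rest → All (OffMiddle i) rest → Unique (middle i rest)
  middle-unique i rest ik u a =
    All-zigzag ((i + 1) ≢_) i 1 (k ∸ 2) _ (λ s ts sl → (λ e → sub≢plus i s 0 ik (sk s sl) 0<k (sym e)) , (λ e → <⇒≢ ts (suc-injective (+-cancelˡ-≡ i 1 (suc s) e))))
      ((λ e → sub≢plus i (k ∸ 1) 0 ik k-1<k 0<k (sym e)) ∷ All.map (λ ok e → plus-off-middle i 0 ik 2≤k (subst (OffMiddle i) (sym e) ok)) a) ∷
    zigzag-unique i 1 (k ∸ 2) _ ik (≤-trans (≤-reflexive (sym (k-1≡suc (k ∸ 2) refl))) (m∸n≤m k 1))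
      (All.map (λ ok e → sub-off-middle i (k ∸ 1) ik k1' k-1<k (subst (OffMiddle i) (sym e) ok)) a ∷ u)
      (nbvS ∷ All.map (λ {x} ok bv → nbvOK x ok bv) a)
    where
    sk : ∀ s → s < 1 + (k ∸ 2) → s < k
    sk s sl = ≤-trans sl (≤-trans (≤-reflexive (sym (k-1≡suc (k ∸ 2) refl))) (m∸n≤m k 1))
    k1' : 1 ≤ k ∸ 1
    k1' = ≤-trans (s≤s z≤n) (≤-reflexive (sym (k-1≡suc (k ∸ 2) refl)))
    nbvS : ¬ OnZigzag i 1 (k ∸ 2) (sub i (k ∸ 1))
    nbvS (s , _ , sl , inj₁ e) = <⇒≢ (≤-trans sl (≤-reflexive (sym (k-1≡suc (k ∸ 2) refl)))) (sym (sub-injective i (k ∸ 1) s k-1<k (sk s sl) e))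
    nbvS (s , _ , sl , inj₂ e) = sub≢plus i (k ∸ 1) s ik k-1<k (sk s sl) e
    nbvOK : ∀ x → OffMiddle i x → ¬ OnZigzag i 1 (k ∸ 2) x
    nbvOK x ok (s , ts , sl , inj₁ e) = sub-off-middle i s ik ts (sk s sl) (subst (OffMiddle i) e ok)
    nbvOK x ok (s , ts , sl , inj₂ e) = plus-off-middle i s ik (≤-trans (s≤s sl) (≤-trans (≤-reflexive (cong suc (sym (k-1≡suc (k ∸ 2) refl)))) (≤-reflexive (m+[n∸m]≡n 0<k)))) (subst (OffMiddle i) e ok)


  data EndCase : Set where
    at-i₀ at-0-y≡k at-0 at-y elsewhere : EndCase

  endCase : ℕ → EndCase
  endCase i with i ≟ i₀
  ... | yes _ = at-i₀
  ... | no _ with i ≟ 0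
  ...   | yes _ with y ≟ k
  ...     | yes _ = at-0-y≡k
  ...     | no _ = at-0
  endCase i | no _ | no _ with i ≟ y
  ...     | yes _ = at-y
  ...     | no _ = elsewhere

  endsAfter : ℕ → EndCase → List ℕ
  endsAfter i at-i₀ = i ∷ N ∷ []
  endsAfter i at-0-y≡k = (i + k) ∷ []
  endsAfter i at-0 = (i + k) ∷ N ∷ []
  endsAfter i at-y = (i + k) ∷ N ∷ []
  endsAfter i elsewhere = (i + k) ∷ N ∷ i ∷ []

  endsBefore : ℕ → EndCase → List ℕ
  endsBefore i at-i₀ = N ∷ i ∷ []
  endsBefore i at-0-y≡k = (i + k) ∷ []
  endsBefore i at-0 = N ∷ (i + k) ∷ []
  endsBefore i at-y = N ∷ (i + k) ∷ []
  endsBefore i elsewhere = i ∷ N ∷ (i + k) ∷ []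

  walk : ℕ → EndCase → Bool → List ℕ
  walk i end true = middle i (W ∷ endsAfter i end)
  walk i end false = endsBefore i end ++ (W ∷ middle i [])

  attachLast : ℕ → Bool
  attachLast i with suc i ≟ i₀ | suc i ≟ k
  ... | yes _ | _ = true
  ... | no _ | yes _ = true
  ... | no _ | no _ = false

  extraPath : List ℕ
  extraPath = ascending y (N ∸ y) (0 ∷ [])

  paths : ℕ → List ℕ
  paths i with i ≟ k
  ... | yes _ = extraPath
  ... | no _ = walk i (endCase i) (attachLast i)

  EndCaseOK : ℕ → EndCase → Set
  EndCaseOK i at-i₀ = i ≡ i₀
  EndCaseOK i at-0-y≡k = i ≡ 0 × y ≡ k × i ≢ i₀
  EndCaseOK i at-0 = i ≡ 0 × y ≢ k × i ≢ i₀
  EndCaseOK i at-y = i ≡ y × i ≢ 0 × i ≢ i₀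
  EndCaseOK i elsewhere = i ≢ 0 × i ≢ y × i ≢ i₀

  endCase-ok : ∀ i → EndCaseOK i (endCase i)
  endCase-ok i with i ≟ i₀
  ... | yes e = e
  ... | no n0 with i ≟ 0
  ...   | yes e with y ≟ k
  ...     | yes e' = e , e' , n0
  ...     | no e' = e , e' , n0
  endCase-ok i | no n0 | no n1 with i ≟ y
  ...     | yes e = e , n1 , n0
  ...     | no e = n1 , e , n0

  AttachOK : ℕ → Bool → Set
  AttachOK i true = suc i ≡ i₀ ⊎ suc i ≡ k
  AttachOK i false = suc i ≢ i₀ × suc i ≢ k

  attach-ok : ∀ i → AttachOK i (attachLast i)
  attach-ok i with suc i ≟ i₀ | suc i ≟ k
  ... | yes e | _ = inj₁ e
  ... | no _ | yes e = inj₂ e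
  ... | no a | no b = a , b

  i₀-pos : 1 ≤ i₀
  i₀-pos with k <? y
  ... | yes p = ≤-trans (s≤s z≤n) (+-cancelʳ-< k 0 (y ∸ k) (≤-trans p (≤-reflexive (sym (m∸n+n≡m (<⇒≤ p))))))
  ... | no _ = 0<k

  i₀-y : i₀ < k → i₀ + k ≡ y
  i₀-y h with k <? y
  ... | yes p = m∸n+n≡m (<⇒≤ p)
  ... | no _ = ⊥-elim (<-irrefl refl h)

  i₀-k : ¬ (k < y) → i₀ ≡ k
  i₀-k h with k <? y
  ... | yes p = ⊥-elim (h p)
  ... | no _ = refl

  i₀-lt : k < y → i₀ < k
  i₀-lt h with k <? y
  ... | yes p = +-cancelʳ-< k (y ∸ k) k (≤-trans (s≤s (≤-reflexive (m∸n+n≡m (<⇒≤ p)))) y<2k)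
  ... | no q = ⊥-elim (q h)

  spokeOwner-i₀ : i₀ < k → spokeOwner i₀ ≡ i₀
  spokeOwner-i₀ h with i₀ <? k
  ... | no p = ⊥-elim (p h)
  ... | yes _ with i₀ ≟ 0 | i₀ ≟ i₀
  ...   | yes e | _ = ⊥-elim (<⇒≢ i₀-pos (sym e))
  ...   | no _ | yes _ = refl
  ...   | no _ | no p = ⊥-elim (p refl)

  spokeOwner-high-i₀ : ∀ x → k ≤ x → x ∸ k ≡ i₀ → spokeOwner x ≡ i₀ ∸ 1
  spokeOwner-high-i₀ x kx e with x <? k
  ... | yes p = ⊥-elim (<⇒≱ p kx)
  ... | no _ with x ∸ k ≟ i₀
  ...   | yes _ = refl
  ...   | no p = ⊥-elim (p e)

  spokeOwner-high : ∀ x → k ≤ x → x ∸ k ≢ i₀ → spokeOwner x ≡ x ∸ k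
  spokeOwner-high x kx e with x <? k
  ... | yes p = ⊥-elim (<⇒≱ p kx)
  ... | no _ with x ∸ k ≟ i₀
  ...   | yes p = ⊥-elim (e p)
  ...   | no _ = refl

  spokeOwner-outer : ∀ i → i < k → i ≢ i₀ → spokeOwner (i + k) ≡ i
  spokeOwner-outer i ik ne = trans (spokeOwner-high (i + k) (m≤n+m k i) (λ e → ne (trans (sym (m+n∸n≡m i k)) e))) (m+n∸n≡m i k)

  spokeOwner-first : ∀ i → suc i < k → suc i ≢ i₀ → spokeOwner (i + 1) ≡ i
  spokeOwner-first i ik ne rewrite +-comm i 1 with suc i <? k
  ... | no p = ⊥-elim (p ik)
  ... | yes _ with suc i ≟ 0 | suc i ≟ i₀
  ...   | yes () | _
  ...   | no _ | yes e = ⊥-elim (ne e)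
  ...   | no _ | no _ = refl

  spokeOwner-0 : spokeOwner 0 ≡ k ∸ 1
  spokeOwner-0 with 0 <? k
  ... | no p = ⊥-elim (p 0<k)
  ... | yes _ = refl

  spokeOwner-last : ∀ i → i < k → AttachOK i true → spokeOwner (sub i (k ∸ 1)) ≡ i
  spokeOwner-last i ik (inj₂ e) = trans (cong (λ z → spokeOwner (sub z (k ∸ 1))) ie) (trans (cong spokeOwner sub-self) (trans spokeOwner-0 (sym ie)))
    where
    ie : i ≡ k ∸ 1
    ie = trans (sym (m+n∸m≡n 1 i)) (cong (_∸ 1) e)
  spokeOwner-last i ik (inj₁ e) with suc i ≟ k
  ... | yes e2 = spokeOwner-last i ik (inj₂ e2)
  ... | no ne2 = trans (cong spokeOwner (sub-k-1 i ik j1)) w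
    where
    i0k : i₀ < k
    i0k = subst (_< k) e (≤∧≢⇒< ik ne2)
    yv : i + suc k ≡ y
    yv = trans (+-suc i k) (trans (cong (_+ k) e) (i₀-y i0k))
    j1 : i + suc k < N
    j1 = ≤-trans (≤-reflexive (cong suc yv)) y<2k
    w : spokeOwner (i + suc k) ≡ i
    w = trans (spokeOwner-high-i₀ (i + suc k) (≤-trans (n≤1+n k) (m≤n+m (suc k) i)) (trans (cong (_∸ k) (+-suc i k)) (trans (m+n∸n≡m (suc i) k) e))) (cong (_∸ 1) (sym e))

  path-infL : ∀ i → i ≢ 0 → i ≢ y → classifyWalecki i infL ≡ onPath i
  path-infL i n0 ny with i ≟ 0 | i ≟ y
  ... | yes e | _ = ⊥-elim (n0 e)
  ... | no _ | yes e = ⊥-elim (ny e)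
  ... | no _ | no _ = refl

  path-infR : ∀ i → i + k ≢ y → classifyWalecki i infR ≡ onPath i
  path-infR i ne with i + k ≟ y
  ... | yes e = ⊥-elim (ne e)
  ... | no _ = refl

  path-spoke : ∀ x → x ≢ N → classify (spoke x) ≡ onPath (spokeOwner x)
  path-spoke x ne with x ≟ N
  ... | yes e = ⊥-elim (ne e)
  ... | no _ = refl

  i+k≢y : ∀ i → i ≢ i₀ → i ≢ 0 → i + k ≢ y
  i+k≢y i n0 nz e = go (k <? y)
    where
    go : Dec (k < y) → ⊥
    go (yes p) = n0 (+-cancelʳ-≡ k i i₀ (trans e (sym (i₀-y (i₀-lt p)))))
    go (no p) = nz (+-cancelʳ-≡ k i 0 (trans e (≤-antisym (≮⇒≥ p) (≤-trans (m≤n+m k i) (≤-reflexive e)))))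

  i<N : ∀ i → i < k → i < N
  i<N i ik = ≤-trans ik (m≤m+n k k)

  i+k<N : ∀ i → i < k → i + k < N
  i+k<N i ik = +-monoˡ-< k ik

  owned-infL : ∀ i → i < k → i ≢ 0 → i ≢ y → Owned i N i × Owned i i N
  owned-infL i ik n0 ny = owned-coord (walecki i infL) i (ik , tt) (path-infL i n0 ny)

  owned-infR : ∀ i → i < k → i + k ≢ y → Owned i (i + k) N × Owned i N (i + k)
  owned-infR i ik ne = owned-coord (walecki i infR) i (ik , tt) (path-infR i ne)

  owned-spoke : ∀ x i → x < N → spokeOwner x ≡ i → Owned i W x × Owned i x W
  owned-spoke x i xN e = owned-coord (spoke x) i (<⇒≤ xN) (trans (path-spoke x (<⇒≢ xN)) (cong onPath e))

  wOuter : ℕ → EndCase → ℕ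
  wOuter i at-i₀ = i
  wOuter i at-0-y≡k = i + k
  wOuter i at-0 = i + k
  wOuter i at-y = i + k
  wOuter i elsewhere = i + k

  wMiddle : ℕ → Bool → ℕ
  wMiddle i true = sub i (k ∸ 1)
  wMiddle i false = i + 1

  i₀<k : ∀ i → i < k → i ≡ i₀ → i₀ < k
  i₀<k i ik e = subst (_< k) e ik

  spokeOwner-wOuter : ∀ i end → i < k → EndCaseOK i end → spokeOwner (wOuter i end) ≡ i
  spokeOwner-wOuter i at-i₀ ik e = trans (cong spokeOwner e) (trans (spokeOwner-i₀ (i₀<k i ik e)) (sym e))
  spokeOwner-wOuter i at-0-y≡k ik (_ , _ , n) = spokeOwner-outer i ik n
  spokeOwner-wOuter i at-0 ik (_ , _ , n) = spokeOwner-outer i ik n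
  spokeOwner-wOuter i at-y ik (_ , _ , n) = spokeOwner-outer i ik n
  spokeOwner-wOuter i elsewhere ik (_ , _ , n) = spokeOwner-outer i ik n

  wOuter<N : ∀ i end → i < k → wOuter i end < N
  wOuter<N i at-i₀ ik = i<N i ik
  wOuter<N i at-0-y≡k ik = i+k<N i ik
  wOuter<N i at-0 ik = i+k<N i ik
  wOuter<N i at-y ik = i+k<N i ik
  wOuter<N i elsewhere ik = i+k<N i ik

  wMiddle<N : ∀ i s → i < k → AttachOK i s → wMiddle i s < N
  wMiddle<N i true ik _ = sub<N i (k ∸ 1) ik k-1<k
  wMiddle<N i false ik _ = plus<N i 0 ik 0<k

  spokeOwner-wMiddle : ∀ i s → i < k → AttachOK i s → spokeOwner (wMiddle i s) ≡ i
  spokeOwner-wMiddle i true ik h = spokeOwner-last i ik h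
  spokeOwner-wMiddle i false ik (n1 , n2) = spokeOwner-first i (≤∧≢⇒< ik n2) n1

  i₀-case≢0 : ∀ i → i ≡ i₀ → i ≢ 0
  i₀-case≢0 i e e0 = <⇒≢ i₀-pos (sym (trans (sym e) e0))

  i₀-case≢y : ∀ i → i < k → i ≡ i₀ → i ≢ y
  i₀-case≢y i ik e ey = <-irrefl refl (≤-trans ik (≤-reflexive (sym (trans e (i₀-k (λ p → <⇒≱ p (≤-trans (≤-reflexive (sym ey)) (<⇒≤ ik))))))))

  0-case-i+k≢y : ∀ i → i ≡ 0 → y ≢ k → i + k ≢ y
  0-case-i+k≢y i e ny ek = ny (sym (trans (cong (_+ k) (sym e)) ek))

  y-case-i+k≢y : ∀ i → i ≡ y → i + k ≢ y
  y-case-i+k≢y i e ek = <⇒≢ 0<k (sym (+-cancelˡ-≡ i k 0 (trans ek (trans (sym e) (sym (+-identityʳ i))))))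

  linked-walk : ∀ i end s → i < k → EndCaseOK i end → AttachOK i s → Linked (Owned i) (walk i end s)
  linked-walk i end s ik yo so = go end s yo so
    where
    rb : ∀ end → EndCaseOK i end → Owned i W (wOuter i end) × Owned i (wOuter i end) W
    rb end yo = owned-spoke (wOuter i end) i (wOuter<N i end ik) (spokeOwner-wOuter i end ik yo)
    ra : ∀ s → AttachOK i s → Owned i W (wMiddle i s) × Owned i (wMiddle i s) W
    ra s so = owned-spoke (wMiddle i s) i (wMiddle<N i s ik so) (spokeOwner-wMiddle i s ik so)
    XL : Linked (Owned i) (middle i [])
    XL = linked-middle i [] ik [-]
    go : ∀ end s → EndCaseOK i end → AttachOK i s → Linked (Owned i) (walk i end s)
    go at-i₀ true yo so = linked-middle i _ ik (proj₂ (ra true so) ∷ proj₁ (rb at-i₀ yo) ∷ proj₂ (owned-infL i ik (i₀-case≢0 i yo) (i₀-case≢y i ik yo)) ∷ [-])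
    go at-0-y≡k true yo so = linked-middle i _ ik (proj₂ (ra true so) ∷ proj₁ (rb at-0-y≡k yo) ∷ [-])
    go at-0 true yo so = linked-middle i _ ik (proj₂ (ra true so) ∷ proj₁ (rb at-0 yo) ∷ proj₁ (owned-infR i ik (0-case-i+k≢y i (proj₁ yo) (proj₁ (proj₂ yo)))) ∷ [-])
    go at-y true yo so = linked-middle i _ ik (proj₂ (ra true so) ∷ proj₁ (rb at-y yo) ∷ proj₁ (owned-infR i ik (y-case-i+k≢y i (proj₁ yo))) ∷ [-])
    go elsewhere true yo so = linked-middle i _ ik (proj₂ (ra true so) ∷ proj₁ (rb elsewhere yo) ∷ proj₁ (owned-infR i ik (i+k≢y i (proj₂ (proj₂ yo)) (proj₁ yo))) ∷ proj₁ (owned-infL i ik (proj₁ yo) (proj₁ (proj₂ yo))) ∷ [-])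
    go at-i₀ false yo so = proj₁ (owned-infL i ik (i₀-case≢0 i yo) (i₀-case≢y i ik yo)) ∷ proj₂ (rb at-i₀ yo) ∷ proj₁ (ra false so) ∷ XL
    go at-0-y≡k false yo so = proj₂ (rb at-0-y≡k yo) ∷ proj₁ (ra false so) ∷ XL
    go at-0 false yo so = proj₂ (owned-infR i ik (0-case-i+k≢y i (proj₁ yo) (proj₁ (proj₂ yo)))) ∷ proj₂ (rb at-0 yo) ∷ proj₁ (ra false so) ∷ XL
    go at-y false yo so = proj₂ (owned-infR i ik (y-case-i+k≢y i (proj₁ yo))) ∷ proj₂ (rb at-y yo) ∷ proj₁ (ra false so) ∷ XL
    go elsewhere false yo so = proj₂ (owned-infL i ik (proj₁ yo) (proj₁ (proj₂ yo))) ∷ proj₂ (owned-infR i ik (i+k≢y i (proj₂ (proj₂ yo)) (proj₁ yo))) ∷ proj₂ (rb elsewhere yo) ∷ proj₁ (ra false so) ∷ XL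

  off-middle-not-in : ∀ i x rest → i < k → OffMiddle i x → All (x ≢_) rest → All (x ≢_) (middle i rest)
  off-middle-not-in i x rest ik ok a =
    (λ e → plus-off-middle i 0 ik 2≤k (subst (OffMiddle i) e ok)) ∷
    All-zigzag (x ≢_) i 1 (k ∸ 2) _ (λ s ts sl → (λ e → sub-off-middle i s ik ts (sk s sl) (subst (OffMiddle i) e ok)) ,
                                          (λ e → plus-off-middle i s ik (sk2 s sl) (subst (OffMiddle i) e ok)))
      ((λ e → sub-off-middle i (k ∸ 1) ik k1' k-1<k (subst (OffMiddle i) e ok)) ∷ a)
    where
    sk : ∀ s → s < 1 + (k ∸ 2) → s < k
    sk s sl = ≤-trans sl (≤-trans (≤-reflexive (sym (k-1≡suc (k ∸ 2) refl))) (m∸n≤m k 1))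
    sk2 : ∀ s → s < 1 + (k ∸ 2) → suc s < k
    sk2 s sl = ≤-trans (s≤s sl) (≤-trans (≤-reflexive (cong suc (sym (k-1≡suc (k ∸ 2) refl)))) (≤-reflexive (m+[n∸m]≡n 0<k)))
    k1' : 1 ≤ k ∸ 1
    k1' = ≤-trans (s≤s z≤n) (≤-reflexive (sym (k-1≡suc (k ∸ 2) refl)))

  module WalkFacts (i : ℕ) (ik : i < k) where
    i≢ik : i ≢ i + k
    i≢ik e = <⇒≢ 0<k (sym (+-cancelˡ-≡ i k 0 (trans (sym e) (sym (+-identityʳ i)))))
    i≢N : i ≢ N
    i≢N = <⇒≢ (i<N i ik)
    i≢W : i ≢ W
    i≢W = <⇒≢ (≤-trans (i<N i ik) (n≤1+n N))
    ik≢N : i + k ≢ N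
    ik≢N = <⇒≢ (i+k<N i ik)
    ik≢W : i + k ≢ W
    ik≢W = <⇒≢ (≤-trans (i+k<N i ik) (n≤1+n N))
    N≢W : N ≢ W
    N≢W = <⇒≢ (n<1+n N)
    i-off : OffMiddle i i
    i-off = inj₁ refl
    i+k-off : OffMiddle i (i + k)
    i+k-off = inj₂ (inj₁ refl)
    N-off : OffMiddle i N
    N-off = inj₂ (inj₂ ≤-refl)
    W-off : OffMiddle i W
    W-off = inj₂ (inj₂ (n≤1+n N))
    i<n : i < n
    i<n = <N⇒<n i (i<N i ik)
    i+k<n : i + k < n
    i+k<n = <N⇒<n _ (i+k<N i ik)
    N<n : N < n
    N<n = ≤-trans (n<1+n N) (n≤1+n W)
    W<n : W < n
    W<n = ≤-refl
    middle-unique₀ : Unique (middle i [])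
    middle-unique₀ = middle-unique i [] ik [] []
    not-in-middle : ∀ x → OffMiddle i x → All (x ≢_) (middle i [])
    not-in-middle x ok = off-middle-not-in i x [] ik ok []

    walk-unique : ∀ end s → Unique (walk i end s)
    walk-unique at-i₀ true = middle-unique i _ ik ((≢-sym i≢W ∷ ≢-sym N≢W ∷ []) ∷ (i≢N ∷ []) ∷ [] ∷ []) (W-off ∷ i-off ∷ N-off ∷ [])
    walk-unique at-0-y≡k true = middle-unique i _ ik ((≢-sym ik≢W ∷ []) ∷ [] ∷ []) (W-off ∷ i+k-off ∷ [])
    walk-unique at-0 true = middle-unique i _ ik ((≢-sym ik≢W ∷ ≢-sym N≢W ∷ []) ∷ (ik≢N ∷ []) ∷ [] ∷ []) (W-off ∷ i+k-off ∷ N-off ∷ [])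
    walk-unique at-y true = middle-unique i _ ik ((≢-sym ik≢W ∷ ≢-sym N≢W ∷ []) ∷ (ik≢N ∷ []) ∷ [] ∷ []) (W-off ∷ i+k-off ∷ N-off ∷ [])
    walk-unique elsewhere true = middle-unique i _ ik ((≢-sym ik≢W ∷ ≢-sym N≢W ∷ ≢-sym i≢W ∷ []) ∷ (ik≢N ∷ ≢-sym i≢ik ∷ []) ∷ (≢-sym i≢N ∷ []) ∷ [] ∷ []) (W-off ∷ i+k-off ∷ N-off ∷ i-off ∷ [])
    walk-unique at-i₀ false = (≢-sym i≢N ∷ N≢W ∷ not-in-middle N N-off) ∷ (i≢W ∷ not-in-middle i i-off) ∷ not-in-middle W W-off ∷ middle-unique₀
    walk-unique at-0-y≡k false = (ik≢W ∷ not-in-middle (i + k) i+k-off) ∷ not-in-middle W W-off ∷ middle-unique₀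
    walk-unique at-0 false = (≢-sym ik≢N ∷ N≢W ∷ not-in-middle N N-off) ∷ (ik≢W ∷ not-in-middle (i + k) i+k-off) ∷ not-in-middle W W-off ∷ middle-unique₀
    walk-unique at-y false = (≢-sym ik≢N ∷ N≢W ∷ not-in-middle N N-off) ∷ (ik≢W ∷ not-in-middle (i + k) i+k-off) ∷ not-in-middle W W-off ∷ middle-unique₀
    walk-unique elsewhere false = (i≢N ∷ i≢ik ∷ i≢W ∷ not-in-middle i i-off) ∷ (≢-sym ik≢N ∷ N≢W ∷ not-in-middle N N-off) ∷ (ik≢W ∷ not-in-middle (i + k) i+k-off) ∷ not-in-middle W W-off ∷ middle-unique₀

    walk-bounded : ∀ end s → All (_< n) (walk i end s)
    walk-bounded at-i₀ true = bounded-middle i _ ik (W<n ∷ i<n ∷ N<n ∷ [])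
    walk-bounded at-0-y≡k true = bounded-middle i _ ik (W<n ∷ i+k<n ∷ [])
    walk-bounded at-0 true = bounded-middle i _ ik (W<n ∷ i+k<n ∷ N<n ∷ [])
    walk-bounded at-y true = bounded-middle i _ ik (W<n ∷ i+k<n ∷ N<n ∷ [])
    walk-bounded elsewhere true = bounded-middle i _ ik (W<n ∷ i+k<n ∷ N<n ∷ i<n ∷ [])
    walk-bounded at-i₀ false = N<n ∷ i<n ∷ W<n ∷ bounded-middle i [] ik []
    walk-bounded at-0-y≡k false = i+k<n ∷ W<n ∷ bounded-middle i [] ik []
    walk-bounded at-0 false = N<n ∷ i+k<n ∷ W<n ∷ bounded-middle i [] ik []
    walk-bounded at-y false = N<n ∷ i+k<n ∷ W<n ∷ bounded-middle i [] ik []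
    walk-bounded elsewhere false = i<n ∷ N<n ∷ i+k<n ∷ W<n ∷ bounded-middle i [] ik []

  open WalkFacts using (walk-unique; walk-bounded)

  EdgeIn-prefix : ∀ xs {u v} l → EdgeInℕ u v l → EdgeInℕ u v (xs ++ l)
  EdgeIn-prefix [] l e = e
  EdgeIn-prefix (x ∷ xs) l e = there (EdgeIn-prefix xs l e)

  EdgeIn-walk-middle : ∀ i end s P → Valid P → ((Σ ℕ λ t → P ≡ dn t) ⊎ (Σ ℕ λ t → P ≡ up t × 1 ≤ t × t < k ∸ 1)) →
    EdgeInℕ (proj₁ (pair i P)) (proj₂ (pair i P)) (walk i end s)
  EdgeIn-walk-middle i end true .(dn t) v (inj₁ (t , refl)) = EdgeIn-middle-dn i _ t v
  EdgeIn-walk-middle i end false .(dn t) v (inj₁ (t , refl)) = EdgeIn-prefix (endsBefore i end) _ (there (EdgeIn-middle-dn i [] t v))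
  EdgeIn-walk-middle i end true .(up t) v (inj₂ (t , refl , t1 , tk)) = EdgeIn-middle-up i _ t t1 tk
  EdgeIn-walk-middle i end false .(up t) v (inj₂ (t , refl , t1 , tk)) = EdgeIn-prefix (endsBefore i end) _ (there (EdgeIn-middle-up i [] t t1 tk))

  EdgeIn-walk-infL : ∀ i end s → EndCaseOK i end → i ≢ 0 → i ≢ y → EdgeInℕ N i (walk i end s)
  EdgeIn-walk-infL i at-i₀ true _ _ _ = EdgeIn-middle-rest i _ (there (there (here (inj₂ (refl , refl)))))
  EdgeIn-walk-infL i at-i₀ false _ _ _ = here (inj₁ (refl , refl))
  EdgeIn-walk-infL i elsewhere true _ _ _ = EdgeIn-middle-rest i _ (there (there (there (here (inj₁ (refl , refl))))))
  EdgeIn-walk-infL i elsewhere false _ _ _ = here (inj₂ (refl , refl))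
  EdgeIn-walk-infL i at-0-y≡k s (e , _) n0 _ = ⊥-elim (n0 e)
  EdgeIn-walk-infL i at-0 s (e , _) n0 _ = ⊥-elim (n0 e)
  EdgeIn-walk-infL i at-y s (e , _) _ ny = ⊥-elim (ny e)

  EdgeIn-walk-infR : ∀ i end s → i < k → EndCaseOK i end → i + k ≢ y → EdgeInℕ (i + k) N (walk i end s)
  EdgeIn-walk-infR i at-0 true ik _ _ = EdgeIn-middle-rest i _ (there (there (here (inj₁ (refl , refl)))))
  EdgeIn-walk-infR i at-0 false ik _ _ = here (inj₂ (refl , refl))
  EdgeIn-walk-infR i at-y true ik _ _ = EdgeIn-middle-rest i _ (there (there (here (inj₁ (refl , refl)))))
  EdgeIn-walk-infR i at-y false ik _ _ = here (inj₂ (refl , refl))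
  EdgeIn-walk-infR i elsewhere true ik _ _ = EdgeIn-middle-rest i _ (there (there (here (inj₁ (refl , refl)))))
  EdgeIn-walk-infR i elsewhere false ik _ _ = there (here (inj₂ (refl , refl)))
  EdgeIn-walk-infR i at-i₀ s ik e ne = ⊥-elim (ne (trans (cong (_+ k) e) (i₀-y (subst (_< k) e ik))))
  EdgeIn-walk-infR i at-0-y≡k s ik (e , ey , _) ne = ⊥-elim (ne (trans (cong (_+ k) e) (sym ey)))

  EdgeIn-walk-wOuter : ∀ i end s → EdgeInℕ W (wOuter i end) (walk i end s)
  EdgeIn-walk-wOuter i at-i₀ true = EdgeIn-middle-rest i _ (there (here (inj₁ (refl , refl))))
  EdgeIn-walk-wOuter i at-0-y≡k true = EdgeIn-middle-rest i _ (there (here (inj₁ (refl , refl))))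
  EdgeIn-walk-wOuter i at-0 true = EdgeIn-middle-rest i _ (there (here (inj₁ (refl , refl))))
  EdgeIn-walk-wOuter i at-y true = EdgeIn-middle-rest i _ (there (here (inj₁ (refl , refl))))
  EdgeIn-walk-wOuter i elsewhere true = EdgeIn-middle-rest i _ (there (here (inj₁ (refl , refl))))
  EdgeIn-walk-wOuter i at-i₀ false = there (here (inj₂ (refl , refl)))
  EdgeIn-walk-wOuter i at-0-y≡k false = here (inj₂ (refl , refl))
  EdgeIn-walk-wOuter i at-0 false = there (here (inj₂ (refl , refl)))
  EdgeIn-walk-wOuter i at-y false = there (here (inj₂ (refl , refl)))
  EdgeIn-walk-wOuter i elsewhere false = there (there (here (inj₂ (refl , refl))))

  EdgeIn-walk-wMiddle : ∀ i end s → EdgeInℕ W (wMiddle i s) (walk i end s)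
  EdgeIn-walk-wMiddle i end true = EdgeIn-middle-rest i _ (here (inj₂ (refl , refl)))
  EdgeIn-walk-wMiddle i end false = EdgeIn-prefix (endsBefore i end) _ (here (inj₁ (refl , refl)))

  extraLength : ℕ
  extraLength = N ∸ suc y

  extraPath-length : N ∸ y ≡ suc extraLength
  extraPath-length = ∸≡suc∸suc y N y<2k

  y+extraLength : y + extraLength ≡ N ∸ 1
  y+extraLength = trans (sym (+-∸-assoc y {N} {suc y} y<2k)) (trans (cong (_∸ suc y) (+-comm y N)) (cancel N y))
    where
    cancel : ∀ a b → (a + b) ∸ suc b ≡ a ∸ 1
    cancel a zero = cong (_∸ 1) (+-identityʳ a)
    cancel a (suc b) = trans (cong (_∸ suc (suc b)) (+-suc a b)) (cancel a b)

  k-1+k : (k ∸ 1) + suc (k ∸ 1) ≡ N ∸ 1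
  k-1+k = double k 0<k
    where
    double : ∀ K → 1 ≤ K → (K ∸ 1) + suc (K ∸ 1) ≡ (K + K) ∸ 1
    double (suc K) _ = refl

  extra-up0 : ∀ x → ¬ (x < y) → classifyWalecki x (up 0) ≡ onPath k
  extra-up0 x h with x <? y
  ... | yes p = ⊥-elim (h p)
  ... | no _ = refl

  extra-upK : ∀ j → ¬ (j + k < y) → classifyWalecki j (up (k ∸ 1)) ≡ onPath k
  extra-upK j h with k ∸ 1 ≟ 0 | k ∸ 1 ≟ k ∸ 1
  ... | yes e | _ = ⊥-elim (k-1≢0 e)
  ... | no _ | no p = ⊥-elim (p refl)
  ... | no _ | yes _ with j + k <? y
  ...   | yes p = ⊥-elim (h p)
  ...   | no _ = refl

  owned-extra-high : ∀ x → k ≤ x → y ≤ x → suc x < N → Owned k x (x + 1)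
  owned-extra-high x kx yx x1 = subst₂ (Owned k) (trans (plus-k j) xe) (trans (sub-k-1 j jk j1) (trans (+-suc j k) (trans (cong suc xe) (+-comm 1 x))))
      (proj₂ (owned-coord (walecki j (up (k ∸ 1))) k (jk , k-1<k) (extra-upK j (λ p → <⇒≱ p (≤-trans yx (≤-reflexive (sym xe)))))))
    where
    j : ℕ
    j = x ∸ k
    xe : j + k ≡ x
    xe = m∸n+n≡m kx
    jk : j < k
    jk = +-cancelʳ-< k j k (≤-trans (s≤s (≤-reflexive xe)) (<⇒≤ x1))
    j1 : j + suc k < N
    j1 = ≤-trans (s≤s (≤-reflexive (trans (+-suc j k) (cong suc xe)))) x1

  owned-extra-last : Owned k (N ∸ 1) 0
  owned-extra-last = subst₂ (Owned k) k-1+k sub-self (proj₂ (owned-coord (walecki (k ∸ 1) (up (k ∸ 1))) k (k-1<k , k-1<k) (extra-upK (k ∸ 1) nlt)))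
    where
    nlt : ¬ ((k ∸ 1) + k < y)
    nlt p = <⇒≱ p (≤-trans (m≤m+n y extraLength) (≤-reflexive (trans y+extraLength (trans (sym k-1+k) (plus-k (k ∸ 1))))))

  yx<N : ∀ x → x < y + extraLength → suc x < N
  yx<N x h = ≤-trans (s≤s (≤-trans h (≤-reflexive y+extraLength))) (≤-reflexive (m+[n∸m]≡n {1} {N} (≤-trans (s≤s z≤n) y<2k)))

  linked-extra : Linked (Owned k) extraPath
  linked-extra rewrite extraPath-length = ascending-linked (Owned k) y extraLength (0 ∷ []) h (subst (λ z → Linked (Owned k) (z ∷ 0 ∷ [])) (sym y+extraLength) (owned-extra-last ∷ [-]))
    where
    h : ∀ x → y ≤ x → x < y + extraLength → Owned k x (x + 1)
    h x yx xl with x <? k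
    ... | yes xk = proj₁ (owned-coord (walecki x (up 0)) k (xk , 0<k) (extra-up0 x (λ p → <⇒≱ p yx)))
    ... | no xk = owned-extra-high x (≮⇒≥ xk) yx (yx<N x xl)

  extra-unique : Unique extraPath
  extra-unique = ascending-unique y (N ∸ y) (0 ∷ []) ([] ∷ []) ((λ r → <⇒≱ 1≤y (proj₁ r)) ∷ [])

  extra-bounded : All (_< n) extraPath
  extra-bounded = All-ascending (_< n) y (N ∸ y) (0 ∷ []) (λ x _ xl → <N⇒<n x (≤-trans xl (≤-reflexive (m+[n∸m]≡n y≤N)))) (s≤s z≤n ∷ [])

  EdgeIn-extra-up0 : ∀ j → j < k → ¬ (j < y) → EdgeInℕ (sub j 0) (j + 1) extraPath
  EdgeIn-extra-up0 j jk nj rewrite extraPath-length = EdgeIn-ascending y extraLength (0 ∷ []) j (≮⇒≥ nj) jl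
    where
    jl : j < y + extraLength
    jl = ≤-trans jk (≤-trans (m≤n+m k (k ∸ 1)) (≤-reflexive (trans (sym (plus-k (k ∸ 1))) (trans k-1+k (sym y+extraLength)))))

  EdgeIn-extra-upK : ∀ j → j < k → ¬ (j + k < y) → EdgeInℕ (sub j (k ∸ 1)) (j + suc (k ∸ 1)) extraPath
  EdgeIn-extra-upK j jk nj with suc j ≟ k
  ... | yes e = subst₂ (λ a b → EdgeInℕ a b extraPath) (sym (trans (cong (λ z → sub z (k ∸ 1)) je) sub-self)) (trans (trans y+extraLength (sym k-1+k)) (cong (λ z → z + suc (k ∸ 1)) (sym je)))
                  (EdgeIn-sym (subst (λ l → EdgeInℕ (y + extraLength) 0 l) (cong (λ z → ascending y z (0 ∷ [])) (sym extraPath-length)) (EdgeIn-ascending-last y extraLength 0 [])))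
    where
    je : j ≡ k ∸ 1
    je = trans (sym (m+n∸m≡n 1 j)) (cong (_∸ 1) e)
  ... | no ne = subst₂ (λ a b → EdgeInℕ a b extraPath) (sym (trans (sub-k-1 j jk j1) (trans (+-suc j k) (+-comm 1 (j + k))))) (sym (plus-k j))
                  (EdgeIn-sym (subst (λ l → EdgeInℕ (j + k) (j + k + 1) l) (cong (λ z → ascending y z (0 ∷ [])) (sym extraPath-length)) (EdgeIn-ascending y extraLength (0 ∷ []) (j + k) (≮⇒≥ nj) xl)))
    where
    jk' : suc j < k
    jk' = ≤∧≢⇒< jk ne
    j1 : j + suc k < N
    j1 = ≤-trans (≤-reflexive (cong suc (+-suc j k))) (+-monoˡ-≤ k jk')
    xl : j + k < y + extraLength
    xl = ≤-trans (+-monoˡ-≤ k (≤-pred (≤-trans jk' (≤-reflexive (sym (m+[n∸m]≡n 0<k)))))) (≤-reflexive (trans (sym (plus-k (k ∸ 1))) (trans k-1+k (sym y+extraLength))))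

  wMiddle-last : ∀ i → (suc i ≡ i₀ ⊎ suc i ≡ k) → wMiddle i (attachLast i) ≡ sub i (k ∸ 1)
  wMiddle-last i h with attachLast i | attach-ok i
  ... | true | _ = refl
  ... | false | (n1 , n2) = ⊥-elim ([ n1 , n2 ]′ h)

  wMiddle-first : ∀ i → suc i ≢ i₀ → suc i ≢ k → wMiddle i (attachLast i) ≡ i + 1
  wMiddle-first i n1 n2 with attachLast i | attach-ok i
  ... | false | _ = refl
  ... | true | inj₁ e = ⊥-elim (n1 e)
  ... | true | inj₂ e = ⊥-elim (n2 e)

  wOuter-i₀ : wOuter i₀ (endCase i₀) ≡ i₀
  wOuter-i₀ with endCase i₀ | endCase-ok i₀
  ... | at-i₀ | _ = refl
  ... | at-0-y≡k | (_ , _ , p) = ⊥-elim (p refl)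
  ... | at-0 | (_ , _ , p) = ⊥-elim (p refl)
  ... | at-y | (_ , _ , p) = ⊥-elim (p refl)
  ... | elsewhere | (_ , _ , p) = ⊥-elim (p refl)

  wOuter-other : ∀ i → i ≢ i₀ → wOuter i (endCase i) ≡ i + k
  wOuter-other i ne with endCase i | endCase-ok i
  ... | at-i₀ | e = ⊥-elim (ne e)
  ... | at-0-y≡k | _ = refl
  ... | at-0 | _ = refl
  ... | at-y | _ = refl
  ... | elsewhere | _ = refl

  spokeOwner-spec : ∀ x → x < N → spokeOwner x < k × (x ≡ wMiddle (spokeOwner x) (attachLast (spokeOwner x)) ⊎ x ≡ wOuter (spokeOwner x) (endCase (spokeOwner x)))
  spokeOwner-spec x xN with x <? k
  ... | yes xk with x ≟ 0 | x ≟ i₀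
  ...   | yes refl | _ = k-1<k , inj₁ (sym (trans (wMiddle-last (k ∸ 1) (inj₂ (m+[n∸m]≡n 0<k))) sub-self))
  ...   | no _ | yes e = subst (_< k) e xk , inj₂ (trans e (sym wOuter-i₀))
  ...   | no n0 | no ni = ≤-trans (s≤s (m∸n≤m x 1)) xk , inj₁ (sym (trans (wMiddle-first (x ∸ 1) (λ e → ni (trans (sym sx) e)) (λ e → <⇒≢ xk (trans (sym sx) e))) (trans (+-comm (x ∸ 1) 1) sx)))
    where
    sx : suc (x ∸ 1) ≡ x
    sx = m+[n∸m]≡n {1} (≤∧≢⇒< z≤n (λ e → n0 (sym e)))
  spokeOwner-spec x xN | no xk with x ∸ k ≟ i₀
  ...   | yes e = ik' , inj₁ (sym (trans (wMiddle-last (i₀ ∸ 1) (inj₁ si)) (trans (sub-k-1 (i₀ ∸ 1) ik' j1) xv)))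
    where
    si : suc (i₀ ∸ 1) ≡ i₀
    si = m+[n∸m]≡n i₀-pos
    xv : (i₀ ∸ 1) + suc k ≡ x
    xv = trans (+-suc (i₀ ∸ 1) k) (trans (cong (_+ k) si) (trans (cong (_+ k) (sym e)) (m∸n+n≡m (≮⇒≥ xk))))
    ik' : i₀ ∸ 1 < k
    ik' = ≤-trans (≤-reflexive si) (<⇒≤ (+-cancelʳ-< k i₀ k (≤-trans (≤-reflexive (cong suc (trans (cong (_+ k) (sym e)) (m∸n+n≡m (≮⇒≥ xk))))) xN)))
    j1 : (i₀ ∸ 1) + suc k < N
    j1 = subst (_< N) (sym xv) xN
  ...   | no ne = jk , inj₂ (sym (trans (wOuter-other (x ∸ k) ne) (m∸n+n≡m (≮⇒≥ xk))))
    where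
    jk : x ∸ k < k
    jk = +-cancelʳ-< k (x ∸ k) k (≤-trans (s≤s (≤-reflexive (m∸n+n≡m (≮⇒≥ xk)))) xN)

  paths-walk : ∀ i → i < k → paths i ≡ walk i (endCase i) (attachLast i)
  paths-walk i ik with i ≟ k
  ... | yes e = ⊥-elim (<⇒≢ ik e)
  ... | no _ = refl

  paths-k : paths k ≡ extraPath
  paths-k with k ≟ k
  ... | yes _ = refl
  ... | no p = ⊥-elim (p refl)

  EdgeIn-spoke : ∀ x → x < N → EdgeInℕ W x (paths (spokeOwner x))
  EdgeIn-spoke x xN with spokeOwner-spec x xN
  ... | ik , inj₁ e rewrite paths-walk (spokeOwner x) ik = subst (λ z → EdgeInℕ W z (walk (spokeOwner x) (endCase (spokeOwner x)) (attachLast (spokeOwner x)))) (sym e) (EdgeIn-walk-wMiddle (spokeOwner x) (endCase (spokeOwner x)) (attachLast (spokeOwner x)))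
  ... | ik , inj₂ e rewrite paths-walk (spokeOwner x) ik = subst (λ z → EdgeInℕ W z (walk (spokeOwner x) (endCase (spokeOwner x)) (attachLast (spokeOwner x)))) (sym e) (EdgeIn-walk-wOuter (spokeOwner x) (endCase (spokeOwner x)) (attachLast (spokeOwner x)))

  EdgeIn-paths : ∀ ep i → ValidCoord ep → classify ep ≡ onPath i → EdgeInℕ (proj₁ (coordPair ep)) (proj₂ (coordPair ep)) (paths i)
  EdgeIn-paths (spoke x) i xN e with x ≟ N
  ... | yes _ = ⊥-elim (tadpole≢onPath e)
  ... | no not-in-middle rewrite sym (onPath-injective e) = EdgeIn-spoke x (≤∧≢⇒< xN not-in-middle)
  EdgeIn-paths (walecki j infL) i (jk , v) e with j ≟ 0 | j ≟ y
  ... | yes _ | _ = ⊥-elim (tadpole≢onPath e)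
  ... | no _ | yes _ = ⊥-elim (tadpole≢onPath e)
  ... | no n0 | no ny rewrite sym (onPath-injective e) | paths-walk j jk = EdgeIn-walk-infL j (endCase j) (attachLast j) (endCase-ok j) n0 ny
  EdgeIn-paths (walecki j infR) i (jk , v) e with j + k ≟ y
  ... | yes _ = ⊥-elim (tadpole≢onPath e)
  ... | no ne rewrite sym (onPath-injective e) | paths-walk j jk = EdgeIn-walk-infR j (endCase j) (attachLast j) jk (endCase-ok j) ne
  EdgeIn-paths (walecki j (dn t)) i (jk , v) e rewrite sym (onPath-injective e) | paths-walk j jk = EdgeIn-walk-middle j (endCase j) (attachLast j) (dn t) v (inj₁ (t , refl))
  EdgeIn-paths (walecki j (up t)) i (jk , tk) e with t ≟ 0 | t ≟ k ∸ 1
  ... | yes refl | _ = g e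
    where
    g : classifyWalecki j (up 0) ≡ onPath i → EdgeInℕ (sub j 0) (j + 1) (paths i)
    g e' with j <? y
    ... | yes _ = ⊥-elim (tadpole≢onPath e')
    ... | no nj rewrite sym (onPath-injective e') | paths-k = EdgeIn-extra-up0 j jk nj
  ... | no t0 | yes refl with j + k <? y
  ...   | yes _ = ⊥-elim (tadpole≢onPath e)
  ...   | no nj rewrite sym (onPath-injective e) | paths-k = EdgeIn-extra-upK j jk nj
  EdgeIn-paths (walecki j (up t)) i (jk , tk) e | no t0 | no tK rewrite sym (onPath-injective e) | paths-walk j jk =
    EdgeIn-walk-middle j (endCase j) (attachLast j) (up t) tk (inj₂ (t , refl , ≤∧≢⇒< z≤n (λ x → t0 (sym x)) , ≤∧≢⇒< (≤-pred (≤-trans tk (≤-reflexive (sym (m+[n∸m]≡n 0<k))))) tK))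

  class-range : ∀ ep i → ValidCoord ep → classify ep ≡ onPath i → i ≤ k
  class-range (spoke x) i xN e with x ≟ N
  ... | yes _ = ⊥-elim (tadpole≢onPath e)
  ... | no not-in-middle = subst (_≤ k) (onPath-injective e) (<⇒≤ (proj₁ (spokeOwner-spec x (≤∧≢⇒< xN not-in-middle))))
  class-range (walecki j infL) i (jk , v) e with j ≟ 0 | j ≟ y
  ... | yes _ | _ = ⊥-elim (tadpole≢onPath e)
  ... | no _ | yes _ = ⊥-elim (tadpole≢onPath e)
  ... | no _ | no _ = subst (_≤ k) (onPath-injective e) (<⇒≤ jk)
  class-range (walecki j infR) i (jk , v) e with j + k ≟ y
  ... | yes _ = ⊥-elim (tadpole≢onPath e)
  ... | no _ = subst (_≤ k) (onPath-injective e) (<⇒≤ jk)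
  class-range (walecki j (dn t)) i (jk , v) e = subst (_≤ k) (onPath-injective e) (<⇒≤ jk)
  class-range (walecki j (up t)) i (jk , tk) e with t ≟ 0 | t ≟ k ∸ 1
  ... | yes refl | _ = g e
    where
    g : classifyWalecki j (up 0) ≡ onPath i → i ≤ k
    g e' with j <? y
    ... | yes _ = ⊥-elim (tadpole≢onPath e')
    ... | no _ = subst (_≤ k) (onPath-injective e') ≤-refl
  ... | no t0 | yes refl with j + k <? y
  ...   | yes _ = ⊥-elim (tadpole≢onPath e)
  ...   | no _ = subst (_≤ k) (onPath-injective e) ≤-refl
  class-range (walecki j (up t)) i (jk , tk) e | no t0 | no tK = subst (_≤ k) (onPath-injective e) (<⇒≤ jk)

  PathFacts : ℕ → Set
  PathFacts i = All (_< n) (paths i) × Unique (paths i) × Linked (Owned i) (paths i)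

  path-facts : ∀ i → i ≤ k → PathFacts i
  path-facts i ik = go (i ≟ k)
    where
    at-k : PathFacts k
    at-k rewrite paths-k = extra-bounded , extra-unique , linked-extra
    below-k : i < k → PathFacts i
    below-k ik' rewrite paths-walk i ik' = walk-bounded i ik' (endCase i) (attachLast i) , walk-unique i ik' (endCase i) (attachLast i) , linked-walk i (endCase i) (attachLast i) ik' (endCase-ok i) (attach-ok i)
    go : Dec (i ≡ k) → PathFacts i
    go (yes e) = subst PathFacts (sym e) at-k
    go (no ne) = below-k (≤∧≢⇒< ik ne)

  m≡ : m ≡ suc (suc y)
  m≡ = cong suc (trans (length-ascending 0 (suc y) []) (cong suc (+-identityʳ y)))

  vertices-ok : All (_< n) vertices × Unique vertices
  vertices-ok = subst (λ l → All (_< n) l × Unique l) (sym (cong (N ∷_) (ascending-++ 0 (suc y) [] (W ∷ [])))) (a , u)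
    where
    a : All (_< n) (N ∷ ascending 0 (suc y) (W ∷ []))
    a = ≤-trans (n<1+n N) (n≤1+n W) ∷ All-ascending (_< n) 0 (suc y) (W ∷ []) (λ x _ xl → <N⇒<n x (≤-trans xl y<2k)) (≤-refl ∷ [])
    u : Unique (N ∷ ascending 0 (suc y) (W ∷ []))
    u = All-ascending (N ≢_) 0 (suc y) (W ∷ []) (λ x _ xl e → <⇒≢ (≤-trans xl y<2k) (sym e)) (<⇒≢ (n<1+n N) ∷ []) ∷
        ascending-unique 0 (suc y) (W ∷ []) ([] ∷ []) ((λ r → <⇒≱ (≤-trans (proj₂ r) (≤-trans y<2k (n≤1+n N))) ≤-refl) ∷ [])

  decomposition : ∀ {m′} → suc (suc y) ≡ m′ → (f : Fin (suc m′) → Fin n) → Injective _≡_ _≡_ f →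
    Σ (Fin (suc k) → List (Fin n)) (IsPathDecomposition (KminusT f) (suc k))
  decomposition e = transport-decomposition (trans m≡ e) (proj₁ vertices-ok) (proj₂ vertices-ok)
    (owned-decomposition T⇒tadpole paths path-facts tadpole-class-edge (λ e i v c → class-range e i v c , EdgeIn-paths e i v c))

module OrderFour where

  open import Function.Definitions using (Injective)
  open Relabelling using (EdgeInℕ; here; there; OwnedDecomposition; TadpoleAdj; TadpoleAdj-sym)
  open TadpoleLists
  open import Data.Nat using (ℕ; suc; _<_; z≤n; s≤s)
  open import Data.Fin using (Fin; zero)
  open import Data.List using (List; []; _∷_)
  open import Data.List.Relation.Unary.All using (All; []; _∷_)
  open import Data.List.Relation.Unary.Unique.Propositional using (Unique)
  open import Data.List.Relation.Unary.AllPairs using ([]; _∷_)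
  open import Data.List.Relation.Unary.Linked using ([-]; _∷_)
  open import Data.Product using (Σ; _,_)
  open import Data.Sum using (inj₁; inj₂)
  open import Data.Empty using (⊥-elim)
  open import Relation.Nullary using (¬_)
  open import Relation.Binary.PropositionalEquality using (_≡_; _≢_; refl)

  open ListTadpole 0 (1 ∷ 2 ∷ []) 3 public

  path : Fin 1 → List ℕ
  path _ = 1 ∷ 3 ∷ 2 ∷ []

  owner : ℕ → ℕ → Fin 1
  owner _ _ = zero

  not-into-3 : ∀ {a} → ¬ Consecutive a 3 cycle
  not-into-3 (there (there (there ())))

  not-from-3 : ∀ {b} → ¬ Consecutive 3 b cycle
  not-from-3 (there (there (there ())))

  only-pendant-at-3 : ∀ {a} → TadpoleAdj m vertex a 3 → a ≡ 0
  only-pendant-at-3 (inj₁ t) with edge-cases t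
  ... | inj₁ c = ⊥-elim (not-into-3 c)
  ... | inj₂ (inj₂ (refl , _)) = refl
  only-pendant-at-3 (inj₂ t) with edge-cases t
  ... | inj₁ c = ⊥-elim (not-from-3 c)
  ... | inj₂ (inj₁ (() , _))
  ... | inj₂ (inj₂ (() , _))

  01∈T : TadpoleAdj m vertex 0 1
  01∈T = inj₁ (consecutive-edge here)

  12∈T : TadpoleAdj m vertex 1 2
  12∈T = inj₁ (consecutive-edge (there here))

  20∈T : TadpoleAdj m vertex 2 0
  20∈T = inj₁ closing-edge

  03∈T : TadpoleAdj m vertex 0 3
  03∈T = inj₁ pendant-edge

  covers : ∀ a b → a < 4 → b < 4 → a ≢ b → ¬ TadpoleAdj m vertex a b → EdgeInℕ a b (path (owner a b))
  covers 0 0 _ _ a≢b _ = ⊥-elim (a≢b refl)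
  covers 0 1 _ _ _ ¬t = ⊥-elim (¬t 01∈T)
  covers 0 2 _ _ _ ¬t = ⊥-elim (¬t (TadpoleAdj-sym 20∈T))
  covers 0 3 _ _ _ ¬t = ⊥-elim (¬t 03∈T)
  covers 1 0 _ _ _ ¬t = ⊥-elim (¬t (TadpoleAdj-sym 01∈T))
  covers 1 1 _ _ a≢b _ = ⊥-elim (a≢b refl)
  covers 1 2 _ _ _ ¬t = ⊥-elim (¬t 12∈T)
  covers 1 3 _ _ _ _ = here (inj₁ (refl , refl))
  covers 2 0 _ _ _ ¬t = ⊥-elim (¬t 20∈T)
  covers 2 1 _ _ _ ¬t = ⊥-elim (¬t (TadpoleAdj-sym 12∈T))
  covers 2 2 _ _ a≢b _ = ⊥-elim (a≢b refl)
  covers 2 3 _ _ _ _ = there (here (inj₂ (refl , refl)))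
  covers 3 0 _ _ _ ¬t = ⊥-elim (¬t (TadpoleAdj-sym 03∈T))
  covers 3 1 _ _ _ _ = here (inj₂ (refl , refl))
  covers 3 2 _ _ _ _ = there (here (inj₁ (refl , refl)))
  covers 3 3 _ _ a≢b _ = ⊥-elim (a≢b refl)
  covers (suc (suc (suc (suc _)))) _ (s≤s (s≤s (s≤s (s≤s ())))) _ _ _
  covers _ (suc (suc (suc (suc _)))) _ (s≤s (s≤s (s≤s (s≤s ())))) _ _

  1≢0 : 1 ≢ 0
  1≢0 ()

  2≢0 : 2 ≢ 0
  2≢0 ()

  owned-decomposition : OwnedDecomposition 4 1 (TadpoleAdj m vertex) path owner
  owned-decomposition = record
    { bounded = λ _ → s≤s (s≤s z≤n) ∷ s≤s (s≤s (s≤s (s≤s z≤n))) ∷ s≤s (s≤s (s≤s z≤n)) ∷ []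
    ; unique  = λ _ → ((λ ()) ∷ (λ ()) ∷ []) ∷ ((λ ()) ∷ []) ∷ [] ∷ []
    ; linked  = λ { zero → ((λ ()) , (λ t → ⊥-elim (1≢0 (only-pendant-at-3 t))) , refl , refl)
                         ∷ ((λ ()) , (λ t → ⊥-elim (2≢0 (only-pendant-at-3 (TadpoleAdj-sym t)))) , refl , refl) ∷ [-] }
    ; covers  = covers
    }

  vertices-bounded : All (_< 4) vertices
  vertices-bounded = s≤s z≤n ∷ s≤s (s≤s z≤n) ∷ s≤s (s≤s (s≤s z≤n)) ∷ s≤s (s≤s (s≤s (s≤s z≤n))) ∷ []

  vertices-unique : Unique vertices
  vertices-unique = ((λ ()) ∷ (λ ()) ∷ (λ ()) ∷ []) ∷ ((λ ()) ∷ (λ ()) ∷ []) ∷ ((λ ()) ∷ []) ∷ [] ∷ []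

  decomposition : (f : Fin 4 → Fin 4) → Injective _≡_ _≡_ f → Σ (Fin 1 → List (Fin 4)) (IsPathDecomposition (KminusT f) 1)
  decomposition = transport-decomposition refl vertices-bounded vertices-unique owned-decomposition

BoundedDecomposition : (n m : ℕ) → (Fin (suc m) → Fin n) → Set
BoundedDecomposition n m f =
  Σ ℕ λ K → Σ (Fin K → List (Fin n)) λ P → K ≤ suc n / 2 × IsPathDecomposition (KminusT f) K P

half-of-odd : ∀ k → suc (suc (k + k)) / 2 ≡ suc k
half-of-odd k = trans (cong (_/ 2) (sym (double k))) (m*n/n≡m (suc k) 2)
  where
  double : ∀ k → suc k * 2 ≡ suc (suc (k + k))
  double = solve-∀

data OrderParity : ℕ → Set where
  odd  : ∀ k → OrderParity (suc (k + k))
  even : ∀ k → OrderParity (suc (suc (k + k)))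

orderParity : ∀ n → OrderParity (suc n)
orderParity zero = odd 0
orderParity (suc n) with orderParity n
... | odd k = even k
... | even k = subst OrderParity (cong (λ z → suc (suc z)) (+-suc k k)) (odd (suc k))

odd-order : ∀ k m → 3 ≤ m → m ≤ k + k → (f : Fin (suc m) → Fin (suc (k + k))) → Injective _≡_ _≡_ f →
  BoundedDecomposition (suc (k + k)) m f
odd-order k m 3≤m m≤2k f f-inj = suc k , proj₁ D , ≤-reflexive (sym (half-of-odd k)) , proj₂ D
  where
  2≤m : 2 ≤ m
  2≤m = ≤-trans (n≤1+n 2) 3≤m
  2≤k : 2 ≤ k
  2≤k = ≮⇒≥ λ k<2 → <⇒≱ (≤-trans 3≤m m≤2k) (+-mono-≤ (≤-pred k<2) (≤-pred k<2))
  D : Σ (Fin (suc k) → List (Fin (suc (k + k)))) (IsPathDecomposition (KminusT f) (suc k))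
  D with m ≤? k + 2
  ... | yes m≤k+2 =
    OddOrder.decomposition k 0 (m ∸ 2) 2≤k (+-cancelˡ-≤ 2 1 (m ∸ 2) (subst (3 ≤_) (sym (m+[n∸m]≡n 2≤m)) 3≤m))
      (+-cancelˡ-≤ 2 (m ∸ 2) k (subst (_≤ 2 + k) (sym (m+[n∸m]≡n 2≤m)) (subst (m ≤_) (+-comm k 2) m≤k+2)))
      2≤k (inj₁ refl) (trans (+-comm (m ∸ 2) 2) (m+[n∸m]≡n 2≤m)) f f-inj
  ... | no m≰k+2 =
    OddOrder.decomposition k (m ∸ (k + 2)) k 2≤k (≤-trans (n≤1+n _) c+2≤k) ≤-refl c+2≤k (inj₂ refl) k+c+2≡m f f-inj
    where
    k+c+2≡m : k + suc (suc (m ∸ (k + 2))) ≡ m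
    k+c+2≡m = trans (sym (+-assoc k 2 (m ∸ (k + 2)))) (m+[n∸m]≡n (<⇒≤ (≰⇒> m≰k+2)))
    c+2≤k : suc (suc (m ∸ (k + 2))) ≤ k
    c+2≤k = +-cancelˡ-≤ k _ k (subst (_≤ k + k) (sym k+c+2≡m) m≤2k)

even-order : ∀ k m → 2 ≤ k → 3 ≤ m → m ≤ suc (k + k) → (f : Fin (suc m) → Fin (suc (suc (k + k)))) → Injective _≡_ _≡_ f →
  BoundedDecomposition (suc (suc (k + k))) m f
even-order k m 2≤k 3≤m m≤2k+1 f f-inj =
  suc k , proj₁ D , subst (_≤ suc (suc (suc (k + k))) / 2) (half-of-odd k) (/-monoˡ-≤ {suc (suc (k + k))} 2 (n≤1+n _)) , proj₂ D
  where
  2≤m : 2 ≤ m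
  2≤m = ≤-trans (n≤1+n 2) 3≤m
  m≡ : suc (suc (m ∸ 2)) ≡ m
  m≡ = m+[n∸m]≡n 2≤m
  D : Σ (Fin (suc k) → List (Fin (suc (suc (k + k))))) (IsPathDecomposition (KminusT f) (suc k))
  D = EvenOrder.decomposition k (m ∸ 2) 2≤k (≤-pred (≤-pred (subst (3 ≤_) (sym m≡) 3≤m)))
        (≤-pred (subst (_≤ suc (k + k)) (sym m≡) m≤2k+1)) m≡ f f-inj

theorem2 : (n m : ℕ) → 2 ≤ n → 3 ≤ m → m ≤ n ∸ 1 →
    (f : Fin (suc m) → Fin n) → Injective _≡_ _≡_ f →
    Σ ℕ λ k → Σ (Fin k → List (Fin n)) λ P →
      k ≤ (suc n) / 2 × IsPathDecomposition (KminusT f) k P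
theorem2 (suc n) m _ 3≤m m≤n f f-inj with orderParity n
... | odd k = odd-order k m 3≤m m≤n f f-inj
... | even 0 = ⊥-elim (<⇒≱ 3≤m (≤-trans m≤n (s≤s z≤n)))
... | even 1 with ≤-antisym m≤n 3≤m
...   | refl = 1 , proj₁ (OrderFour.decomposition f f-inj) , s≤s z≤n , proj₂ (OrderFour.decomposition f f-inj)
theorem2 (suc n) m _ 3≤m m≤n f f-inj | even (suc (suc k)) =
  even-order (suc (suc k)) m (s≤s (s≤s z≤n)) 3≤m m≤n f f-inj
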